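{- Let $\vec G$ be any orientation of the Coxeter diagram of $S_n$, with up indices determined as in the context. For every transposition $(m,M)$ with $1\le m<M\le n$, there is a unique join-irreducible element $\gamma$ of the weak order on $S_n$ which is not contracted by the Cambrian congruence $\Theta(\vec G)$ and whose associated left reflection is $(m,M)$. The subset of $[n]$ associated to this $\gamma$ is $A=\{m\}\cup\{b\in(m,M): b\text{ is an up index}\}\cup(M,n]$.
   Context: $S_n$ has simple reflections $s_i=(i,i+1)$; its Coxeter diagram is the path $s_1-\cdots-s_{n-1}$ (labels $3$); an orientation directs each edge. Up/down indices: for $b\in[2,n-1]$, $b$ is up if $s_b\to s_{b-1}$ and down if $s_{b-1}\to s_b$; $1$ and $n$ are declared up or down arbitrarily. Weak order: $x\le y$ iff $I(x)\subseteq I(y)$, $I(x)=\{(x_j,x_i):i<j,\ x_i>x_j\}$ in one-line notation. The Cambrian congruence $\Theta(\vec G)$ is the smallest lattice congruence of the weak order with $t\equiv ts$ for each directed edge $s\to t$. Join-irreducible elements $\gamma$ (those covering exactly one element $\gamma_*$) correspond bijectively to subsets $A\subseteq[n]$ with $\max([n]\setminus A)>\min A$: $\gamma$ lists the elements of $[n]\setminus A$ in increasing order followed by the elements of $A$ in increasing order. The associated left reflection of $\gamma$ is the transposition $(\min A,\max([n]\setminus A))$. A congruence $\Theta$ contracts $\gamma$ if $\gamma\equiv\gamma_*$ modulo $\Theta$. Intervals such as $(m,M)$, $(M,n]$ denote sets of integers. -}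

module Defs where

open import Data.Nat using (ℕ; zero; suc; _+_; _∸_; _≤_; _<_; _≡ᵇ_; _<ᵇ_)
open import Data.Bool using (Bool; true; false; if_then_else_; _∨_; _∧_; not; T)
open import Data.Bool.Properties using (T?)
open import Data.List using (List; []; _∷_; _++_; map; filter; applyUpTo)
open import Data.List.Relation.Binary.Permutation.Propositional using (_↭_)
open import Data.Product using (Σ; _×_; _,_)
open import Data.Sum using (_⊎_)
open import Data.Empty using (⊥)
open import Relation.Nullary using (¬_)
open import Relation.Binary.PropositionalEquality using (_≡_)
open import Level using (Level) renaming (suc to lsuc; zero to lzero)
open import Function using (_∘_)

-- Permutations of [n] = {1,…,n} in one-line notation (lists of naturals).

range : ℕ → List ℕ
range n = applyUpTo suc n

IsPerm : ℕ → List ℕ → Set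
IsPerm n w = w ↭ range n

Before : List ℕ → ℕ → ℕ → Set
Before w b a = Σ (List ℕ) λ xs → Σ (List ℕ) λ ys → Σ (List ℕ) λ zs →
  w ≡ xs ++ b ∷ ys ++ a ∷ zs

-- (a , b) ∈ I(w): a < b and b precedes a in one-line notation,
-- i.e. the pair (x_j , x_i) with i < j and x_i > x_j.
Inv : List ℕ → ℕ → ℕ → Set
Inv w a b = a < b × Before w b a

_≤w_ : List ℕ → List ℕ → Set
x ≤w y = ∀ a b → Inv x a b → Inv y a b

Covers : ℕ → List ℕ → List ℕ → Set
Covers n y x = IsPerm n x × IsPerm n y × x ≤w y × ¬ (y ≤w x) ×
  (∀ z → IsPerm n z → x ≤w z → z ≤w y → z ≡ x ⊎ z ≡ y)

JoinIrreducible : ℕ → List ℕ → Set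
JoinIrreducible n γ = Σ (List ℕ) λ γ* → Covers n γ γ* ×
  (∀ x → Covers n γ x → x ≡ γ*)

IsJoin : ℕ → List ℕ → List ℕ → List ℕ → Set
IsJoin n x y j = IsPerm n j × x ≤w j × y ≤w j ×
  (∀ z → IsPerm n z → x ≤w z → y ≤w z → j ≤w z)

IsMeet : ℕ → List ℕ → List ℕ → List ℕ → Set
IsMeet n x y j = IsPerm n j × j ≤w x × j ≤w y ×
  (∀ z → IsPerm n z → z ≤w x → z ≤w y → z ≤w j)

Rel : Set₁
Rel = List ℕ → List ℕ → Set

record IsLatticeCongruence (n : ℕ) (R : Rel) : Set where
  field
    refl′  : ∀ x → IsPerm n x → R x x
    sym′   : ∀ x y → R x y → R y x
    trans′ : ∀ x y z → R x y → R y z → R x z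
    join-compat : ∀ x y z j₁ j₂ → IsPerm n x → IsPerm n y → IsPerm n z →
      R x y → IsJoin n x z j₁ → IsJoin n y z j₂ → R j₁ j₂
    meet-compat : ∀ x y z j₁ j₂ → IsPerm n x → IsPerm n y → IsPerm n z →
      R x y → IsMeet n x z j₁ → IsMeet n y z j₂ → R j₁ j₂

transp : ℕ → ℕ → ℕ → ℕ
transp a b k = if k ≡ᵇ a then b else (if k ≡ᵇ b then a else k)

sr : ℕ → ℕ → List ℕ
sr n i = map (transp i (suc i)) (range n)

-- one-line notation of the product s_i s_j (apply s_j first) in S_n
sr2 : ℕ → ℕ → ℕ → List ℕ
sr2 n i j = map (transp i (suc i) ∘ transp j (suc j)) (range n)

-- An orientation of the path s_1 - ⋯ - s_{n-1} is given by o : ℕ → Bool,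
-- where for b ∈ [2, n-1]:  o b ≡ true  means the edge is directed s_b → s_{b-1}
-- (b is an up index), and o b ≡ false means s_{b-1} → s_b (b is a down index).
-- Values of o outside [2, n-1] are irrelevant.
Orientation : Set
Orientation = ℕ → Bool

Up : Orientation → ℕ → Set
Up o b = o b ≡ true

-- generating relations: t ≡ t s for each directed edge s → t
data Gen (n : ℕ) (o : Orientation) : Rel where
  gen-up   : ∀ b → 2 ≤ b → b ≤ n ∸ 1 → o b ≡ true →
             Gen n o (sr n (b ∸ 1)) (sr2 n (b ∸ 1) b)
  gen-down : ∀ b → 2 ≤ b → b ≤ n ∸ 1 → o b ≡ false →
             Gen n o (sr n b) (sr2 n b (b ∸ 1))

Θ : ℕ → Orientation → List ℕ → List ℕ → Set₁
Θ n o x y = ∀ (R : Rel) → IsLatticeCongruence n R →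
  (∀ u v → Gen n o u v → R u v) → R x y

Contracted : ℕ → Orientation → List ℕ → Set₁
Contracted n o γ = Σ (List ℕ) λ γ* → Covers n γ γ* × Θ n o γ γ*

-- the associated left reflection of the join-irreducible γ is (m M):
-- γ = (m M) γ_*, i.e. γ_* is obtained from γ by swapping the values m and M
LeftReflection : ℕ → List ℕ → ℕ → ℕ → Set
LeftReflection n γ m M = ∀ γ* → Covers n γ γ* → γ* ≡ map (transp m M) γ

permOfSubset : ℕ → (ℕ → Bool) → List ℕ
permOfSubset n A = filter (λ k → T? (not (A k))) (range n) ++ filter (λ k → T? (A k)) (range n)

cambrianSubset : Orientation → ℕ → ℕ → ℕ → Bool
cambrianSubset o m M b = (b ≡ᵇ m) ∨ ((m <ᵇ b) ∧ (b <ᵇ M) ∧ o b) ∨ (M <ᵇ b)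

-- For b strictly between m and M, say that the join-irreducible permOfSubset n A with m ∈ A, M ∉ A, A ∩ [1, m) = ∅
-- and (M, n] ⊆ A ("the arc (m, M)") puts b on side A b. Its only descent is M m, so it covers exactly the
-- permutation with m and M swapped, and every join-irreducible with left reflection (m, M) is such an arc.
--
-- If some b lies on the side opposite its orientation, the generator of Θ(G⃗) at b contracts the arc (b - 1, b + 1)
-- with the same sides, and joins and meets with explicit permutations force the contraction to grow one endpoint
-- at a time up to (m, M). If every b lies on the side of its orientation (the Cambrian arc), the arc is not
-- contracted: "lying above the same Cambrian arcs" is a lattice congruence containing the generators, because a
-- Cambrian arc below a join x ∨ z lies below x, below z, or splits at an interior point into two Cambrian arcs
-- below x ∨ z; and it separates the Cambrian arc from its lower cover.

module Submission where

open import Defs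
open import Data.Nat using (ℕ; zero; suc; _≤_; _<_; z≤n; s≤s; _≟_; _<?_; _≤?_; _≡ᵇ_; >-nonZero; _+_; _∸_; _≤ᵇ_; _<ᵇ_)
open import Data.Nat.Properties
open import Data.List using (List; []; _∷_; _++_; filter; map; upTo; [_]; length)
open import Data.List.Properties using (∷-injective; ++-assoc; map-++; map-id-local; ++-identityʳ; length-map)
open import Data.List.Membership.Propositional using (_∈_; find; lose; _∉_)
open import Data.List.Membership.Propositional.Properties using (∈-∃++; ∈-++⁺ˡ; ∈-++⁺ʳ; ∈-++⁻; ∈-applyUpTo⁺; ∈-applyUpTo⁻; ∈-filter⁺; ∈-filter⁻; ∈-map⁺; ∈-map⁻)
open import Data.List.Membership.DecPropositional _≟_ using (_∈?_)
open import Data.List.Relation.Unary.Any using (here; there; any?)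
open import Data.List.Relation.Unary.All using (All; []; _∷_)
open import Data.List.Relation.Unary.AllPairs using (AllPairs; []; _∷_)
open import Data.List.Relation.Unary.Unique.Propositional using (Unique)
open import Data.List.Relation.Binary.Permutation.Propositional using (_↭_; ↭-refl; ↭-sym; ↭-trans; ↭-prep)
open import Data.Product using (Σ; _×_; _,_; proj₁; proj₂; ∃)
open import Data.Sum using (_⊎_; inj₁; inj₂; [_,_]′)
open import Function using (_∘_; Equivalence)
open import Data.Empty using (⊥; ⊥-elim)
open import Relation.Nullary using (¬_; Dec; yes; no; _×-dec_; _→-dec_; ¬?; _⊎-dec_; does)
open import Relation.Nullary.Decidable using (decidable-stable; dec-true; dec-false)
open import Relation.Binary using (tri<; tri≈; tri>)
open import Relation.Binary.PropositionalEquality using (_≡_; _≢_; ≢-sym; refl; sym; trans; cong; subst; subst₂; cong₂; module ≡-Reasoning)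
open import Data.Bool using (Bool; true; false; not; T; if_then_else_; _∧_; _∨_)
open import Data.Bool.Properties using (T?; T-≡; T-not-≡; T-∨; T-∧; ∨-identityʳ)
open import Relation.Unary using (Pred; Decidable)
open import Level using (0ℓ)
open import Data.Unit using (tt)
open import Data.Bool.ListAction using (all)
open import Data.List.Relation.Unary.All.Properties using (all⁺)
open import Data.Nat.Induction using (<-rec)
import Data.List.Relation.Unary.All as All
import Data.List.Relation.Unary.AllPairs as AllPairs
import Data.List.Relation.Unary.AllPairs.Properties as AllPairsₚ
import Data.List.Relation.Binary.Permutation.Propositional as ↭
import Data.List.Relation.Binary.Permutation.Propositional.Properties as ↭ₚ
import Data.List.Relation.Unary.Unique.Propositional.Properties as Uniqueₚ
import Data.Bool.Properties as Bool

open Equivalence using (to; from)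

-- Positions in one-line notation

before-head : ∀ {b a : ℕ} {w} → a ∈ w → Before (b ∷ w) b a
before-head {b} a∈w with ys , zs , eq ← ∈-∃++ a∈w = [] , ys , zs , cong (b ∷_) eq

before-tail : ∀ {x b a : ℕ} {w} → Before w b a → Before (x ∷ w) b a
before-tail {x} (xs , ys , zs , eq) = x ∷ xs , ys , zs , cong (x ∷_) eq

before-∷⁻ : ∀ {x b a : ℕ} {w} → Before (x ∷ w) b a → (x ≡ b × a ∈ w) ⊎ Before w b a
before-∷⁻ ([] , ys , zs , eq) with refl , eq′ ← ∷-injective eq =
  inj₁ (refl , subst (_ ∈_) (sym eq′) (∈-++⁺ʳ ys (here refl)))
before-∷⁻ (_ ∷ xs , ys , zs , eq) = inj₂ (xs , ys , zs , proj₂ (∷-injective eq))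

before⇒∈ˡ : ∀ {b a : ℕ} {w} → Before w b a → b ∈ w
before⇒∈ˡ {w = []} ([] , _ , _ , ())
before⇒∈ˡ {w = []} (_ ∷ _ , _ , _ , ())
before⇒∈ˡ {w = x ∷ w} h with before-∷⁻ h
... | inj₁ (refl , _) = here refl
... | inj₂ h′ = there (before⇒∈ˡ h′)

before⇒∈ʳ : ∀ {b a : ℕ} {w} → Before w b a → a ∈ w
before⇒∈ʳ {w = []} ([] , _ , _ , ())
before⇒∈ʳ {w = []} (_ ∷ _ , _ , _ , ())
before⇒∈ʳ {w = x ∷ w} h with before-∷⁻ h
... | inj₁ (_ , a∈) = there a∈
... | inj₂ h′ = there (before⇒∈ʳ h′)

before-[] : ∀ {b a : ℕ} → ¬ Before [] b a
before-[] h with () ← before⇒∈ˡ h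

before? : ∀ (w : List ℕ) b a → Dec (Before w b a)
before? [] b a = no before-[]
before? (x ∷ w) b a with x ≟ b | a ∈? w | before? w b a
... | yes refl | yes a∈ | _ = yes (before-head a∈)
... | _ | _ | yes h = yes (before-tail h)
... | no x≢b | _ | no ¬h = no λ h → [ x≢b ∘ proj₁ , ¬h ]′ (before-∷⁻ h)
... | yes refl | no a∉ | no ¬h = no λ h → [ a∉ ∘ proj₂ , ¬h ]′ (before-∷⁻ h)

before-++⁻ : ∀ (u : List ℕ) {v b a} → Before (u ++ v) b a →
  Before u b a ⊎ (b ∈ u × a ∈ v) ⊎ Before v b a
before-++⁻ [] h = inj₂ (inj₂ h)
before-++⁻ (x ∷ u) h with before-∷⁻ h
... | inj₁ (refl , a∈) = [ inj₁ ∘ before-head , (λ a∈v → inj₂ (inj₁ (here refl , a∈v))) ]′ (∈-++⁻ u a∈)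
... | inj₂ h′ with before-++⁻ u h′
...   | inj₁ h₁ = inj₁ (before-tail h₁)
...   | inj₂ (inj₁ (b∈ , a∈)) = inj₂ (inj₁ (there b∈ , a∈))
...   | inj₂ (inj₂ h₂) = inj₂ (inj₂ h₂)

before-++⁺ˡ : ∀ {u v : List ℕ} {b a} → Before u b a → Before (u ++ v) b a
before-++⁺ˡ {[]} h = ⊥-elim (before-[] h)
before-++⁺ˡ {x ∷ u} h with before-∷⁻ h
... | inj₁ (refl , a∈u) = before-head (∈-++⁺ˡ a∈u)
... | inj₂ h′ = before-tail (before-++⁺ˡ h′)

before-++⁺ʳ : ∀ (u : List ℕ) {v b a} → Before v b a → Before (u ++ v) b a
before-++⁺ʳ [] h = h
before-++⁺ʳ (x ∷ u) h = before-tail (before-++⁺ʳ u h)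

before-++⁺ : ∀ {u v : List ℕ} {b a} → b ∈ u → a ∈ v → Before (u ++ v) b a
before-++⁺ {x ∷ u} (here refl) a∈ = before-head (∈-++⁺ʳ u a∈)
before-++⁺ {x ∷ u} (there b∈) a∈ = before-tail (before-++⁺ b∈ a∈)

before-irrefl : ∀ {w : List ℕ} {b} → Unique w → ¬ Before w b b
before-irrefl {[]} _ h = before-[] h
before-irrefl {x ∷ w} (x∉ ∷ u) h with before-∷⁻ h
... | inj₁ (refl , b∈) = All.lookup x∉ b∈ refl
... | inj₂ h′ = before-irrefl u h′

before-asym : ∀ {w : List ℕ} {b a} → Unique w → Before w b a → ¬ Before w a b
before-asym {[]} _ h _ = before-[] h
before-asym {x ∷ w} (x∉ ∷ u) h₁ h₂ with before-∷⁻ h₁ | before-∷⁻ h₂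
... | inj₁ (refl , a∈) | inj₁ (refl , _) = All.lookup x∉ a∈ refl
... | inj₁ (refl , _) | inj₂ h₂′ = All.lookup x∉ (before⇒∈ʳ h₂′) refl
... | inj₂ h₁′ | inj₁ (refl , _) = All.lookup x∉ (before⇒∈ʳ h₁′) refl
... | inj₂ h₁′ | inj₂ h₂′ = before-asym u h₁′ h₂′

before-trans : ∀ {w : List ℕ} {c b a} → Unique w → Before w c b → Before w b a → Before w c a
before-trans {[]} _ h _ = ⊥-elim (before-[] h)
before-trans {x ∷ w} (x∉ ∷ u) h₁ h₂ with before-∷⁻ h₁ | before-∷⁻ h₂
... | inj₁ (refl , b∈) | inj₁ (refl , _) = ⊥-elim (All.lookup x∉ b∈ refl)
... | inj₁ (refl , _) | inj₂ h₂′ = before-head (before⇒∈ʳ h₂′)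
... | inj₂ h₁′ | inj₁ (refl , _) = ⊥-elim (All.lookup x∉ (before⇒∈ʳ h₁′) refl)
... | inj₂ h₁′ | inj₂ h₂′ = before-tail (before-trans u h₁′ h₂′)

before-total : ∀ {w : List ℕ} {b a} → b ∈ w → a ∈ w → b ≢ a → Before w b a ⊎ Before w a b
before-total (here refl) (here refl) b≢a = ⊥-elim (b≢a refl)
before-total (here refl) (there a∈) _ = inj₁ (before-head a∈)
before-total (there b∈) (here refl) _ = inj₂ (before-head b∈)
before-total (there b∈) (there a∈) b≢a with before-total b∈ a∈ b≢a
... | inj₁ h = inj₁ (before-tail h)
... | inj₂ h = inj₂ (before-tail h)

Increasing : List ℕ → Set
Increasing = AllPairs _<_

increasing⇒unique : ∀ {w} → Increasing w → Unique w
increasing⇒unique = AllPairs.map (λ lt eq → <-irrefl eq lt)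

increasing-before⇒< : ∀ {w b a} → Increasing w → Before w b a → b < a
increasing-before⇒< {[]} _ h = ⊥-elim (before-[] h)
increasing-before⇒< {x ∷ w} (x< ∷ s) h with before-∷⁻ h
... | inj₁ (refl , a∈) = All.lookup x< a∈
... | inj₂ h′ = increasing-before⇒< s h′

increasing-<⇒before : ∀ {w b a} → Increasing w → b ∈ w → a ∈ w → b < a → Before w b a
increasing-<⇒before s b∈ a∈ b<a with before-total b∈ a∈ (<⇒≢ b<a)
... | inj₁ h = h
... | inj₂ h = ⊥-elim (<-asym b<a (increasing-before⇒< s h))

increasing-adjacent : ∀ (l : List ℕ) → (∀ us u v vs → l ≡ us ++ u ∷ v ∷ vs → u < v) → Increasing l
increasing-adjacent [] _ = []
increasing-adjacent (x ∷ []) _ = [] ∷ []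
increasing-adjacent (x ∷ y ∷ l) h
  with y< ∷ s ← increasing-adjacent (y ∷ l) (λ us u v vs e → h (x ∷ us) u v vs (cong (x ∷_) e)) =
  (x<y ∷ All.map (<-trans x<y) y<) ∷ y< ∷ s
  where
  x<y : x < y
  x<y = h [] x y l refl

range-increasing : ∀ n → Increasing (range n)
range-increasing n = AllPairsₚ.applyUpTo⁺₁ suc n (λ i<j _ → s≤s i<j)

range-unique : ∀ n → Unique (range n)
range-unique n = increasing⇒unique (range-increasing n)

∈-range⁻ : ∀ {n a} → a ∈ range n → 1 ≤ a × a ≤ n
∈-range⁻ a∈ with _ , i<n , refl ← ∈-applyUpTo⁻ suc a∈ = s≤s z≤n , i<n

∈-range⁺ : ∀ {n a} → 1 ≤ a → a ≤ n → a ∈ range n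
∈-range⁺ {a = suc i} (s≤s z≤n) a≤n = ∈-applyUpTo⁺ suc a≤n

-- Permutations of [n] and the weak order

unique-resp-↭ : ∀ {xs ys : List ℕ} → xs ↭ ys → Unique xs → Unique ys
unique-resp-↭ ↭.refl u = u
unique-resp-↭ (↭.prep x p) (x∉ ∷ u) = ↭ₚ.All-resp-↭ p x∉ ∷ unique-resp-↭ p u
unique-resp-↭ (↭.swap x y p) ((x≢y ∷ x∉) ∷ y∉ ∷ u) =
  (≢-sym x≢y ∷ ↭ₚ.All-resp-↭ p y∉) ∷ ↭ₚ.All-resp-↭ p x∉ ∷ unique-resp-↭ p u
unique-resp-↭ (↭.trans p q) u = unique-resp-↭ q (unique-resp-↭ p u)

unique-⊆-⊇⇒↭ : ∀ {xs ys : List ℕ} → Unique xs → Unique ys →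
  (∀ {a} → a ∈ xs → a ∈ ys) → (∀ {a} → a ∈ ys → a ∈ xs) → xs ↭ ys
unique-⊆-⊇⇒↭ {[]} {[]} _ _ _ _ = ↭-refl
unique-⊆-⊇⇒↭ {[]} {y ∷ ys} _ _ _ ys⊆ with () ← ys⊆ (here refl)
unique-⊆-⊇⇒↭ {x ∷ xs} {ys} (x∉xs ∷ uxs) uys xs⊆ ys⊆ with ys₁ , ys₂ , refl ← ∈-∃++ (xs⊆ (here refl)) =
  ↭-trans (↭-prep x (unique-⊆-⊇⇒↭ uxs urest xs⊆rest rest⊆xs)) (↭-sym shift)
  where
  shift : ys₁ ++ x ∷ ys₂ ↭ x ∷ (ys₁ ++ ys₂)
  shift = ↭ₚ.shift x ys₁ ys₂
  x∉rest : All (x ≢_) (ys₁ ++ ys₂)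
  x∉rest = AllPairs.head (unique-resp-↭ shift uys)
  urest : Unique (ys₁ ++ ys₂)
  urest = AllPairs.tail (unique-resp-↭ shift uys)
  xs⊆rest : ∀ {a} → a ∈ xs → a ∈ ys₁ ++ ys₂
  xs⊆rest a∈ with ↭ₚ.∈-resp-↭ shift (xs⊆ (there a∈))
  ... | here refl = ⊥-elim (All.lookup x∉xs a∈ refl)
  ... | there a∈′ = a∈′
  rest⊆xs : ∀ {a} → a ∈ ys₁ ++ ys₂ → a ∈ xs
  rest⊆xs a∈ with ys⊆ (↭ₚ.∈-resp-↭ (↭-sym shift) (there a∈))
  ... | here refl = ⊥-elim (All.lookup x∉rest a∈ refl)
  ... | there a∈′ = a∈′

perm-unique : ∀ {n w} → IsPerm n w → Unique w
perm-unique {n} p = unique-resp-↭ (↭-sym p) (range-unique n)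

perm-∈⁻ : ∀ {n w a} → IsPerm n w → a ∈ w → 1 ≤ a × a ≤ n
perm-∈⁻ p a∈ = ∈-range⁻ (↭ₚ.∈-resp-↭ p a∈)

perm-∈⁺ : ∀ {n w a} → IsPerm n w → 1 ≤ a → a ≤ n → a ∈ w
perm-∈⁺ p 1≤a a≤n = ↭ₚ.∈-resp-↭ (↭-sym p) (∈-range⁺ 1≤a a≤n)

perm-before-total : ∀ {n w b a} → IsPerm n w → 1 ≤ b → b ≤ n → 1 ≤ a → a ≤ n → b ≢ a →
  Before w b a ⊎ Before w a b
perm-before-total p 1≤b b≤n 1≤a a≤n = before-total (perm-∈⁺ p 1≤b b≤n) (perm-∈⁺ p 1≤a a≤n)

unique-before-ext : ∀ {w v : List ℕ} → Unique w → Unique v →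
  (∀ {a} → a ∈ w → a ∈ v) → (∀ {a} → a ∈ v → a ∈ w) →
  (∀ {b a} → Before w b a → Before v b a) → w ≡ v
unique-before-ext {[]} {[]} _ _ _ _ _ = refl
unique-before-ext {[]} {y ∷ v} _ _ _ v⊆ _ with () ← v⊆ (here refl)
unique-before-ext {x ∷ w} {[]} _ _ w⊆ _ _ with () ← w⊆ (here refl)
unique-before-ext {x ∷ w} {y ∷ v} (x∉w ∷ uw) (y∉v ∷ uv) w⊆ v⊆ w⇒v with x ≟ y
... | yes refl = cong (x ∷_) (unique-before-ext uw uv (tail-⊆ x∉w w⊆) (tail-⊆ y∉v v⊆) tail-before)
  where
  tail-⊆ : ∀ {z zs zs′} → All (z ≢_) zs → (∀ {a} → a ∈ z ∷ zs → a ∈ z ∷ zs′) → ∀ {a} → a ∈ zs → a ∈ zs′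
  tail-⊆ z∉ ⊆ a∈ with ⊆ (there a∈)
  ... | here refl = ⊥-elim (All.lookup z∉ a∈ refl)
  ... | there a∈′ = a∈′
  tail-before : ∀ {b a} → Before w b a → Before v b a
  tail-before h with before-∷⁻ (w⇒v (before-tail h))
  ... | inj₁ (refl , _) = ⊥-elim (All.lookup x∉w (before⇒∈ˡ h) refl)
  ... | inj₂ h′ = h′
... | no x≢y with before-∷⁻ (w⇒v (before-head y∈w))
  where
  y∈w : y ∈ w
  y∈w with v⊆ (here refl)
  ... | here y≡x = ⊥-elim (x≢y (sym y≡x))
  ... | there y∈ = y∈
...   | inj₁ (y≡x , _) = ⊥-elim (x≢y (sym y≡x))
...   | inj₂ h = ⊥-elim (All.lookup y∉v (before⇒∈ʳ h) refl)

inv? : ∀ w a c → Dec (Inv w a c)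
inv? w a c = (a <? c) ×-dec before? w c a

inv-trans : ∀ {n w a b c} → IsPerm n w → Inv w a b → Inv w b c → Inv w a c
inv-trans p (a<b , h₁) (b<c , h₂) = <-trans a<b b<c , before-trans (perm-unique p) h₂ h₁

inv-bounds : ∀ {n w a c} → IsPerm n w → Inv w a c → 1 ≤ a × c ≤ n
inv-bounds p (_ , h) = proj₁ (perm-∈⁻ p (before⇒∈ʳ h)) , proj₂ (perm-∈⁻ p (before⇒∈ˡ h))

¬inv⇒before : ∀ {n w a c} → IsPerm n w → 1 ≤ a → a < c → c ≤ n → ¬ Inv w a c → Before w a c
¬inv⇒before p 1≤a a<c c≤n ¬inv
  with perm-before-total p 1≤a (<⇒≤ (<-≤-trans a<c c≤n)) (≤-trans 1≤a (<⇒≤ a<c)) c≤n (<⇒≢ a<c)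
... | inj₁ h = h
... | inj₂ h = ⊥-elim (¬inv (a<c , h))

≤w-refl : ∀ {w} → w ≤w w
≤w-refl _ _ i = i

≤w-trans : ∀ {u v w} → u ≤w v → v ≤w w → u ≤w w
≤w-trans u≤v v≤w a b i = v≤w a b (u≤v a b i)

≤w-antisym : ∀ {n w v} → IsPerm n w → IsPerm n v → w ≤w v → v ≤w w → w ≡ v
≤w-antisym {n} {w} {v} pw pv w≤v v≤w =
  unique-before-ext (perm-unique pw) (perm-unique pv) (↭ₚ.∈-resp-↭ (↭-trans pw (↭-sym pv)))
    (↭ₚ.∈-resp-↭ (↭-trans pv (↭-sym pw))) w⇒v
  where
  w⇒v : ∀ {b a} → Before w b a → Before v b a
  w⇒v {b} {a} h with <-cmp b a
  ... | tri≈ _ refl _ = ⊥-elim (before-irrefl (perm-unique pw) h)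
  ... | tri> _ _ a<b = proj₂ (w≤v a b (a<b , h))
  ... | tri< b<a _ _ with perm-∈⁻ pw (before⇒∈ˡ h) | perm-∈⁻ pw (before⇒∈ʳ h)
  ...   | 1≤b , b≤n | 1≤a , a≤n with perm-before-total pv 1≤b b≤n 1≤a a≤n (<⇒≢ b<a)
  ...     | inj₁ h′ = h′
  ...     | inj₂ h′ = ⊥-elim (before-asym (perm-unique pw) h (proj₂ (v≤w b a (b<a , h′))))

¬≤w⇒inv : ∀ {n w v} → IsPerm n w → ¬ (w ≤w v) → ∃ λ a → ∃ λ c → Inv w a c × ¬ Inv v a c
¬≤w⇒inv {n} {w} {v} pw w≰v with anyUpTo? (λ a → anyUpTo? (λ c → inv? w a c ×-dec ¬? (inv? v a c)) (suc n)) (suc n)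
... | yes (a , _ , c , _ , witness) = a , c , witness
... | no none = ⊥-elim (w≰v w≤v)
  where
  w≤v : w ≤w v
  w≤v a c i = decidable-stable (inv? v a c) λ ¬i →
    none (a , s≤s (≤-trans (<⇒≤ (proj₁ i)) c≤n) , c , s≤s c≤n , i , ¬i)
    where c≤n = proj₂ (inv-bounds pw i)

swap-adjacent-↭ : ∀ (us : List ℕ) u v vs → us ++ u ∷ v ∷ vs ↭ us ++ v ∷ u ∷ vs
swap-adjacent-↭ us u v vs = ↭ₚ.++⁺ˡ us (↭.swap u v ↭-refl)

before-swap-adjacent : ∀ (us : List ℕ) {u v vs x y} → Before (us ++ u ∷ v ∷ vs) x y → ¬ (x ≡ u × y ≡ v) →
  Before (us ++ v ∷ u ∷ vs) x y
before-swap-adjacent [] h ≢uv with before-∷⁻ h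
... | inj₁ (refl , here refl) = ⊥-elim (≢uv (refl , refl))
... | inj₁ (refl , there y∈) = before-tail (before-head y∈)
... | inj₂ h′ with before-∷⁻ h′
...   | inj₁ (refl , y∈) = before-head (there y∈)
...   | inj₂ h″ = before-tail (before-tail h″)
before-swap-adjacent (w ∷ us) {u} {v} {vs} h ≢uv with before-∷⁻ h
... | inj₁ (refl , y∈) = before-head (↭ₚ.∈-resp-↭ (swap-adjacent-↭ us u v vs) y∈)
... | inj₂ h′ = before-tail (before-swap-adjacent us h′ ≢uv)

swap-descent-covered : ∀ {n} us {u v} vs → IsPerm n (us ++ u ∷ v ∷ vs) → v < u →
  Covers n (us ++ u ∷ v ∷ vs) (us ++ v ∷ u ∷ vs)
swap-descent-covered {n} us {u} {v} vs pγ v<u = pγ′ , pγ , γ′≤γ , γ≰γ′ , interval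
  where
  γ γ′ : List ℕ
  γ = us ++ u ∷ v ∷ vs
  γ′ = us ++ v ∷ u ∷ vs
  pγ′ : IsPerm n γ′
  pγ′ = ↭-trans (↭-sym (swap-adjacent-↭ us u v vs)) pγ
  inv-vu : Inv γ v u
  inv-vu = v<u , before-++⁺ʳ us (before-head (here refl))
  ¬inv′-vu : ¬ Inv γ′ v u
  ¬inv′-vu (_ , h) = before-asym (perm-unique pγ′) h (before-++⁺ʳ us (before-head (here refl)))
  γ′≤γ : γ′ ≤w γ
  γ′≤γ a c (a<c , h) = a<c , before-swap-adjacent us h λ { (refl , refl) → <-asym a<c v<u }
  γ≰γ′ : ¬ (γ ≤w γ′)
  γ≰γ′ γ≤γ′ = ¬inv′-vu (γ≤γ′ v u inv-vu)
  other-inv : ∀ {a c} → Inv γ a c → ¬ (a ≡ v × c ≡ u) → Inv γ′ a c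
  other-inv (a<c , h) ≢vu = a<c , before-swap-adjacent us h λ { (refl , refl) → ≢vu (refl , refl) }
  interval : ∀ z → IsPerm n z → γ′ ≤w z → z ≤w γ → z ≡ γ′ ⊎ z ≡ γ
  interval z pz γ′≤z z≤γ with inv? z v u
  ... | yes inv-z = inj₂ (≤w-antisym pz pγ z≤γ γ≤z)
    where
    γ≤z : γ ≤w z
    γ≤z a c i with a ≟ v | c ≟ u
    ... | yes refl | yes refl = inv-z
    ... | yes refl | no c≢u = γ′≤z a c (other-inv i (c≢u ∘ proj₂))
    ... | no a≢v | _ = γ′≤z a c (other-inv i (a≢v ∘ proj₁))
  ... | no ¬inv-z = inj₁ (≤w-antisym pz pγ′ z≤γ′ γ′≤z)
    where
    z≤γ′ : z ≤w γ′
    z≤γ′ a c i = other-inv (z≤γ a c i) λ { (refl , refl) → ¬inv-z i }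

-- Listing [n] by a subset or by a key

module _ {P : Pred ℕ 0ℓ} (P? : Decidable P) where

  filter-increasing : ∀ {l} → Increasing l → Increasing (filter P? l)
  filter-increasing = AllPairsₚ.filter⁺ P?

  before-filter⁻ : ∀ {l b a} → Increasing l → Before (filter P? l) b a → (b ∈ l × P b) × (a ∈ l × P a) × b < a
  before-filter⁻ {l} s h = ∈-filter⁻ P? {xs = l} (before⇒∈ˡ h) , ∈-filter⁻ P? {xs = l} (before⇒∈ʳ h) ,
                           increasing-before⇒< (filter-increasing s) h

  before-filter⁺ : ∀ {l c a} → Before l c a → P c → P a → Before (filter P? l) c a
  before-filter⁺ {[]} h _ _ = ⊥-elim (before-[] h)
  before-filter⁺ {x ∷ l} h Pc Pa with before-∷⁻ h | P? x
  ... | inj₁ (refl , a∈) | yes _ = before-head (∈-filter⁺ P? a∈ Pa)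
  ... | inj₁ (refl , _) | no ¬Px = ⊥-elim (¬Px Pc)
  ... | inj₂ h′ | yes _ = before-tail (before-filter⁺ h′ Pc Pa)
  ... | inj₂ h′ | no _ = before-filter⁺ h′ Pc Pa

module _ (n : ℕ) (A : ℕ → Bool) where

  private
    outside inside : List ℕ
    outside = filter (T? ∘ not ∘ A) (range n)
    inside = filter (T? ∘ A) (range n)

  inv-permOfSubset⁻ : ∀ {a c} → Inv (permOfSubset n A) a c → (1 ≤ a × a < c × c ≤ n) × A a ≡ true × A c ≡ false
  inv-permOfSubset⁻ {a} {c} (a<c , h) with before-++⁻ outside h
  ... | inj₁ h₀ = ⊥-elim (<-asym a<c (proj₂ (proj₂ (before-filter⁻ (T? ∘ not ∘ A) (range-increasing n) h₀))))
  ... | inj₂ (inj₂ h₁) = ⊥-elim (<-asym a<c (proj₂ (proj₂ (before-filter⁻ (T? ∘ A) (range-increasing n) h₁))))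
  ... | inj₂ (inj₁ (c∈ , a∈)) with ∈-filter⁻ (T? ∘ not ∘ A) {xs = range n} c∈ | ∈-filter⁻ (T? ∘ A) {xs = range n} a∈
  ...   | c∈n , Ac | a∈n , Aa = (proj₁ (∈-range⁻ a∈n) , a<c , proj₂ (∈-range⁻ c∈n)) , to T-≡ Aa , to T-not-≡ Ac

  inv-permOfSubset⁺ : ∀ {a c} → 1 ≤ a → a < c → c ≤ n → A a ≡ true → A c ≡ false → Inv (permOfSubset n A) a c
  inv-permOfSubset⁺ 1≤a a<c c≤n Aa Ac = a<c , before-++⁺ {outside} {inside}
    (∈-filter⁺ (T? ∘ not ∘ A) (∈-range⁺ (≤-trans 1≤a (<⇒≤ a<c)) c≤n) (from T-not-≡ Ac))
    (∈-filter⁺ (T? ∘ A) (∈-range⁺ 1≤a (≤-trans (<⇒≤ a<c) c≤n)) (from T-≡ Aa))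

  permOfSubset-isPerm : IsPerm n (permOfSubset n A)
  permOfSubset-isPerm = unique-⊆-⊇⇒↭ unique (range-unique n) ⊆range range⊆
    where
    unique : Unique (permOfSubset n A)
    unique = Uniqueₚ.++⁺ (increasing⇒unique (filter-increasing (T? ∘ not ∘ A) (range-increasing n)))
                         (increasing⇒unique (filter-increasing (T? ∘ A) (range-increasing n))) disjoint
      where
      disjoint : ∀ {v} → ¬ (v ∈ outside × v ∈ inside)
      disjoint (v∈₀ , v∈₁) with ∈-filter⁻ (T? ∘ not ∘ A) {xs = range n} v∈₀ | ∈-filter⁻ (T? ∘ A) {xs = range n} v∈₁
      ... | _ , ¬Av | _ , Av with () ← trans (sym (to T-not-≡ ¬Av)) (to T-≡ Av)
    ⊆range : ∀ {a} → a ∈ permOfSubset n A → a ∈ range n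
    ⊆range a∈ with ∈-++⁻ outside a∈
    ... | inj₁ a∈₀ = proj₁ (∈-filter⁻ (T? ∘ not ∘ A) {xs = range n} a∈₀)
    ... | inj₂ a∈₁ = proj₁ (∈-filter⁻ (T? ∘ A) {xs = range n} a∈₁)
    range⊆ : ∀ {a} → a ∈ range n → a ∈ permOfSubset n A
    range⊆ {a} a∈ with A a in Aa
    ... | true = ∈-++⁺ʳ outside (∈-filter⁺ (T? ∘ A) a∈ (from T-≡ Aa))
    ... | false = ∈-++⁺ˡ (∈-filter⁺ (T? ∘ not ∘ A) a∈ (from T-not-≡ Aa))

permOfSubset-cong : ∀ n {A B : ℕ → Bool} → (∀ k → 1 ≤ k → k ≤ n → A k ≡ B k) → permOfSubset n A ≡ permOfSubset n B
permOfSubset-cong n {A} {B} A≗B =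
  ≤w-antisym (permOfSubset-isPerm n A) (permOfSubset-isPerm n B) (≤w A B A≗B) (≤w B A (λ k 1≤k k≤n → sym (A≗B k 1≤k k≤n)))
  where
  ≤w : ∀ A B → (∀ k → 1 ≤ k → k ≤ n → A k ≡ B k) → permOfSubset n A ≤w permOfSubset n B
  ≤w A B A≗B a c i with (1≤a , a<c , c≤n) , Aa , Ac ← inv-permOfSubset⁻ n A i =
    inv-permOfSubset⁺ n B 1≤a a<c c≤n (trans (sym (A≗B a 1≤a (≤-trans (<⇒≤ a<c) c≤n))) Aa)
                                     (trans (sym (A≗B c (≤-trans 1≤a (<⇒≤ a<c)) c≤n)) Ac)

keyBlock : ℕ → (ℕ → ℕ) → ℕ → List ℕ
keyBlock n κ k = filter (λ b → κ b ≟ k) (range n)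

keyBlocks : ℕ → (ℕ → ℕ) → List ℕ → List ℕ
keyBlocks n κ [] = []
keyBlocks n κ (k ∷ ks) = keyBlock n κ k ++ keyBlocks n κ ks

sortByKey : ℕ → ℕ → (ℕ → ℕ) → List ℕ
sortByKey n K κ = keyBlocks n κ (upTo K)

module _ (n : ℕ) (κ : ℕ → ℕ) where

  ∈-keyBlocks⁻ : ∀ ks {b} → b ∈ keyBlocks n κ ks → b ∈ range n × κ b ∈ ks
  ∈-keyBlocks⁻ (k ∷ ks) b∈ with ∈-++⁻ (keyBlock n κ k) b∈
  ... | inj₁ b∈k with b∈n , κb≡k ← ∈-filter⁻ (λ b → κ b ≟ k) {xs = range n} b∈k = b∈n , here κb≡k
  ... | inj₂ b∈ks = proj₁ (∈-keyBlocks⁻ ks b∈ks) , there (proj₂ (∈-keyBlocks⁻ ks b∈ks))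

  ∈-keyBlocks⁺ : ∀ ks {b} → b ∈ range n → κ b ∈ ks → b ∈ keyBlocks n κ ks
  ∈-keyBlocks⁺ (k ∷ ks) b∈ (here κb≡k) = ∈-++⁺ˡ (∈-filter⁺ (λ b → κ b ≟ k) b∈ κb≡k)
  ∈-keyBlocks⁺ (k ∷ ks) b∈ (there κb∈) = ∈-++⁺ʳ (keyBlock n κ k) (∈-keyBlocks⁺ ks b∈ κb∈)

  keyBlocks-unique : ∀ ks → Increasing ks → Unique (keyBlocks n κ ks)
  keyBlocks-unique [] _ = []
  keyBlocks-unique (k ∷ ks) (k< ∷ s) =
    Uniqueₚ.++⁺ (increasing⇒unique (filter-increasing (λ b → κ b ≟ k) (range-increasing n))) (keyBlocks-unique ks s) disjoint
    where
    disjoint : ∀ {v} → ¬ (v ∈ keyBlock n κ k × v ∈ keyBlocks n κ ks)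
    disjoint (v∈k , v∈ks) with ∈-filter⁻ (λ b → κ b ≟ k) {xs = range n} v∈k | ∈-keyBlocks⁻ ks v∈ks
    ... | _ , refl | _ , κv∈ = <-irrefl refl (All.lookup k< κv∈)

  before-keyBlocks⁻ : ∀ ks {c a} → Increasing ks → Before (keyBlocks n κ ks) c a → κ c < κ a ⊎ (κ c ≡ κ a × c < a)
  before-keyBlocks⁻ [] _ h = ⊥-elim (before-[] h)
  before-keyBlocks⁻ (k ∷ ks) (k< ∷ s) h with before-++⁻ (keyBlock n κ k) h
  ... | inj₁ h₀ with (_ , κc≡k) , (_ , κa≡k) , c<a ← before-filter⁻ (λ b → κ b ≟ k) (range-increasing n) h₀ =
    inj₂ (trans κc≡k (sym κa≡k) , c<a)
  ... | inj₂ (inj₁ (c∈ , a∈)) with ∈-filter⁻ (λ b → κ b ≟ k) {xs = range n} c∈ | ∈-keyBlocks⁻ ks a∈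
  ...   | _ , refl | _ , κa∈ = inj₁ (All.lookup k< κa∈)
  before-keyBlocks⁻ (k ∷ ks) (k< ∷ s) h | inj₂ (inj₂ h₁) = before-keyBlocks⁻ ks s h₁

  before-keyBlocks⁺ : ∀ ks {c a} → Increasing ks → c ∈ range n → a ∈ range n → κ c ∈ ks → κ a ∈ ks → κ c < κ a →
    Before (keyBlocks n κ ks) c a
  before-keyBlocks⁺ (k ∷ ks) _ _ _ (here refl) (here κa≡k) lt = ⊥-elim (<-irrefl (sym κa≡k) lt)
  before-keyBlocks⁺ (k ∷ ks) _ c∈ a∈ (here κc≡k) (there κa∈) _ =
    before-++⁺ {keyBlock n κ k} (∈-filter⁺ (λ b → κ b ≟ k) c∈ κc≡k) (∈-keyBlocks⁺ ks a∈ κa∈)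
  before-keyBlocks⁺ (k ∷ ks) (k< ∷ _) _ _ (there κc∈) (here refl) lt = ⊥-elim (<-asym (All.lookup k< κc∈) lt)
  before-keyBlocks⁺ (k ∷ ks) (_ ∷ s) c∈ a∈ (there κc∈) (there κa∈) lt =
    before-++⁺ʳ (keyBlock n κ k) (before-keyBlocks⁺ ks s c∈ a∈ κc∈ κa∈ lt)

module _ (n K : ℕ) (κ : ℕ → ℕ) (κ<K : ∀ b → κ b < K) where

  private
    upTo-increasing : Increasing (upTo K)
    upTo-increasing = AllPairsₚ.applyUpTo⁺₁ (λ i → i) K (λ i<j _ → i<j)
    κ∈ : ∀ b → κ b ∈ upTo K
    κ∈ b = ∈-applyUpTo⁺ (λ i → i) (κ<K b)

  sortByKey-isPerm : IsPerm n (sortByKey n K κ)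
  sortByKey-isPerm = unique-⊆-⊇⇒↭ (keyBlocks-unique n κ (upTo K) upTo-increasing) (range-unique n)
    (proj₁ ∘ ∈-keyBlocks⁻ n κ (upTo K)) (λ {b} b∈ → ∈-keyBlocks⁺ n κ (upTo K) b∈ (κ∈ b))

  inv-sortByKey⁻ : ∀ {a c} → Inv (sortByKey n K κ) a c → (1 ≤ a × a < c × c ≤ n) × κ c < κ a
  inv-sortByKey⁻ (a<c , h) with before-keyBlocks⁻ n κ (upTo K) upTo-increasing h
  ... | inj₂ (_ , c<a) = ⊥-elim (<-asym a<c c<a)
  ... | inj₁ κc<κa = (proj₁ (∈-range⁻ (proj₁ (∈-keyBlocks⁻ n κ (upTo K) (before⇒∈ʳ h)))) , a<c ,
                      proj₂ (∈-range⁻ (proj₁ (∈-keyBlocks⁻ n κ (upTo K) (before⇒∈ˡ h))))) , κc<κa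

  inv-sortByKey⁺ : ∀ {a c} → 1 ≤ a → a < c → c ≤ n → κ c < κ a → Inv (sortByKey n K κ) a c
  inv-sortByKey⁺ {a} {c} 1≤a a<c c≤n κc<κa = a<c , before-keyBlocks⁺ n κ (upTo K) upTo-increasing
    (∈-range⁺ (≤-trans 1≤a (<⇒≤ a<c)) c≤n) (∈-range⁺ 1≤a (≤-trans (<⇒≤ a<c) c≤n)) (κ∈ c) (κ∈ a) κc<κa

-- Transpositions and the generators sᵢ, sᵢ sᵢ₊₁, sᵢ₊₁, sᵢ₊₁ sᵢ

≡ᵇ-refl : ∀ b → (b ≡ᵇ b) ≡ true
≡ᵇ-refl b = to T-≡ (≡⇒≡ᵇ b b refl)

≢⇒≡ᵇ-false : ∀ {b c} → b ≢ c → (b ≡ᵇ c) ≡ false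
≢⇒≡ᵇ-false {b} {c} b≢c with b ≡ᵇ c in eq
... | true = ⊥-elim (b≢c (≡ᵇ⇒≡ b c (from T-≡ eq)))
... | false = refl

transp-left : ∀ a b → transp a b a ≡ b
transp-left a b rewrite ≡ᵇ-refl a = refl

transp-right : ∀ {a b} → a ≢ b → transp a b b ≡ a
transp-right {a} {b} a≢b rewrite ≢⇒≡ᵇ-false (≢-sym a≢b) | ≡ᵇ-refl b = refl

transp-other : ∀ {a b k} → k ≢ a → k ≢ b → transp a b k ≡ k
transp-other k≢a k≢b rewrite ≢⇒≡ᵇ-false k≢a | ≢⇒≡ᵇ-false k≢b = refl

transp-involutive : ∀ {a b} k → a ≢ b → transp a b (transp a b k) ≡ k
transp-involutive {a} {b} k a≢b with k ≟ a | k ≟ b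
... | yes refl | _ rewrite transp-left k b = transp-right a≢b
... | no _ | yes refl rewrite transp-right a≢b = transp-left a k
... | no k≢a | no k≢b rewrite transp-other k≢a k≢b = transp-other k≢a k≢b

before-map⁺ : ∀ (f : ℕ → ℕ) {l u v} → Before l u v → Before (map f l) (f u) (f v)
before-map⁺ f {[]} h = ⊥-elim (before-[] h)
before-map⁺ f {x ∷ l} h with before-∷⁻ h
... | inj₁ (refl , v∈) = before-head (∈-map⁺ f v∈)
... | inj₂ h′ = before-tail (before-map⁺ f h′)

before-map⁻ : ∀ (f g : ℕ → ℕ) → (∀ k → g (f k) ≡ k) → ∀ {l x y} → Before (map f l) x y → Before l (g x) (g y)
before-map⁻ f g gf {[]} h = ⊥-elim (before-[] h)
before-map⁻ f g gf {z ∷ l} h with before-∷⁻ h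
... | inj₂ h′ = before-tail (before-map⁻ f g gf h′)
... | inj₁ (refl , y∈) with u , u∈ , refl ← ∈-map⁻ f y∈ rewrite gf z | gf u = before-head u∈

Near : ℕ → ℕ → Set
Near i k = i ≤ k × k ≤ suc (suc i)

near? : ∀ i k → Dec (Near i k)
near? i k = (i ≤? k) ×-dec (k ≤? suc (suc i))

near-cases : ∀ {i k} → Near i k → k ≡ i ⊎ k ≡ suc i ⊎ k ≡ suc (suc i)
near-cases {i} {k} (i≤k , k≤i+2) with m≤n⇒m<n∨m≡n i≤k
... | inj₂ refl = inj₁ refl
... | inj₁ i<k with m≤n⇒m<n∨m≡n i<k
...   | inj₂ refl = inj₂ (inj₁ refl)
...   | inj₁ i+1<k = inj₂ (inj₂ (≤-antisym k≤i+2 i+1<k))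

near-pairs : ∀ {i a c} → Near i a → Near i c → a < c →
  (a ≡ i × c ≡ suc i) ⊎ (a ≡ i × c ≡ suc (suc i)) ⊎ (a ≡ suc i × c ≡ suc (suc i))
near-pairs na nc a<c with near-cases na | near-cases nc
... | inj₁ refl | inj₂ (inj₁ refl) = inj₁ (refl , refl)
... | inj₁ refl | inj₂ (inj₂ refl) = inj₂ (inj₁ (refl , refl))
... | inj₂ (inj₁ refl) | inj₂ (inj₂ refl) = inj₂ (inj₂ (refl , refl))
... | inj₁ refl | inj₁ refl = ⊥-elim (<-irrefl refl a<c)
... | inj₂ (inj₁ refl) | inj₁ refl = ⊥-elim (<-asym a<c (n<1+n _))
... | inj₂ (inj₁ refl) | inj₂ (inj₁ refl) = ⊥-elim (<-irrefl refl a<c)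
... | inj₂ (inj₂ refl) | inj₁ refl = ⊥-elim (<-asym a<c (m<n+m _ (s≤s z≤n)))
... | inj₂ (inj₂ refl) | inj₂ (inj₁ refl) = ⊥-elim (<-asym a<c (n<1+n _))
... | inj₂ (inj₂ refl) | inj₂ (inj₂ refl) = ⊥-elim (<-irrefl refl a<c)

module NearPermutation (n i : ℕ) (1≤i : 1 ≤ i) (i+2≤n : suc (suc i) ≤ n) (f g : ℕ → ℕ)
         (gf : ∀ k → g (f k) ≡ k) (fg : ∀ k → f (g k) ≡ k)
         (f-fix : ∀ k → ¬ Near i k → f k ≡ k) (g-fix : ∀ k → ¬ Near i k → g k ≡ k)
         (f-near : ∀ k → Near i k → Near i (f k)) (g-near : ∀ k → Near i k → Near i (g k)) where

  w : List ℕ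
  w = map f (range n)

  private
    in-range : ∀ (h : ℕ → ℕ) → (∀ k → ¬ Near i k → h k ≡ k) → (∀ k → Near i k → Near i (h k)) →
      ∀ {k} → k ∈ range n → h k ∈ range n
    in-range h h-fix h-near {k} k∈ with near? i k
    ... | yes nk = ∈-range⁺ (≤-trans 1≤i (proj₁ (h-near k nk))) (≤-trans (proj₂ (h-near k nk)) i+2≤n)
    ... | no ¬nk rewrite h-fix k ¬nk = k∈

  isPerm : IsPerm n w
  isPerm = unique-⊆-⊇⇒↭ (Uniqueₚ.map⁺ f-injective (range-unique n)) (range-unique n) w⊆ ⊆w
    where
    f-injective : ∀ {x y} → f x ≡ f y → x ≡ y
    f-injective {x} {y} fx≡fy = trans (sym (gf x)) (trans (cong g fx≡fy) (gf y))
    w⊆ : ∀ {a} → a ∈ w → a ∈ range n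
    w⊆ a∈ with u , u∈ , refl ← ∈-map⁻ f a∈ = in-range f f-fix f-near u∈
    ⊆w : ∀ {a} → a ∈ range n → a ∈ w
    ⊆w {a} a∈ = subst (_∈ w) (fg a) (∈-map⁺ f (in-range g g-fix g-near a∈))

  inv⁻ : ∀ {a c} → Inv w a c → Near i a × Near i c × g c < g a
  inv⁻ {a} {c} (a<c , h) with near? i a | near? i c
  ... | yes na | yes nc = na , nc , gc<ga
    where gc<ga = increasing-before⇒< (range-increasing n) (before-map⁻ f g gf h)
  ... | no ¬na | no ¬nc = ⊥-elim (<-asym a<c (subst₂ _<_ (g-fix c ¬nc) (g-fix a ¬na) gc<ga))
    where gc<ga = increasing-before⇒< (range-increasing n) (before-map⁻ f g gf h)
  ... | no ¬na | yes nc = ⊥-elim (¬na (<⇒≤ i<a , ≤-trans (<⇒≤ a<c) (proj₂ nc)))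
    where
    i<a : i < a
    i<a = ≤-<-trans (proj₁ (g-near c nc))
            (subst (g c <_) (g-fix a ¬na) (increasing-before⇒< (range-increasing n) (before-map⁻ f g gf h)))
  ... | yes na | no ¬nc = ⊥-elim (<-asym gc<ga (≤-<-trans (proj₂ (g-near a na)) i+2<c))
    where
    gc<ga = subst (_< g a) (g-fix c ¬nc) (increasing-before⇒< (range-increasing n) (before-map⁻ f g gf h))
    i+2<c : suc (suc i) < c
    i+2<c with suc (suc i) <? c
    ... | yes lt = lt
    ... | no ¬lt = ⊥-elim (¬nc (≤-trans (proj₁ na) (<⇒≤ a<c) , ≮⇒≥ ¬lt))

  inv⁺ : ∀ {a c} → Near i a → Near i c → a < c → g c < g a → Inv w a c
  inv⁺ {a} {c} na nc a<c gc<ga = a<c , subst₂ (Before w) (fg c) (fg a)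
    (before-map⁺ f (increasing-<⇒before (range-increasing n) (g∈ c nc) (g∈ a na) gc<ga))
    where
    g∈ : ∀ k → Near i k → g k ∈ range n
    g∈ k nk = ∈-range⁺ (≤-trans 1≤i (proj₁ (g-near k nk))) (≤-trans (proj₂ (g-near k nk)) i+2≤n)

module Generators (n i : ℕ) (1≤i : 1 ≤ i) (i+2≤n : suc (suc i) ≤ n) where

  private
    i≢i+1 : ∀ {k} → k ≢ suc k
    i≢i+1 = <⇒≢ (n<1+n _)
    i≢i+2 : ∀ {k} → k ≢ suc (suc k)
    i≢i+2 = <⇒≢ (m<n+m _ (s≤s z≤n))

    t₀ t₁ : ℕ → ℕ
    t₀ = transp i (suc i)
    t₁ = transp (suc i) (suc (suc i))

    t-involutive : ∀ a k → transp a (suc a) (transp a (suc a) k) ≡ k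
    t-involutive a k = transp-involutive k i≢i+1

    t-fix : ∀ {a} → Near i a → Near i (suc a) → ∀ k → ¬ Near i k → transp a (suc a) k ≡ k
    t-fix na na+1 k ¬nk = transp-other (λ { refl → ¬nk na }) (λ { refl → ¬nk na+1 })

    t-near : ∀ {a} → Near i a → Near i (suc a) → ∀ k → Near i k → Near i (transp a (suc a) k)
    t-near {a} na na+1 k nk with k ≟ a | k ≟ suc a
    ... | yes refl | _ rewrite transp-left k (suc k) = na+1
    ... | no _ | yes refl rewrite transp-right {a} i≢i+1 = na
    ... | no k≢a | no k≢a+1 rewrite transp-other k≢a k≢a+1 = nk

    n₀ : Near i i
    n₀ = ≤-refl , m≤n+m i 2
    n₁ : Near i (suc i)
    n₁ = n≤1+n i , n≤1+n (suc i)
    n₂ : Near i (suc (suc i))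
    n₂ = m≤n+m i 2 , ≤-refl

    t₀-0 : t₀ i ≡ suc i
    t₀-0 = transp-left i (suc i)
    t₀-1 : t₀ (suc i) ≡ i
    t₀-1 = transp-right i≢i+1
    t₀-2 : t₀ (suc (suc i)) ≡ suc (suc i)
    t₀-2 = transp-other (≢-sym i≢i+2) (≢-sym i≢i+1)
    t₁-0 : t₁ i ≡ i
    t₁-0 = transp-other i≢i+1 i≢i+2
    t₁-1 : t₁ (suc i) ≡ suc (suc i)
    t₁-1 = transp-left (suc i) (suc (suc i))
    t₁-2 : t₁ (suc (suc i)) ≡ suc i
    t₁-2 = transp-right i≢i+1

    i<i+1 : i < suc i
    i<i+1 = n<1+n i
    i+1<i+2 : suc i < suc (suc i)
    i+1<i+2 = n<1+n (suc i)
    i<i+2 : i < suc (suc i)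
    i<i+2 = <-trans i<i+1 i+1<i+2

    module Sᵢ = NearPermutation n i 1≤i i+2≤n t₀ t₀ (t-involutive i) (t-involutive i)
      (t-fix n₀ n₁) (t-fix n₀ n₁) (t-near n₀ n₁) (t-near n₀ n₁)
    module Sᵢ₊₁ = NearPermutation n i 1≤i i+2≤n t₁ t₁ (t-involutive (suc i)) (t-involutive (suc i))
      (t-fix n₁ n₂) (t-fix n₁ n₂) (t-near n₁ n₂) (t-near n₁ n₂)

    t₁t₀-inverse : ∀ k → t₁ (t₀ (t₀ (t₁ k))) ≡ k
    t₁t₀-inverse k rewrite t-involutive i (t₁ k) = t-involutive (suc i) k
    t₀t₁-inverse : ∀ k → t₀ (t₁ (t₁ (t₀ k))) ≡ k
    t₀t₁-inverse k rewrite t-involutive (suc i) (t₀ k) = t-involutive i k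

    fix₂ : ∀ (h₁ h₂ : ℕ → ℕ) → (∀ k → ¬ Near i k → h₁ k ≡ k) → (∀ k → ¬ Near i k → h₂ k ≡ k) →
      ∀ k → ¬ Near i k → h₁ (h₂ k) ≡ k
    fix₂ h₁ h₂ fix₁ fix₂′ k ¬nk rewrite fix₂′ k ¬nk = fix₁ k ¬nk

    module SᵢSᵢ₊₁ = NearPermutation n i 1≤i i+2≤n (t₀ ∘ t₁) (t₁ ∘ t₀) t₁t₀-inverse t₀t₁-inverse
      (fix₂ t₀ t₁ (t-fix n₀ n₁) (t-fix n₁ n₂)) (fix₂ t₁ t₀ (t-fix n₁ n₂) (t-fix n₀ n₁))
      (λ k → t-near n₀ n₁ (t₁ k) ∘ t-near n₁ n₂ k) (λ k → t-near n₁ n₂ (t₀ k) ∘ t-near n₀ n₁ k)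
    module Sᵢ₊₁Sᵢ = NearPermutation n i 1≤i i+2≤n (t₁ ∘ t₀) (t₀ ∘ t₁) t₀t₁-inverse t₁t₀-inverse
      (fix₂ t₁ t₀ (t-fix n₁ n₂) (t-fix n₀ n₁)) (fix₂ t₀ t₁ (t-fix n₀ n₁) (t-fix n₁ n₂))
      (λ k → t-near n₁ n₂ (t₀ k) ∘ t-near n₀ n₁ k) (λ k → t-near n₀ n₁ (t₁ k) ∘ t-near n₁ n₂ k)

  sᵢ-isPerm : IsPerm n (sr n i)
  sᵢ-isPerm = Sᵢ.isPerm

  sᵢ₊₁-isPerm : IsPerm n (sr n (suc i))
  sᵢ₊₁-isPerm = Sᵢ₊₁.isPerm

  sᵢsᵢ₊₁-isPerm : IsPerm n (sr2 n i (suc i))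
  sᵢsᵢ₊₁-isPerm = SᵢSᵢ₊₁.isPerm

  sᵢ₊₁sᵢ-isPerm : IsPerm n (sr2 n (suc i) i)
  sᵢ₊₁sᵢ-isPerm = Sᵢ₊₁Sᵢ.isPerm

  inv-sᵢ⁻ : ∀ {a c} → Inv (sr n i) a c → a ≡ i × c ≡ suc i
  inv-sᵢ⁻ inv with na , nc , lt ← Sᵢ.inv⁻ inv with near-pairs na nc (proj₁ inv)
  ... | inj₁ (refl , refl) = refl , refl
  ... | inj₂ (inj₁ (refl , refl)) = ⊥-elim (<-asym i+1<i+2 (subst₂ _<_ t₀-2 t₀-0 lt))
  ... | inj₂ (inj₂ (refl , refl)) = ⊥-elim (<-asym i<i+2 (subst₂ _<_ t₀-2 t₀-1 lt))

  inv-sᵢ⁺ : Inv (sr n i) i (suc i)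
  inv-sᵢ⁺ = Sᵢ.inv⁺ n₀ n₁ i<i+1 (subst₂ _<_ (sym t₀-1) (sym t₀-0) i<i+1)

  inv-sᵢ₊₁⁻ : ∀ {a c} → Inv (sr n (suc i)) a c → a ≡ suc i × c ≡ suc (suc i)
  inv-sᵢ₊₁⁻ inv with na , nc , lt ← Sᵢ₊₁.inv⁻ inv with near-pairs na nc (proj₁ inv)
  ... | inj₁ (refl , refl) = ⊥-elim (<-asym i<i+2 (subst₂ _<_ t₁-1 t₁-0 lt))
  ... | inj₂ (inj₁ (refl , refl)) = ⊥-elim (<-asym i<i+1 (subst₂ _<_ t₁-2 t₁-0 lt))
  ... | inj₂ (inj₂ (refl , refl)) = refl , refl

  inv-sᵢ₊₁⁺ : Inv (sr n (suc i)) (suc i) (suc (suc i))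
  inv-sᵢ₊₁⁺ = Sᵢ₊₁.inv⁺ n₁ n₂ i+1<i+2 (subst₂ _<_ (sym t₁-2) (sym t₁-1) i+1<i+2)

  inv-sᵢsᵢ₊₁⁻ : ∀ {a c} → Inv (sr2 n i (suc i)) a c → a ≡ i × (c ≡ suc i ⊎ c ≡ suc (suc i))
  inv-sᵢsᵢ₊₁⁻ inv with na , nc , lt ← SᵢSᵢ₊₁.inv⁻ inv with near-pairs na nc (proj₁ inv)
  ... | inj₁ (refl , refl) = refl , inj₁ refl
  ... | inj₂ (inj₁ (refl , refl)) = refl , inj₂ refl
  ... | inj₂ (inj₂ (refl , refl)) =
    ⊥-elim (<-asym i<i+1 (subst₂ _<_ (trans (cong t₁ t₀-2) t₁-2) (trans (cong t₁ t₀-1) t₁-0) lt))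

  inv-sᵢsᵢ₊₁⁺ : ∀ {c} → c ≡ suc i ⊎ c ≡ suc (suc i) → Inv (sr2 n i (suc i)) i c
  inv-sᵢsᵢ₊₁⁺ (inj₁ refl) =
    SᵢSᵢ₊₁.inv⁺ n₀ n₁ i<i+1 (subst₂ _<_ (sym (trans (cong t₁ t₀-1) t₁-0)) (sym (trans (cong t₁ t₀-0) t₁-1)) i<i+2)
  inv-sᵢsᵢ₊₁⁺ (inj₂ refl) =
    SᵢSᵢ₊₁.inv⁺ n₀ n₂ i<i+2 (subst₂ _<_ (sym (trans (cong t₁ t₀-2) t₁-2)) (sym (trans (cong t₁ t₀-0) t₁-1)) i+1<i+2)

  inv-sᵢ₊₁sᵢ⁻ : ∀ {a c} → Inv (sr2 n (suc i) i) a c → (a ≡ i ⊎ a ≡ suc i) × c ≡ suc (suc i)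
  inv-sᵢ₊₁sᵢ⁻ inv with na , nc , lt ← Sᵢ₊₁Sᵢ.inv⁻ inv with near-pairs na nc (proj₁ inv)
  ... | inj₁ (refl , refl) =
    ⊥-elim (<-asym i+1<i+2 (subst₂ _<_ (trans (cong t₀ t₁-1) t₀-2) (trans (cong t₀ t₁-0) t₀-0) lt))
  ... | inj₂ (inj₁ (refl , refl)) = inj₁ refl , refl
  ... | inj₂ (inj₂ (refl , refl)) = inj₂ refl , refl

  inv-sᵢ₊₁sᵢ⁺ : ∀ {a} → a ≡ i ⊎ a ≡ suc i → Inv (sr2 n (suc i) i) a (suc (suc i))
  inv-sᵢ₊₁sᵢ⁺ (inj₁ refl) =
    Sᵢ₊₁Sᵢ.inv⁺ n₀ n₂ i<i+2 (subst₂ _<_ (sym (trans (cong t₀ t₁-2) t₀-1)) (sym (trans (cong t₀ t₁-0) t₀-0)) i<i+1)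
  inv-sᵢ₊₁sᵢ⁺ (inj₂ refl) =
    Sᵢ₊₁Sᵢ.inv⁺ n₁ n₂ i+1<i+2 (subst₂ _<_ (sym (trans (cong t₀ t₁-2) t₀-1)) (sym (trans (cong t₀ t₁-1) t₀-2)) i<i+2)

-- Zones relative to an interval

-- Position of a value b relative to an interval (p, q) and a side function S: below p - 1, at p - 1,
-- at p (S p true / false), strictly inside (S b true / false), at q (S q true / false), at q + 1, above q + 1.
data Zone : Set where
  Lo P0 PA PN IA IN QA QN Q1 Hi : Zone

zoneRank : Zone → ℕ
zoneRank Lo = 0
zoneRank P0 = 1
zoneRank PA = 2
zoneRank PN = 2
zoneRank IA = 3
zoneRank IN = 3
zoneRank QA = 4
zoneRank QN = 4
zoneRank Q1 = 5
zoneRank Hi = 6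

zoneIndex : Zone → ℕ
zoneIndex Lo = 0
zoneIndex P0 = 1
zoneIndex PA = 2
zoneIndex PN = 3
zoneIndex IA = 4
zoneIndex IN = 5
zoneIndex QA = 6
zoneIndex QN = 7
zoneIndex Q1 = 8
zoneIndex Hi = 9

zoneOfIndex : ℕ → Zone
zoneOfIndex 0 = Lo
zoneOfIndex 1 = P0
zoneOfIndex 2 = PA
zoneOfIndex 3 = PN
zoneOfIndex 4 = IA
zoneOfIndex 5 = IN
zoneOfIndex 6 = QA
zoneOfIndex 7 = QN
zoneOfIndex 8 = Q1
zoneOfIndex _ = Hi

zoneOfIndex-zoneIndex : ∀ z → zoneOfIndex (zoneIndex z) ≡ z
zoneOfIndex-zoneIndex Lo = refl
zoneOfIndex-zoneIndex P0 = refl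
zoneOfIndex-zoneIndex PA = refl
zoneOfIndex-zoneIndex PN = refl
zoneOfIndex-zoneIndex IA = refl
zoneOfIndex-zoneIndex IN = refl
zoneOfIndex-zoneIndex QA = refl
zoneOfIndex-zoneIndex QN = refl
zoneOfIndex-zoneIndex Q1 = refl
zoneOfIndex-zoneIndex Hi = refl

_==ᶻ_ : Zone → Zone → Bool
s ==ᶻ t = zoneIndex s ≡ᵇ zoneIndex t

==ᶻ⇒≡ : ∀ s t → T (s ==ᶻ t) → s ≡ t
==ᶻ⇒≡ s t eq = begin
  s                          ≡⟨ sym (zoneOfIndex-zoneIndex s) ⟩
  zoneOfIndex (zoneIndex s)  ≡⟨ cong zoneOfIndex (≡ᵇ⇒≡ (zoneIndex s) (zoneIndex t) eq) ⟩
  zoneOfIndex (zoneIndex t)  ≡⟨ zoneOfIndex-zoneIndex t ⟩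
  t                          ∎
  where open ≡-Reasoning

zones : List Zone
zones = Lo ∷ P0 ∷ PA ∷ PN ∷ IA ∷ IN ∷ QA ∷ QN ∷ Q1 ∷ Hi ∷ []

∈-zones : ∀ z → z ∈ zones
∈-zones Lo = here refl
∈-zones P0 = there (here refl)
∈-zones PA = there (there (here refl))
∈-zones PN = there (there (there (here refl)))
∈-zones IA = there (there (there (there (here refl))))
∈-zones IN = there (there (there (there (there (here refl)))))
∈-zones QA = there (there (there (there (there (there (here refl))))))
∈-zones QN = there (there (there (there (there (there (there (here refl)))))))
∈-zones Q1 = there (there (there (there (there (there (there (there (here refl))))))))
∈-zones Hi = there (there (there (there (there (there (there (there (there (here refl)))))))))

-- Conditions on pairs of zones; every instance below is discharged by evaluation (`tt`).
ZoneCheck : Set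
ZoneCheck = Zone → Zone → Bool

allZones : (Zone → Bool) → Bool
allZones g = all g zones

allZones-sound : ∀ g → T (allZones g) → ∀ z → T (g z)
allZones-sound g ok z = All.lookup (all⁺ g zones ok) (∈-zones z)

allZonePairs : ZoneCheck → Bool
allZonePairs h = allZones (λ s → allZones (h s))

allZonePairs-sound : ∀ h → T (allZonePairs h) → ∀ s t → T (h s t)
allZonePairs-sound h ok s = allZones-sound (h s) (allZones-sound (λ s → allZones (h s)) ok s)

T-not-∨ : ∀ x {y} → T (not x ∨ y) → T x → T y
T-not-∨ true y _ = y

indicator : Bool → ℕ
indicator b = if b then 1 else 0

abstract
  ≤-indicator : ℕ → ℕ → ℕ
  ≤-indicator k b = if k ≤ᵇ b then 1 else 0

  ≤-indicator-1 : ∀ {k b} → k ≤ b → ≤-indicator k b ≡ 1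
  ≤-indicator-1 {k} {b} k≤b with k ≤ᵇ b | ≤⇒≤ᵇ k≤b
  ... | true | _ = refl

  ≤-indicator-0 : ∀ {k b} → b < k → ≤-indicator k b ≡ 0
  ≤-indicator-0 {k} {b} b<k with k ≤ᵇ b in eq
  ... | true = ⊥-elim (<⇒≱ b<k (≤ᵇ⇒≤ k b (from T-≡ eq)))
  ... | false = refl

  ≤-indicator-mono : ∀ k {a c} → a ≤ c → ≤-indicator k a ≤ ≤-indicator k c
  ≤-indicator-mono k {a} a≤c with k ≤ᵇ a in eq
  ... | false = z≤n
  ... | true = ≤-reflexive (sym (≤-indicator-1 (≤-trans (≤ᵇ⇒≤ k a (from T-≡ eq)) a≤c)))

module Zones (n p q : ℕ) (S : ℕ → Bool) (1≤p : 1 ≤ p) (p<q : p < q) where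

  data View (b : ℕ) : Zone → Set where
    vLo : b < p ∸ 1 → View b Lo
    vP0 : b ≡ p ∸ 1 → View b P0
    vPA : b ≡ p → S p ≡ true → View b PA
    vPN : b ≡ p → S p ≡ false → View b PN
    vIA : p < b → b < q → S b ≡ true → View b IA
    vIN : p < b → b < q → S b ≡ false → View b IN
    vQA : b ≡ q → S q ≡ true → View b QA
    vQN : b ≡ q → S q ≡ false → View b QN
    vQ1 : b ≡ suc q → View b Q1
    vHi : suc q < b → View b Hi

  zone : ℕ → Zone
  zone b with <-cmp b (p ∸ 1)
  ... | tri< _ _ _ = Lo
  ... | tri≈ _ _ _ = P0
  ... | tri> _ _ _ with <-cmp b p
  ...   | tri< _ _ _ = Lo
  ...   | tri≈ _ _ _ = if S p then PA else PN
  ...   | tri> _ _ _ with <-cmp b q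
  ...     | tri< _ _ _ = if S b then IA else IN
  ...     | tri≈ _ _ _ = if S q then QA else QN
  ...     | tri> _ _ _ with <-cmp b (suc q)
  ...       | tri< _ _ _ = Hi
  ...       | tri≈ _ _ _ = Q1
  ...       | tri> _ _ _ = Hi

  suc[p-1]≡p : suc (p ∸ 1) ≡ p
  suc[p-1]≡p = suc-pred p
    where instance _ = >-nonZero 1≤p

  p-1<p : p ∸ 1 < p
  p-1<p = ≤-reflexive suc[p-1]≡p

  p-1<q : p ∸ 1 < q
  p-1<q = <-trans p-1<p p<q

  q<q+1 : q < suc q
  q<q+1 = n<1+n q

  p<q+1 : p < suc q
  p<q+1 = <-trans p<q q<q+1

  view : ∀ b → View b (zone b)
  view b with <-cmp b (p ∸ 1)
  ... | tri< lt _ _ = vLo lt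
  ... | tri≈ _ eq _ = vP0 eq
  ... | tri> _ _ gt with <-cmp b p
  ...   | tri< lt _ _ = ⊥-elim (<⇒≱ lt (subst (_≤ b) suc[p-1]≡p gt))
  ...   | tri≈ _ eq _ with S p in e
  ...     | true = vPA eq e
  ...     | false = vPN eq e
  view b | tri> _ _ _ | tri> _ _ gt with <-cmp b q
  ... | tri< lt _ _ with S b in e
  ...   | true = vIA gt lt e
  ...   | false = vIN gt lt e
  view b | tri> _ _ _ | tri> _ _ gt | tri≈ _ eq _ with S q in e
  ... | true = vQA eq e
  ... | false = vQN eq e
  view b | tri> _ _ _ | tri> _ _ _ | tri> _ _ gt with <-cmp b (suc q)
  ... | tri< lt _ _ = ⊥-elim (<⇒≱ lt gt)
  ... | tri≈ _ eq _ = vQ1 eq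
  ... | tri> _ _ gt′ = vHi gt′

  view-at : ∀ {b z} → zone b ≡ z → View b z
  view-at {b} eq = subst (View b) eq (view b)

  rank : ℕ → ℕ
  rank b = ≤-indicator (p ∸ 1) b + (≤-indicator p b + (≤-indicator (suc p) b +
           (≤-indicator q b + (≤-indicator (suc q) b + ≤-indicator (suc (suc q)) b))))

  rank-mono : ∀ {a c} → a ≤ c → rank a ≤ rank c
  rank-mono a≤c = +-mono-≤ (≤-indicator-mono (p ∸ 1) a≤c) (+-mono-≤ (≤-indicator-mono p a≤c)
    (+-mono-≤ (≤-indicator-mono (suc p) a≤c) (+-mono-≤ (≤-indicator-mono q a≤c)
    (+-mono-≤ (≤-indicator-mono (suc q) a≤c) (≤-indicator-mono (suc (suc q)) a≤c)))))

  private
    rank≡ : ∀ {b} x₁ x₂ x₃ x₄ x₅ x₆ →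
      ≤-indicator (p ∸ 1) b ≡ x₁ → ≤-indicator p b ≡ x₂ → ≤-indicator (suc p) b ≡ x₃ →
      ≤-indicator q b ≡ x₄ → ≤-indicator (suc q) b ≡ x₅ → ≤-indicator (suc (suc q)) b ≡ x₆ →
      rank b ≡ x₁ + (x₂ + (x₃ + (x₄ + (x₅ + x₆))))
    rank≡ _ _ _ _ _ _ refl refl refl refl refl refl = refl

    q+1<q+2 : suc q < suc (suc q)
    q+1<q+2 = n<1+n (suc q)

    at-p : ∀ {b} → b ≡ p → rank b ≡ 2
    at-p refl = rank≡ 1 1 0 0 0 0 (≤-indicator-1 (<⇒≤ p-1<p)) (≤-indicator-1 ≤-refl) (≤-indicator-0 (n<1+n p))
      (≤-indicator-0 p<q) (≤-indicator-0 p<q+1) (≤-indicator-0 (<-trans p<q+1 q+1<q+2))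
    inside : ∀ {b} → p < b → b < q → rank b ≡ 3
    inside p<b b<q = rank≡ 1 1 1 0 0 0 (≤-indicator-1 (<⇒≤ (<-trans p-1<p p<b))) (≤-indicator-1 (<⇒≤ p<b))
      (≤-indicator-1 p<b) (≤-indicator-0 b<q) (≤-indicator-0 (<-trans b<q q<q+1))
      (≤-indicator-0 (<-trans b<q (<-trans q<q+1 q+1<q+2)))
    at-q : ∀ {b} → b ≡ q → rank b ≡ 4
    at-q refl = rank≡ 1 1 1 1 0 0 (≤-indicator-1 (<⇒≤ p-1<q)) (≤-indicator-1 (<⇒≤ p<q)) (≤-indicator-1 p<q)
      (≤-indicator-1 ≤-refl) (≤-indicator-0 q<q+1) (≤-indicator-0 (<-trans q<q+1 q+1<q+2))

  zoneRank≡rank : ∀ b → zoneRank (zone b) ≡ rank b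
  zoneRank≡rank b with zone b | view b
  ... | .Lo | vLo b<p-1 = sym (rank≡ 0 0 0 0 0 0 (≤-indicator-0 b<p-1) (≤-indicator-0 b<p)
      (≤-indicator-0 (<-trans b<p (n<1+n p))) (≤-indicator-0 (<-trans b<p p<q))
      (≤-indicator-0 (<-trans b<p p<q+1)) (≤-indicator-0 (<-trans b<p (<-trans p<q+1 q+1<q+2))))
    where b<p = <-trans b<p-1 p-1<p
  ... | .P0 | vP0 refl = sym (rank≡ 1 0 0 0 0 0 (≤-indicator-1 ≤-refl) (≤-indicator-0 p-1<p)
      (≤-indicator-0 (<-trans p-1<p (n<1+n p))) (≤-indicator-0 p-1<q)
      (≤-indicator-0 (<-trans p-1<q q<q+1)) (≤-indicator-0 (<-trans p-1<q (<-trans q<q+1 q+1<q+2))))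
  ... | .PA | vPA refl _ = sym (at-p refl)
  ... | .PN | vPN refl _ = sym (at-p refl)
  ... | .IA | vIA p<b b<q _ = sym (inside p<b b<q)
  ... | .IN | vIN p<b b<q _ = sym (inside p<b b<q)
  ... | .QA | vQA refl _ = sym (at-q refl)
  ... | .QN | vQN refl _ = sym (at-q refl)
  ... | .Q1 | vQ1 refl = sym (rank≡ 1 1 1 1 1 0 (≤-indicator-1 (<⇒≤ p-1<q+1)) (≤-indicator-1 (<⇒≤ p<q+1))
      (≤-indicator-1 p<q+1) (≤-indicator-1 (n≤1+n q)) (≤-indicator-1 ≤-refl) (≤-indicator-0 q+1<q+2))
    where p-1<q+1 = <-trans p-1<p p<q+1
  ... | .Hi | vHi q+1<b = sym (rank≡ 1 1 1 1 1 1 (≤-indicator-1 (<⇒≤ (<-trans p-1<p p<b))) (≤-indicator-1 (<⇒≤ p<b))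
      (≤-indicator-1 p<b) (≤-indicator-1 (<⇒≤ q<b)) (≤-indicator-1 (<⇒≤ q+1<b)) (≤-indicator-1 q+1<b))
    where q<b = <-trans q<q+1 q+1<b
          p<b = <-trans p<q q<b

  zoneRank-mono : ∀ {a c} → a < c → zoneRank (zone a) ≤ zoneRank (zone c)
  zoneRank-mono {a} {c} a<c = subst₂ _≤_ (sym (zoneRank≡rank a)) (sym (zoneRank≡rank c)) (rank-mono (<⇒≤ a<c))

  record ZoneKeyed (w : List ℕ) (f : Zone → ℕ) : Set where
    field
      keyed-isPerm : IsPerm n w
      keyed-inv⁻ : ∀ {a c} → Inv w a c → f (zone c) < f (zone a)
      keyed-inv⁺ : ∀ {a c} → 1 ≤ a → a < c → c ≤ n → f (zone c) < f (zone a) → Inv w a c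
  open ZoneKeyed public

  record ZonesSatisfy (ok : Zone → Bool) : Set where
    constructor zonesSatisfy
    field zone-ok : ∀ b → 1 ≤ b → b ≤ n → T (ok (zone b))
  open ZonesSatisfy

  everyZone : Zone → Bool
  everyZone _ = true

  zonesSatisfy-every : ZonesSatisfy everyZone
  zonesSatisfy-every = zonesSatisfy λ _ _ _ → tt

  zonesSatisfy-avoid : ∀ z → (∀ b → ¬ View b z) → ZonesSatisfy (λ t → not (t ==ᶻ z))
  zonesSatisfy-avoid z empty = zonesSatisfy avoids
    where
    avoids : ∀ b → 1 ≤ b → b ≤ n → T (not (zone b ==ᶻ z))
    avoids b _ _ with zone b ==ᶻ z in eq
    ... | true = empty b (view-at (==ᶻ⇒≡ (zone b) z (from T-≡ eq)))
    ... | false = tt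

  zoneCheck : (Zone → Bool) → ZoneCheck → ZoneCheck
  zoneCheck ok h s t = not (ok s) ∨ (not (ok t) ∨ (not (zoneRank s ≤ᵇ zoneRank t) ∨ h s t))

  zoneCheck-sound : ∀ {ok} h → ZonesSatisfy ok → T (allZonePairs (zoneCheck ok h)) →
    ∀ {a c} → 1 ≤ a → a < c → c ≤ n → T (h (zone a) (zone c))
  zoneCheck-sound {ok} h oks chk {a} {c} 1≤a a<c c≤n =
    T-not-∨ _ (T-not-∨ _ (T-not-∨ _ (allZonePairs-sound (zoneCheck ok h) chk (zone a) (zone c))
      (zone-ok oks a 1≤a (≤-trans (<⇒≤ a<c) c≤n))) (zone-ok oks c (≤-trans 1≤a (<⇒≤ a<c)) c≤n))
      (≤⇒≤ᵇ (zoneRank-mono a<c))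

  Descends : (Zone → ℕ) → ZoneCheck
  Descends f s t = f t <ᵇ f s

  inv-zones : ∀ {ok w f} (P : ZoneCheck) → ZonesSatisfy ok → ZoneKeyed w f →
    T (allZonePairs (zoneCheck ok (λ s t → not (Descends f s t) ∨ P s t))) →
    ∀ {a c} → Inv w a c → T (P (zone a) (zone c))
  inv-zones {f = f} P oks kw chk {a} {c} i =
    T-not-∨ _ (zoneCheck-sound (λ s t → not (Descends f s t) ∨ P s t) oks chk 1≤a (proj₁ i) c≤n) (<⇒<ᵇ (keyed-inv⁻ kw i))
    where
    1≤a = proj₁ (inv-bounds (keyed-isPerm kw) i)
    c≤n = proj₂ (inv-bounds (keyed-isPerm kw) i)

  keyed-≤w : ∀ {ok w v f g} → ZonesSatisfy ok → ZoneKeyed w f → ZoneKeyed v g →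
    T (allZonePairs (zoneCheck ok (λ s t → not (Descends f s t) ∨ Descends g s t))) → w ≤w v
  keyed-≤w {g = g} oks kw kv chk a c i =
    keyed-inv⁺ kv (proj₁ (inv-bounds (keyed-isPerm kw) i)) (proj₁ i) (proj₂ (inv-bounds (keyed-isPerm kw) i))
      (<ᵇ⇒< _ _ (inv-zones (Descends g) oks kw chk i))

  keyed-≤w-meet : ∀ {ok w v u f g h} → ZonesSatisfy ok → ZoneKeyed w f → ZoneKeyed v g → ZoneKeyed u h →
    T (allZonePairs (zoneCheck ok (λ s t → not (Descends f s t) ∨ (not (Descends g s t) ∨ Descends h s t)))) →
    ∀ z → z ≤w w → z ≤w v → z ≤w u
  keyed-≤w-meet {g = g} {h} oks kw kv ku chk z z≤w z≤v a c i =
    keyed-inv⁺ ku (proj₁ (inv-bounds (keyed-isPerm kw) (z≤w a c i))) (proj₁ i) (proj₂ (inv-bounds (keyed-isPerm kw) (z≤w a c i)))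
      (<ᵇ⇒< _ _ (T-not-∨ _ (inv-zones (λ s t → not (Descends g s t) ∨ Descends h s t) oks kw chk (z≤w a c i))
                           (<⇒<ᵇ (keyed-inv⁻ kv (z≤v a c i)))))

  -- `sp` lists the zone pairs whose inversion in every upper bound is shown separately (by transitivity).
  keyed-≤w-join : ∀ {ok w v u f g h} (sp : ZoneCheck) → ZonesSatisfy ok → ZoneKeyed w f → ZoneKeyed v g → ZoneKeyed u h →
    (∀ z a c → IsPerm n z → w ≤w z → v ≤w z → 1 ≤ a → a < c → c ≤ n → T (sp (zone a) (zone c)) → Inv z a c) →
    T (allZonePairs (zoneCheck ok (λ s t → not (Descends h s t) ∨ (Descends f s t ∨ (Descends g s t ∨ sp s t))))) →
    ∀ z → IsPerm n z → w ≤w z → v ≤w z → u ≤w z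
  keyed-≤w-join {f = f} {g} sp oks kw kv ku sp-inv chk z pz w≤z v≤z a c i =
    from-zones (to T-∨ (inv-zones (λ s t → Descends f s t ∨ (Descends g s t ∨ sp s t)) oks ku chk i))
    where
    1≤a = proj₁ (inv-bounds (keyed-isPerm ku) i)
    c≤n = proj₂ (inv-bounds (keyed-isPerm ku) i)
    from-zones : T (Descends f (zone a) (zone c)) ⊎ T (Descends g (zone a) (zone c) ∨ sp (zone a) (zone c)) → Inv z a c
    from-zones (inj₁ f-desc) = w≤z a c (keyed-inv⁺ kw 1≤a (proj₁ i) c≤n (<ᵇ⇒< _ _ f-desc))
    from-zones (inj₂ rest) with to (T-∨ {Descends g (zone a) (zone c)}) rest
    ... | inj₁ g-desc = v≤z a c (keyed-inv⁺ kv 1≤a (proj₁ i) c≤n (<ᵇ⇒< _ _ g-desc))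
    ... | inj₂ special = sp-inv z a c pz w≤z v≤z 1≤a (proj₁ i) c≤n special

  keyed-isMeet : ∀ {ok w v u f g h} → ZonesSatisfy ok → ZoneKeyed w f → ZoneKeyed v g → ZoneKeyed u h →
    T (allZonePairs (zoneCheck ok (λ s t → not (Descends h s t) ∨ Descends f s t))) →
    T (allZonePairs (zoneCheck ok (λ s t → not (Descends h s t) ∨ Descends g s t))) →
    T (allZonePairs (zoneCheck ok (λ s t → not (Descends f s t) ∨ (not (Descends g s t) ∨ Descends h s t)))) →
    IsMeet n w v u
  keyed-isMeet oks kw kv ku u≤w u≤v meet =
    keyed-isPerm ku , keyed-≤w oks ku kw u≤w , keyed-≤w oks ku kv u≤v , λ z _ → keyed-≤w-meet oks kw kv ku meet z

  keyed-isJoinWith : ∀ {ok w v u f g h} (sp : ZoneCheck) → ZonesSatisfy ok → ZoneKeyed w f → ZoneKeyed v g → ZoneKeyed u h →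
    (∀ z a c → IsPerm n z → w ≤w z → v ≤w z → 1 ≤ a → a < c → c ≤ n → T (sp (zone a) (zone c)) → Inv z a c) →
    T (allZonePairs (zoneCheck ok (λ s t → not (Descends f s t) ∨ Descends h s t))) →
    T (allZonePairs (zoneCheck ok (λ s t → not (Descends g s t) ∨ Descends h s t))) →
    T (allZonePairs (zoneCheck ok (λ s t → not (Descends h s t) ∨ (Descends f s t ∨ (Descends g s t ∨ sp s t))))) →
    IsJoin n w v u
  keyed-isJoinWith sp oks kw kv ku sp-inv w≤u v≤u join =
    keyed-isPerm ku , keyed-≤w oks kw ku w≤u , keyed-≤w oks kv ku v≤u , keyed-≤w-join sp oks kw kv ku sp-inv join

  keyed-isJoin : ∀ {ok w v u f g h} → ZonesSatisfy ok → ZoneKeyed w f → ZoneKeyed v g → ZoneKeyed u h →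
    T (allZonePairs (zoneCheck ok (λ s t → not (Descends f s t) ∨ Descends h s t))) →
    T (allZonePairs (zoneCheck ok (λ s t → not (Descends g s t) ∨ Descends h s t))) →
    T (allZonePairs (zoneCheck ok (λ s t → not (Descends h s t) ∨ (Descends f s t ∨ (Descends g s t ∨ false))))) →
    IsJoin n w v u
  keyed-isJoin oks kw kv ku = keyed-isJoinWith (λ _ _ → false) oks kw kv ku (λ _ _ _ _ _ _ _ _ _ ())

  permOfSubset-keyed : ∀ (A : ℕ → Bool) (fA : Zone → Bool) → (∀ b → A b ≡ fA (zone b)) →
    ZoneKeyed (permOfSubset n A) (indicator ∘ fA)
  permOfSubset-keyed A fA A≡ = record
    { keyed-isPerm = permOfSubset-isPerm n A ; keyed-inv⁻ = inv⁻ ; keyed-inv⁺ = inv⁺ }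
    where
    inv⁻ : ∀ {a c} → Inv (permOfSubset n A) a c → indicator (fA (zone c)) < indicator (fA (zone a))
    inv⁻ {a} {c} i with _ , Aa , Ac ← inv-permOfSubset⁻ n A i rewrite A≡ a | A≡ c | Aa | Ac = s≤s z≤n
    inv⁺ : ∀ {a c} → 1 ≤ a → a < c → c ≤ n → indicator (fA (zone c)) < indicator (fA (zone a)) → Inv (permOfSubset n A) a c
    inv⁺ {a} {c} 1≤a a<c c≤n lt with fA (zone a) in Aa | fA (zone c) in Ac
    ... | true | false = inv-permOfSubset⁺ n A 1≤a a<c c≤n (trans (A≡ a) Aa) (trans (A≡ c) Ac)
    ... | true | true = ⊥-elim (<-irrefl refl lt)
    ... | false | false = ⊥-elim (<-irrefl refl lt)
    ... | false | true = ⊥-elim (<-asym lt (s≤s z≤n))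

  sortByKey-keyed : ∀ (κ : ℕ → ℕ) (κ<5 : ∀ b → κ b < 5) (f : Zone → ℕ) → (∀ b → κ b ≡ f (zone b)) →
    ZoneKeyed (sortByKey n 5 κ) f
  sortByKey-keyed κ κ<5 f κ≡ = record
    { keyed-isPerm = sortByKey-isPerm n 5 κ κ<5
    ; keyed-inv⁻ = λ {a} {c} i → subst₂ _<_ (κ≡ c) (κ≡ a) (proj₂ (inv-sortByKey⁻ n 5 κ κ<5 i))
    ; keyed-inv⁺ = λ {a} {c} 1≤a a<c c≤n lt →
        inv-sortByKey⁺ n 5 κ κ<5 1≤a a<c c≤n (subst₂ _<_ (sym (κ≡ c)) (sym (κ≡ a)) lt)
    }

  sortByZoneKey : (Zone → ℕ) → List ℕ
  sortByZoneKey f = sortByKey n 5 (f ∘ zone)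

  sortByZoneKey-keyed : ∀ f → T (allZones (λ z → f z <ᵇ 5)) → ZoneKeyed (sortByZoneKey f) f
  sortByZoneKey-keyed f f<5 = sortByKey-keyed (f ∘ zone) (λ b → <ᵇ⇒< _ _ (allZones-sound (λ z → f z <ᵇ 5) f<5 (zone b)))
    f (λ _ → refl)

-- Arcs and their lower covers

true≢false : true ≢ false
true≢false ()

<ᵇ-true : ∀ {a b} → a < b → (a <ᵇ b) ≡ true
<ᵇ-true a<b = to T-≡ (<⇒<ᵇ a<b)

<ᵇ-false : ∀ {a b} → b ≤ a → (a <ᵇ b) ≡ false
<ᵇ-false {a} {b} b≤a with a <ᵇ b in eq
... | true = ⊥-elim (<⇒≱ (<ᵇ⇒< a b (from T-≡ eq)) b≤a)
... | false = refl

module _ (S : ℕ → Bool) where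

  cambrianSubset-below : ∀ {p q b} → b < p → p < q → cambrianSubset S p q b ≡ false
  cambrianSubset-below {p} {q} {b} b<p p<q
    rewrite ≢⇒≡ᵇ-false (<⇒≢ b<p) | <ᵇ-false {p} {b} (<⇒≤ b<p) | <ᵇ-false {q} {b} (<⇒≤ (<-trans b<p p<q)) = refl

  cambrianSubset-left : ∀ p q → cambrianSubset S p q p ≡ true
  cambrianSubset-left p q rewrite ≡ᵇ-refl p = refl

  cambrianSubset-inside : ∀ {p q b} → p < b → b < q → cambrianSubset S p q b ≡ S b
  cambrianSubset-inside {p} {q} {b} p<b b<q
    rewrite ≢⇒≡ᵇ-false (≢-sym (<⇒≢ p<b)) | <ᵇ-true p<b | <ᵇ-true b<q | <ᵇ-false {q} {b} (<⇒≤ b<q) = ∨-identityʳ (S b)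

  cambrianSubset-right : ∀ {p q} → p < q → cambrianSubset S p q q ≡ false
  cambrianSubset-right {p} {q} p<q rewrite ≢⇒≡ᵇ-false (≢-sym (<⇒≢ p<q)) | <ᵇ-true p<q | <ᵇ-false {q} {q} ≤-refl = refl

  cambrianSubset-above : ∀ {p q b} → q < b → p < q → cambrianSubset S p q b ≡ true
  cambrianSubset-above {p} {q} {b} q<b p<q
    rewrite ≢⇒≡ᵇ-false (≢-sym (<⇒≢ (<-trans p<q q<b))) | <ᵇ-true (<-trans p<q q<b) | <ᵇ-false {b} {q} (<⇒≤ q<b)
          | <ᵇ-true q<b = refl

cambrianSubset-cong : ∀ {S S′ m M} → (∀ b → m < b → b < M → S b ≡ S′ b) →
  ∀ k → cambrianSubset S m M k ≡ cambrianSubset S′ m M k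
cambrianSubset-cong {S} {S′} {m} {M} S≗S′ k with m <ᵇ k in m<ᵇk | k <ᵇ M in k<ᵇM
... | false | _ = refl
... | true | false = refl
... | true | true rewrite S≗S′ k (<ᵇ⇒< m k (from T-≡ m<ᵇk)) (<ᵇ⇒< k M (from T-≡ k<ᵇM)) = refl

-- The join-irreducible of the arc (p, q) whose interior points b lie on the side S b.
arc : ℕ → ℕ → ℕ → (ℕ → Bool) → List ℕ
arc n p q S = permOfSubset n (cambrianSubset S p q)

-- Its lower cover, with p and q swapped: [n] \ A without q, then p, then q, then A without p.
arc*-key : ℕ → ℕ → (ℕ → Bool) → ℕ → ℕ
arc*-key p q S b = if b ≡ᵇ p then 1 else (if b ≡ᵇ q then 2 else (if cambrianSubset S p q b then 3 else 0))

arc* : ℕ → ℕ → ℕ → (ℕ → Bool) → List ℕ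
arc* n p q S = sortByKey n 5 (arc*-key p q S)

arc*-key<5 : ∀ p q S b → arc*-key p q S b < 5
arc*-key<5 p q S b with b ≡ᵇ p | b ≡ᵇ q | cambrianSubset S p q b
... | true | _ | _ = s≤s (s≤s z≤n)
... | false | true | _ = s≤s (s≤s (s≤s z≤n))
... | false | false | true = s≤s (s≤s (s≤s (s≤s z≤n)))
... | false | false | false = s≤s z≤n

module _ (S : ℕ → Bool) where

  arc*-key-below : ∀ {p q b} → b < p → p < q → arc*-key p q S b ≡ 0
  arc*-key-below b<p p<q
    rewrite cambrianSubset-below S b<p p<q | ≢⇒≡ᵇ-false (<⇒≢ b<p) | ≢⇒≡ᵇ-false (<⇒≢ (<-trans b<p p<q)) = refl

  arc*-key-left : ∀ p q → arc*-key p q S p ≡ 1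
  arc*-key-left p q rewrite ≡ᵇ-refl p = refl

  arc*-key-inside : ∀ {p q b} → p < b → b < q → arc*-key p q S b ≡ (if S b then 3 else 0)
  arc*-key-inside p<b b<q
    rewrite cambrianSubset-inside S p<b b<q | ≢⇒≡ᵇ-false (≢-sym (<⇒≢ p<b)) | ≢⇒≡ᵇ-false (<⇒≢ b<q) = refl

  arc*-key-right : ∀ {p q} → p < q → arc*-key p q S q ≡ 2
  arc*-key-right {p} {q} p<q rewrite ≢⇒≡ᵇ-false (≢-sym (<⇒≢ p<q)) | ≡ᵇ-refl q = refl

  arc*-key-above : ∀ {p q b} → q < b → p < q → arc*-key p q S b ≡ 3
  arc*-key-above q<b p<q
    rewrite cambrianSubset-above S q<b p<q | ≢⇒≡ᵇ-false (≢-sym (<⇒≢ (<-trans p<q q<b)))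
          | ≢⇒≡ᵇ-false (≢-sym (<⇒≢ q<b)) = refl

arcZones arcZonesₗ arcZonesᵣ : Zone → Bool
arcZones Lo = false
arcZones P0 = false
arcZones PA = true
arcZones PN = true
arcZones IA = true
arcZones IN = false
arcZones QA = false
arcZones QN = false
arcZones Q1 = true
arcZones Hi = true

arcZonesₗ Lo = false
arcZonesₗ P0 = true
arcZonesₗ PA = true
arcZonesₗ PN = false
arcZonesₗ IA = true
arcZonesₗ IN = false
arcZonesₗ QA = false
arcZonesₗ QN = false
arcZonesₗ Q1 = true
arcZonesₗ Hi = true

arcZonesᵣ Lo = false
arcZonesᵣ P0 = false
arcZonesᵣ PA = true
arcZonesᵣ PN = true
arcZonesᵣ IA = true
arcZonesᵣ IN = false
arcZonesᵣ QA = true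
arcZonesᵣ QN = false
arcZonesᵣ Q1 = false
arcZonesᵣ Hi = true

arc*Zones arc*Zonesₗ arc*Zonesᵣ : Zone → ℕ
arc*Zones Lo = 0
arc*Zones P0 = 0
arc*Zones PA = 1
arc*Zones PN = 1
arc*Zones IA = 3
arc*Zones IN = 0
arc*Zones QA = 2
arc*Zones QN = 2
arc*Zones Q1 = 3
arc*Zones Hi = 3

arc*Zonesₗ Lo = 0
arc*Zonesₗ P0 = 1
arc*Zonesₗ PA = 3
arc*Zonesₗ PN = 0
arc*Zonesₗ IA = 3
arc*Zonesₗ IN = 0
arc*Zonesₗ QA = 2
arc*Zonesₗ QN = 2
arc*Zonesₗ Q1 = 3
arc*Zonesₗ Hi = 3

arc*Zonesᵣ Lo = 0
arc*Zonesᵣ P0 = 0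
arc*Zonesᵣ PA = 1
arc*Zonesᵣ PN = 1
arc*Zonesᵣ IA = 3
arc*Zonesᵣ IN = 0
arc*Zonesᵣ QA = 3
arc*Zonesᵣ QN = 0
arc*Zonesᵣ Q1 = 2
arc*Zonesᵣ Hi = 3

isP0 isP isIA isIN isQ isQ1 : Zone → Bool
isP0 P0 = true
isP0 _ = false
isP PA = true
isP PN = true
isP _ = false
isQ QA = true
isQ QN = true
isQ _ = false
isIA IA = true
isIA _ = false
isIN IN = true
isIN _ = false
isQ1 Q1 = true
isQ1 _ = false

arcZones-A : ∀ z → T (isP z ∨ isIA z) → indicator (arcZones z) ≡ 1
arcZones-A PA _ = refl
arcZones-A PN _ = refl
arcZones-A IA _ = refl

arcZones-∉A : ∀ z → T (isIN z ∨ isQ z) → indicator (arcZones z) ≡ 0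
arcZones-∉A IN _ = refl
arcZones-∉A QA _ = refl
arcZones-∉A QN _ = refl

module Arcs (n p q : ℕ) (S : ℕ → Bool) (1≤p : 1 ≤ p) (p<q : p < q) where
  open Zones n p q S 1≤p p<q public

  arc-zones : ∀ b → cambrianSubset S p q b ≡ arcZones (zone b)
  arc-zones b with zone b | view b
  ... | .Lo | vLo b<p-1 = cambrianSubset-below S (<-trans b<p-1 p-1<p) p<q
  ... | .P0 | vP0 refl = cambrianSubset-below S p-1<p p<q
  ... | .PA | vPA refl _ = cambrianSubset-left S p q
  ... | .PN | vPN refl _ = cambrianSubset-left S p q
  ... | .IA | vIA p<b b<q Sb = trans (cambrianSubset-inside S p<b b<q) Sb
  ... | .IN | vIN p<b b<q Sb = trans (cambrianSubset-inside S p<b b<q) Sb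
  ... | .QA | vQA refl _ = cambrianSubset-right S p<q
  ... | .QN | vQN refl _ = cambrianSubset-right S p<q
  ... | .Q1 | vQ1 refl = cambrianSubset-above S q<q+1 p<q
  ... | .Hi | vHi q+1<b = cambrianSubset-above S (<-trans q<q+1 q+1<b) p<q

  arcₗ-zones : ∀ b → cambrianSubset S (p ∸ 1) q b ≡ arcZonesₗ (zone b)
  arcₗ-zones b with zone b | view b
  ... | .Lo | vLo b<p-1 = cambrianSubset-below S b<p-1 p-1<q
  ... | .P0 | vP0 refl = cambrianSubset-left S (p ∸ 1) q
  ... | .PA | vPA refl Sp = trans (cambrianSubset-inside S p-1<p p<q) Sp
  ... | .PN | vPN refl Sp = trans (cambrianSubset-inside S p-1<p p<q) Sp
  ... | .IA | vIA p<b b<q Sb = trans (cambrianSubset-inside S (<-trans p-1<p p<b) b<q) Sb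
  ... | .IN | vIN p<b b<q Sb = trans (cambrianSubset-inside S (<-trans p-1<p p<b) b<q) Sb
  ... | .QA | vQA refl _ = cambrianSubset-right S p-1<q
  ... | .QN | vQN refl _ = cambrianSubset-right S p-1<q
  ... | .Q1 | vQ1 refl = cambrianSubset-above S q<q+1 p-1<q
  ... | .Hi | vHi q+1<b = cambrianSubset-above S (<-trans q<q+1 q+1<b) p-1<q

  arcᵣ-zones : ∀ b → cambrianSubset S p (suc q) b ≡ arcZonesᵣ (zone b)
  arcᵣ-zones b with zone b | view b
  ... | .Lo | vLo b<p-1 = cambrianSubset-below S (<-trans b<p-1 p-1<p) p<q+1
  ... | .P0 | vP0 refl = cambrianSubset-below S p-1<p p<q+1
  ... | .PA | vPA refl _ = cambrianSubset-left S p (suc q)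
  ... | .PN | vPN refl _ = cambrianSubset-left S p (suc q)
  ... | .IA | vIA p<b b<q Sb = trans (cambrianSubset-inside S p<b (<-trans b<q q<q+1)) Sb
  ... | .IN | vIN p<b b<q Sb = trans (cambrianSubset-inside S p<b (<-trans b<q q<q+1)) Sb
  ... | .QA | vQA refl Sq = trans (cambrianSubset-inside S p<q q<q+1) Sq
  ... | .QN | vQN refl Sq = trans (cambrianSubset-inside S p<q q<q+1) Sq
  ... | .Q1 | vQ1 refl = cambrianSubset-right S p<q+1
  ... | .Hi | vHi q+1<b = cambrianSubset-above S q+1<b p<q+1

  arc*-zones : ∀ b → arc*-key p q S b ≡ arc*Zones (zone b)
  arc*-zones b with zone b | view b
  ... | .Lo | vLo b<p-1 = arc*-key-below S (<-trans b<p-1 p-1<p) p<q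
  ... | .P0 | vP0 refl = arc*-key-below S p-1<p p<q
  ... | .PA | vPA refl _ = arc*-key-left S p q
  ... | .PN | vPN refl _ = arc*-key-left S p q
  ... | .IA | vIA p<b b<q Sb rewrite arc*-key-inside S p<b b<q | Sb = refl
  ... | .IN | vIN p<b b<q Sb rewrite arc*-key-inside S p<b b<q | Sb = refl
  ... | .QA | vQA refl _ = arc*-key-right S p<q
  ... | .QN | vQN refl _ = arc*-key-right S p<q
  ... | .Q1 | vQ1 refl = arc*-key-above S q<q+1 p<q
  ... | .Hi | vHi q+1<b = arc*-key-above S (<-trans q<q+1 q+1<b) p<q

  arc*ₗ-zones : ∀ b → arc*-key (p ∸ 1) q S b ≡ arc*Zonesₗ (zone b)
  arc*ₗ-zones b with zone b | view b
  ... | .Lo | vLo b<p-1 = arc*-key-below S b<p-1 p-1<q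
  ... | .P0 | vP0 refl = arc*-key-left S (p ∸ 1) q
  ... | .PA | vPA refl Sp rewrite arc*-key-inside S p-1<p p<q | Sp = refl
  ... | .PN | vPN refl Sp rewrite arc*-key-inside S p-1<p p<q | Sp = refl
  ... | .IA | vIA p<b b<q Sb rewrite arc*-key-inside S (<-trans p-1<p p<b) b<q | Sb = refl
  ... | .IN | vIN p<b b<q Sb rewrite arc*-key-inside S (<-trans p-1<p p<b) b<q | Sb = refl
  ... | .QA | vQA refl _ = arc*-key-right S p-1<q
  ... | .QN | vQN refl _ = arc*-key-right S p-1<q
  ... | .Q1 | vQ1 refl = arc*-key-above S q<q+1 p-1<q
  ... | .Hi | vHi q+1<b = arc*-key-above S (<-trans q<q+1 q+1<b) p-1<q

  arc*ᵣ-zones : ∀ b → arc*-key p (suc q) S b ≡ arc*Zonesᵣ (zone b)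
  arc*ᵣ-zones b with zone b | view b
  ... | .Lo | vLo b<p-1 = arc*-key-below S (<-trans b<p-1 p-1<p) p<q+1
  ... | .P0 | vP0 refl = arc*-key-below S p-1<p p<q+1
  ... | .PA | vPA refl _ = arc*-key-left S p (suc q)
  ... | .PN | vPN refl _ = arc*-key-left S p (suc q)
  ... | .IA | vIA p<b b<q Sb rewrite arc*-key-inside S p<b (<-trans b<q q<q+1) | Sb = refl
  ... | .IN | vIN p<b b<q Sb rewrite arc*-key-inside S p<b (<-trans b<q q<q+1) | Sb = refl
  ... | .QA | vQA refl Sq rewrite arc*-key-inside S p<q q<q+1 | Sq = refl
  ... | .QN | vQN refl Sq rewrite arc*-key-inside S p<q q<q+1 | Sq = refl
  ... | .Q1 | vQ1 refl = arc*-key-right S p<q+1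
  ... | .Hi | vHi q+1<b = arc*-key-above S q+1<b p<q+1

  arc-keyed : ZoneKeyed (arc n p q S) (indicator ∘ arcZones)
  arc-keyed = permOfSubset-keyed (cambrianSubset S p q) arcZones arc-zones

  arcₗ-keyed : ZoneKeyed (arc n (p ∸ 1) q S) (indicator ∘ arcZonesₗ)
  arcₗ-keyed = permOfSubset-keyed (cambrianSubset S (p ∸ 1) q) arcZonesₗ arcₗ-zones

  arcᵣ-keyed : ZoneKeyed (arc n p (suc q) S) (indicator ∘ arcZonesᵣ)
  arcᵣ-keyed = permOfSubset-keyed (cambrianSubset S p (suc q)) arcZonesᵣ arcᵣ-zones

  arc*-keyed : ZoneKeyed (arc* n p q S) arc*Zones
  arc*-keyed = sortByKey-keyed (arc*-key p q S) (arc*-key<5 p q S) arc*Zones arc*-zones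

  arc*ₗ-keyed : ZoneKeyed (arc* n (p ∸ 1) q S) arc*Zonesₗ
  arc*ₗ-keyed = sortByKey-keyed (arc*-key (p ∸ 1) q S) (arc*-key<5 (p ∸ 1) q S) arc*Zonesₗ arc*ₗ-zones

  arc*ᵣ-keyed : ZoneKeyed (arc* n p (suc q) S) arc*Zonesᵣ
  arc*ᵣ-keyed = sortByKey-keyed (arc*-key p (suc q) S) (arc*-key<5 p (suc q) S) arc*Zonesᵣ arc*ᵣ-zones

  zone-p : zone p ≡ (if S p then PA else PN)
  zone-p with zone p | view p
  ... | .Lo | vLo p<p-1 = ⊥-elim (<-asym p<p-1 p-1<p)
  ... | .P0 | vP0 p≡p-1 = ⊥-elim (<⇒≢ p-1<p (sym p≡p-1))
  ... | .PA | vPA _ Sp rewrite Sp = refl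
  ... | .PN | vPN _ Sp rewrite Sp = refl
  ... | .IA | vIA p<p _ _ = ⊥-elim (<-irrefl refl p<p)
  ... | .IN | vIN p<p _ _ = ⊥-elim (<-irrefl refl p<p)
  ... | .QA | vQA p≡q _ = ⊥-elim (<⇒≢ p<q p≡q)
  ... | .QN | vQN p≡q _ = ⊥-elim (<⇒≢ p<q p≡q)
  ... | .Q1 | vQ1 p≡q+1 = ⊥-elim (<⇒≢ p<q+1 p≡q+1)
  ... | .Hi | vHi q+1<p = ⊥-elim (<-asym q+1<p p<q+1)

  zone-q : zone q ≡ (if S q then QA else QN)
  zone-q with zone q | view q
  ... | .Lo | vLo q<p-1 = ⊥-elim (<-asym q<p-1 p-1<q)
  ... | .P0 | vP0 q≡p-1 = ⊥-elim (<⇒≢ p-1<q (sym q≡p-1))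
  ... | .PA | vPA q≡p _ = ⊥-elim (<⇒≢ p<q (sym q≡p))
  ... | .PN | vPN q≡p _ = ⊥-elim (<⇒≢ p<q (sym q≡p))
  ... | .IA | vIA _ q<q _ = ⊥-elim (<-irrefl refl q<q)
  ... | .IN | vIN _ q<q _ = ⊥-elim (<-irrefl refl q<q)
  ... | .QA | vQA _ Sq rewrite Sq = refl
  ... | .QN | vQN _ Sq rewrite Sq = refl
  ... | .Q1 | vQ1 q≡q+1 = ⊥-elim (<⇒≢ q<q+1 q≡q+1)
  ... | .Hi | vHi q+1<q = ⊥-elim (<-asym q+1<q q<q+1)

  zone-p-1 : zone (p ∸ 1) ≡ P0
  zone-p-1 with zone (p ∸ 1) | view (p ∸ 1)
  ... | .P0 | vP0 _ = refl
  ... | .Lo | vLo p-1<p-1 = ⊥-elim (<-irrefl refl p-1<p-1)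
  ... | .PA | vPA p-1≡p _ = ⊥-elim (<⇒≢ p-1<p p-1≡p)
  ... | .PN | vPN p-1≡p _ = ⊥-elim (<⇒≢ p-1<p p-1≡p)
  ... | .IA | vIA p<p-1 _ _ = ⊥-elim (<-asym p<p-1 p-1<p)
  ... | .IN | vIN p<p-1 _ _ = ⊥-elim (<-asym p<p-1 p-1<p)
  ... | .QA | vQA p-1≡q _ = ⊥-elim (<⇒≢ p-1<q p-1≡q)
  ... | .QN | vQN p-1≡q _ = ⊥-elim (<⇒≢ p-1<q p-1≡q)
  ... | .Q1 | vQ1 p-1≡q+1 = ⊥-elim (<⇒≢ (<-trans p-1<q q<q+1) p-1≡q+1)
  ... | .Hi | vHi q+1<p-1 = ⊥-elim (<-asym q+1<p-1 (<-trans p-1<q q<q+1))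
  zone-q+1 : zone (suc q) ≡ Q1
  zone-q+1 with zone (suc q) | view (suc q)
  ... | .Q1 | vQ1 _ = refl
  ... | .Lo | vLo q+1<p-1 = ⊥-elim (<-asym q+1<p-1 (<-trans p-1<q q<q+1))
  ... | .P0 | vP0 q+1≡p-1 = ⊥-elim (<⇒≢ (<-trans p-1<q q<q+1) (sym q+1≡p-1))
  ... | .PA | vPA q+1≡p _ = ⊥-elim (<⇒≢ p<q+1 (sym q+1≡p))
  ... | .PN | vPN q+1≡p _ = ⊥-elim (<⇒≢ p<q+1 (sym q+1≡p))
  ... | .IA | vIA _ q+1<q _ = ⊥-elim (<-asym q+1<q q<q+1)
  ... | .IN | vIN _ q+1<q _ = ⊥-elim (<-asym q+1<q q<q+1)
  ... | .QA | vQA q+1≡q _ = ⊥-elim (<⇒≢ q<q+1 (sym q+1≡q))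
  ... | .QN | vQN q+1≡q _ = ⊥-elim (<⇒≢ q<q+1 (sym q+1≡q))
  ... | .Hi | vHi q+1<q+1 = ⊥-elim (<-irrefl refl q+1<q+1)
  isP0-at : ∀ {b} → T (isP0 (zone b)) → b ≡ p ∸ 1
  isP0-at {b} _ with zone b | view b
  ... | .P0 | vP0 b≡p-1 = b≡p-1

  isP-at : ∀ {b} → T (isP (zone b)) → b ≡ p
  isP-at {b} _ with zone b | view b
  ... | .PA | vPA b≡p _ = b≡p
  ... | .PN | vPN b≡p _ = b≡p

  isQ-at : ∀ {b} → T (isQ (zone b)) → b ≡ q
  isQ-at {b} _ with zone b | view b
  ... | .QA | vQA b≡q _ = b≡q
  ... | .QN | vQN b≡q _ = b≡q

  isP-zone-p : T (isP (zone p) ∨ isIA (zone p))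
  isP-zone-p rewrite zone-p with S p
  ... | true = tt
  ... | false = tt

  isQ-zone-q : T (isIN (zone q) ∨ isQ (zone q))
  isQ-zone-q rewrite zone-q with S q
  ... | true = tt
  ... | false = tt

  isQ1-at : ∀ {b} → T (isQ1 (zone b)) → b ≡ suc q
  isQ1-at {b} _ with zone b | view b
  ... | .Q1 | vQ1 b≡q+1 = b≡q+1

  isIA-at : ∀ {b} → T (isIA (zone b)) → p < b × b < q
  isIA-at {b} _ with zone b | view b
  ... | .IA | vIA p<b b<q _ = p<b , b<q

  isIN-at : ∀ {b} → T (isIN (zone b)) → p < b × b < q
  isIN-at {b} _ with zone b | view b
  ... | .IN | vIN p<b b<q _ = p<b , b<q

  arc-key-p : indicator (arcZones (zone p)) ≡ 1
  arc-key-p = arcZones-A (zone p) isP-zone-p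

  arc-key-q : indicator (arcZones (zone q)) ≡ 0
  arc-key-q = arcZones-∉A (zone q) isQ-zone-q

  arc*-key-p : arc*Zones (zone p) ≡ 1
  arc*-key-p rewrite zone-p with S p
  ... | true = refl
  ... | false = refl

  arc*-key-q : arc*Zones (zone q) ≡ 2
  arc*-key-q rewrite zone-q with S q
  ... | true = refl
  ... | false = refl

  inv-arc-pq : q ≤ n → Inv (arc n p q S) p q
  inv-arc-pq q≤n = keyed-inv⁺ arc-keyed 1≤p p<q q≤n (subst₂ _<_ (sym arc-key-q) (sym arc-key-p) (s≤s z≤n))

module ArcCover (n p q : ℕ) (S : ℕ → Bool) (1≤p : 1 ≤ p) (p<q : p < q) (q≤n : q ≤ n) where
  open Arcs n p q S 1≤p p<q

  private
    δ δ* : List ℕ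
    δ = arc n p q S
    δ* = arc* n p q S
    A : ℕ → Bool
    A = cambrianSubset S p q

  ¬inv-arc*-pq : ¬ Inv δ* p q
  ¬inv-arc*-pq i = <-asym (subst₂ _<_ arc*-key-q arc*-key-p (keyed-inv⁻ arc*-keyed i)) (s≤s (s≤s z≤n))

  arc*≤arc : δ* ≤w δ
  arc*≤arc = keyed-≤w zonesSatisfy-every arc*-keyed arc-keyed tt

  inv-arc⇒inv-arc* : ∀ {a c} → Inv δ a c → ¬ (a ≡ p × c ≡ q) → Inv δ* a c
  inv-arc⇒inv-arc* {a} {c} i ≢pq
    with to T-∨ (inv-zones (λ s t → Descends arc*Zones s t ∨ (isP s ∧ isQ t)) zonesSatisfy-every arc-keyed tt i)
  ... | inj₁ lt = keyed-inv⁺ arc*-keyed (proj₁ (inv-bounds (keyed-isPerm arc-keyed) i)) (proj₁ i)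
                   (proj₂ (inv-bounds (keyed-isPerm arc-keyed) i)) (<ᵇ⇒< _ _ lt)
  ... | inj₂ pq with Pa , Qc ← to T-∧ pq = ⊥-elim (≢pq (isP-at Pa , isQ-at Qc))

  private
    outside inside : List ℕ
    outside = filter (T? ∘ not ∘ A) (range n)
    inside = filter (T? ∘ A) (range n)

    nothing-after-q : ∀ {y} → ¬ Before outside q y
    nothing-after-q h with _ , (_ , ¬Ay) , q<y ← before-filter⁻ (T? ∘ not ∘ A) (range-increasing n) h =
      true≢false (trans (sym (cambrianSubset-above S q<y p<q)) (to T-not-≡ ¬Ay))

    nothing-before-p : ∀ {x} → ¬ Before inside x p
    nothing-before-p h with (_ , Ax) , _ , x<p ← before-filter⁻ (T? ∘ A) (range-increasing n) h =
      true≢false (trans (sym (to T-≡ Ax)) (cambrianSubset-below S x<p p<q))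

    q-last : Σ (List ℕ) λ xs → outside ≡ xs ++ q ∷ []
    q-last with ∈-∃++ (∈-filter⁺ (T? ∘ not ∘ A) (∈-range⁺ (≤-trans 1≤p (<⇒≤ p<q)) q≤n)
                                 (from T-not-≡ (cambrianSubset-right S p<q)))
    ... | xs , [] , eq = xs , eq
    ... | xs , y ∷ ys , eq =
      ⊥-elim (nothing-after-q (subst (λ l → Before l q y) (sym eq) (before-++⁺ʳ xs (before-head (here refl)))))

    p-first : Σ (List ℕ) λ ys → inside ≡ p ∷ ys
    p-first with ∈-∃++ (∈-filter⁺ (T? ∘ A) (∈-range⁺ 1≤p (≤-trans (<⇒≤ p<q) q≤n)) (from T-≡ (cambrianSubset-left S p q)))
    ... | [] , ys , eq = ys , eq
    ... | x ∷ xs , ys , eq =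
      ⊥-elim (nothing-before-p (subst (λ l → Before l x p) (sym eq) (before-head (∈-++⁺ʳ xs (here refl)))))

    xs ys : List ℕ
    xs = proj₁ q-last
    ys = proj₁ p-first

  arc-split : δ ≡ xs ++ q ∷ p ∷ ys
  arc-split = begin
    outside ++ inside             ≡⟨ cong₂ _++_ (proj₂ q-last) (proj₂ p-first) ⟩
    (xs ++ q ∷ []) ++ p ∷ ys      ≡⟨ ++-assoc xs (q ∷ []) (p ∷ ys) ⟩
    xs ++ q ∷ p ∷ ys              ∎
    where open ≡-Reasoning

  private
    t : ℕ → ℕ
    t = transp p q

    unique-split : Unique (xs ++ q ∷ p ∷ ys)
    unique-split = subst Unique arc-split (perm-unique (keyed-isPerm arc-keyed))

    ∉pq-fixed : ∀ {zs} → (∀ {x} → x ∈ zs → x ≢ p) → (∀ {x} → x ∈ zs → x ≢ q) → All (λ x → t x ≡ x) zs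
    ∉pq-fixed ≢p ≢q = All.tabulate λ x∈ → transp-other (≢p x∈) (≢q x∈)

    xs-fixed : All (λ x → t x ≡ x) xs
    xs-fixed = ∉pq-fixed
      (λ { x∈ refl → before-irrefl unique-split (before-++⁺ x∈ (there (here refl))) })
      (λ { x∈ refl → before-irrefl unique-split (before-++⁺ x∈ (here refl)) })

    ys-fixed : All (λ x → t x ≡ x) ys
    ys-fixed = ∉pq-fixed
      (λ { x∈ refl → before-irrefl unique-split (before-++⁺ʳ xs (before-tail (before-head x∈))) })
      (λ { x∈ refl → before-irrefl unique-split (before-++⁺ʳ xs (before-head (there x∈))) })

  transp-arc : map t δ ≡ xs ++ p ∷ q ∷ ys
  transp-arc rewrite arc-split | map-++ t xs (q ∷ p ∷ ys) | map-id-local xs-fixed | map-id-local ys-fixed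
                   | transp-left p q | transp-right {p} {q} (<⇒≢ p<q) = refl

  arc-covers-transp : Covers n δ (map t δ)
  arc-covers-transp = subst₂ (Covers n) (sym arc-split) (sym transp-arc)
    (swap-descent-covered xs ys (subst (IsPerm n) arc-split (keyed-isPerm arc-keyed)) p<q)

  -- a ∈ A and c ∉ A, so neither (p, a) nor (c, q) is an inversion of δ, hence of x.
  lost-inversion⇒p-before-q : ∀ {x a c} → IsPerm n x → x ≤w δ → Inv δ a c → ¬ Inv x a c → Before x p q
  lost-inversion⇒p-before-q {x} {a} {c} px x≤δ iδ ¬ix = chain p-before-a c-before-q
    where
    zones-ac : T ((isP (zone a) ∨ isIA (zone a)) ∧ (isIN (zone c) ∨ isQ (zone c)))
    zones-ac = inv-zones (λ s t → (isP s ∨ isIA s) ∧ (isIN t ∨ isQ t)) zonesSatisfy-every arc-keyed tt iδ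
    a-zone : T (isP (zone a) ∨ isIA (zone a))
    a-zone = proj₁ (to (T-∧ {isP (zone a) ∨ isIA (zone a)}) zones-ac)
    c-zone : T (isIN (zone c) ∨ isQ (zone c))
    c-zone = proj₂ (to (T-∧ {isP (zone a) ∨ isIA (zone a)}) zones-ac)
    a<c = proj₁ iδ
    1≤a = proj₁ (inv-bounds (keyed-isPerm arc-keyed) iδ)
    c≤n = proj₂ (inv-bounds (keyed-isPerm arc-keyed) iδ)
    ux = perm-unique px
    a-before-c : Before x a c
    a-before-c = ¬inv⇒before px 1≤a a<c c≤n ¬ix
    p-before-a : a ≡ p ⊎ Before x p a
    p-before-a with a ≟ p | to (T-∨ {isP (zone a)}) a-zone
    ... | yes a≡p | _ = inj₁ a≡p
    ... | no a≢p | inj₁ Pa = ⊥-elim (a≢p (isP-at Pa))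
    ... | no a≢p | inj₂ IAa =
      inj₂ (¬inv⇒before px 1≤p (proj₁ (isIA-at IAa)) (≤-trans (<⇒≤ a<c) c≤n) (λ i → ¬inv-δ (x≤δ p a i)))
      where
      ¬inv-δ : ¬ Inv δ p a
      ¬inv-δ i = <-irrefl (trans (arcZones-A (zone a) a-zone) (sym (arcZones-A (zone p) isP-zone-p))) (keyed-inv⁻ arc-keyed i)
    c-before-q : c ≡ q ⊎ Before x c q
    c-before-q with c ≟ q | to (T-∨ {isIN (zone c)}) c-zone
    ... | yes c≡q | _ = inj₁ c≡q
    ... | no c≢q | inj₂ Qc = ⊥-elim (c≢q (isQ-at Qc))
    ... | no c≢q | inj₁ INc =
      inj₂ (¬inv⇒before px (≤-trans 1≤a (<⇒≤ a<c)) (proj₂ (isIN-at INc)) q≤n (λ i → ¬inv-δ (x≤δ c q i)))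
      where
      ¬inv-δ : ¬ Inv δ c q
      ¬inv-δ i = <-irrefl (trans (arcZones-∉A (zone q) isQ-zone-q) (sym (arcZones-∉A (zone c) c-zone))) (keyed-inv⁻ arc-keyed i)
    chain : a ≡ p ⊎ Before x p a → c ≡ q ⊎ Before x c q → Before x p q
    chain (inj₁ refl) (inj₁ refl) = a-before-c
    chain (inj₁ refl) (inj₂ c≺q) = before-trans ux a-before-c c≺q
    chain (inj₂ p≺a) (inj₁ refl) = before-trans ux p≺a a-before-c
    chain (inj₂ p≺a) (inj₂ c≺q) = before-trans ux (before-trans ux p≺a a-before-c) c≺q

  strictly-below-arc⇒≤arc* : ∀ {x} → IsPerm n x → x ≤w δ → ¬ (δ ≤w x) → x ≤w δ*
  strictly-below-arc⇒≤arc* px x≤δ δ≰x a c i with _ , _ , iδ , ¬ix ← ¬≤w⇒inv (keyed-isPerm arc-keyed) δ≰x =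
    inv-arc⇒inv-arc* (x≤δ a c i)
      λ { (refl , refl) → before-asym (perm-unique px) (lost-inversion⇒p-before-q px x≤δ iδ ¬ix) (proj₂ i) }

  lower-cover-unique : ∀ x → Covers n δ x → x ≡ δ*
  lower-cover-unique x (px , _ , x≤δ , δ≰x , interval)
    with interval δ* (keyed-isPerm arc*-keyed) (strictly-below-arc⇒≤arc* px x≤δ δ≰x) arc*≤arc
  ... | inj₁ δ*≡x = sym δ*≡x
  ... | inj₂ δ*≡δ = ⊥-elim (¬inv-arc*-pq (subst (λ l → Inv l p q) (sym δ*≡δ) (inv-arc-pq q≤n)))

  transp-arc≡arc* : map t δ ≡ δ*
  transp-arc≡arc* = lower-cover-unique (map t δ) arc-covers-transp

  arc-covers-arc* : Covers n δ δ*
  arc-covers-arc* = subst (Covers n δ) transp-arc≡arc* arc-covers-transp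

  arc-joinIrreducible : JoinIrreducible n δ
  arc-joinIrreducible = δ* , arc-covers-arc* , lower-cover-unique

  arc-leftReflection : LeftReflection n δ p q
  arc-leftReflection x cover = trans (lower-cover-unique x cover) (sym transp-arc≡arc*)

-- Contracting arcs with an interior point on the wrong side

xZonesₗ yZonesₗ eZonesₗ xZonesᵣ yZonesᵣ eZonesᵣ : Zone → ℕ
xZonesₗ Lo = 0
xZonesₗ IN = 0
xZonesₗ PA = 1
xZonesₗ PN = 1
xZonesₗ P0 = 2
xZonesₗ QA = 3
xZonesₗ QN = 3
xZonesₗ IA = 4
xZonesₗ Q1 = 4
xZonesₗ Hi = 4

yZonesₗ Lo = 0
yZonesₗ IN = 0
yZonesₗ QA = 1
yZonesₗ QN = 1
yZonesₗ PA = 2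
yZonesₗ PN = 2
yZonesₗ P0 = 3
yZonesₗ IA = 4
yZonesₗ Q1 = 4
yZonesₗ Hi = 4

eZonesₗ Lo = 0
eZonesₗ IN = 0
eZonesₗ P0 = 1
eZonesₗ PA = 2
eZonesₗ PN = 2
eZonesₗ QA = 3
eZonesₗ QN = 3
eZonesₗ IA = 4
eZonesₗ Q1 = 4
eZonesₗ Hi = 4

xZonesᵣ Lo = 0
xZonesᵣ P0 = 0
xZonesᵣ IN = 0
xZonesᵣ PA = 1
xZonesᵣ PN = 1
xZonesᵣ Q1 = 2
xZonesᵣ QA = 3
xZonesᵣ QN = 3
xZonesᵣ IA = 4
xZonesᵣ Hi = 4

yZonesᵣ Lo = 0
yZonesᵣ P0 = 0
yZonesᵣ IN = 0
yZonesᵣ Q1 = 1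
yZonesᵣ QA = 2
yZonesᵣ QN = 2
yZonesᵣ PA = 3
yZonesᵣ PN = 3
yZonesᵣ IA = 4
yZonesᵣ Hi = 4

eZonesᵣ Lo = 0
eZonesᵣ P0 = 0
eZonesᵣ IN = 0
eZonesᵣ PA = 1
eZonesᵣ PN = 1
eZonesᵣ QA = 2
eZonesᵣ QN = 2
eZonesᵣ Q1 = 3
eZonesᵣ IA = 4
eZonesᵣ Hi = 4

-- Contracting δ = arc (p, q) forces contracting γ = arc (p - 1, q). With x, y, e listing [n] by the keys
-- xZonesₗ, yZonesₗ, eZonesₗ: x = δ* ∨ x and y = δ ∨ x, so R relates x and y; if S p is false then
-- γ* = x ∧ γ and γ = y ∧ γ; if S p is true then e = x ∧ γ, γ = y ∧ γ, γ* = e ∨ δ and γ = γ ∨ δ.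
-- The same pattern with xZonesᵣ, yZonesᵣ, eZonesᵣ extends (p, q) to (p, q + 1).
module Forcing (n : ℕ) (R : Rel) (C : IsLatticeCongruence n R) where
  open IsLatticeCongruence C

  extend-left : ∀ p q S → 2 ≤ p → p < q → q ≤ n →
    R (arc* n p q S) (arc n p q S) → R (arc* n (p ∸ 1) q S) (arc n (p ∸ 1) q S)
  extend-left p q S 2≤p p<q q≤n R-δ = R-γ
    where
    1≤p : 1 ≤ p
    1≤p = ≤-trans (s≤s z≤n) 2≤p
    open Arcs n p q S 1≤p p<q
    x-keyed : ZoneKeyed (sortByZoneKey xZonesₗ) xZonesₗ
    x-keyed = sortByZoneKey-keyed xZonesₗ tt
    y-keyed : ZoneKeyed (sortByZoneKey yZonesₗ) yZonesₗ
    y-keyed = sortByZoneKey-keyed yZonesₗ tt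
    e-keyed : ZoneKeyed (sortByZoneKey eZonesₗ) eZonesₗ
    e-keyed = sortByZoneKey-keyed eZonesₗ tt
    x y e δ δ* γ γ* : List ℕ
    x = sortByZoneKey xZonesₗ
    y = sortByZoneKey yZonesₗ
    e = sortByZoneKey eZonesₗ
    δ = arc n p q S
    δ* = arc* n p q S
    γ = arc n (p ∸ 1) q S
    γ* = arc* n (p ∸ 1) q S
    inv-x : Inv x (p ∸ 1) p
    inv-x = keyed-inv⁺ x-keyed (∸-monoˡ-≤ 1 2≤p) p-1<p (≤-trans (<⇒≤ p<q) q≤n) descends
      where
      descends : xZonesₗ (zone p) < xZonesₗ (zone (p ∸ 1))
      descends rewrite zone-p | zone-p-1 with S p
      ... | true = s≤s (s≤s z≤n)
      ... | false = s≤s (s≤s z≤n)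
    inv-p-1-q : ∀ z a c → IsPerm n z → δ ≤w z → x ≤w z → 1 ≤ a → a < c → c ≤ n →
      T (isP0 (zone a) ∧ isQ (zone c)) → Inv z a c
    inv-p-1-q z a c pz δ≤z x≤z _ _ _ P0Q
      with refl ← isP0-at {a} (proj₁ (to (T-∧ {isP0 (zone a)}) P0Q)) | refl ← isQ-at {c} (proj₂ (to (T-∧ {isP0 (zone a)}) P0Q)) =
      inv-trans pz (x≤z _ _ inv-x) (δ≤z _ _ (inv-arc-pq q≤n))
    R-xy : R x y
    R-xy = join-compat δ* δ x x y (keyed-isPerm arc*-keyed) (keyed-isPerm arc-keyed) (keyed-isPerm x-keyed) R-δ
      (keyed-isJoin zonesSatisfy-every arc*-keyed x-keyed x-keyed tt tt tt)
      (keyed-isJoinWith (λ s t → isP0 s ∧ isQ t) zonesSatisfy-every arc-keyed x-keyed y-keyed inv-p-1-q tt tt tt)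
    R-γ : R γ* γ
    R-γ with S p in Sp
    ... | false = meet-compat x y γ γ* γ (keyed-isPerm x-keyed) (keyed-isPerm y-keyed) (keyed-isPerm arcₗ-keyed) R-xy
        (keyed-isMeet ok x-keyed arcₗ-keyed arc*ₗ-keyed tt tt tt) (keyed-isMeet ok y-keyed arcₗ-keyed arcₗ-keyed tt tt tt)
      where ok = zonesSatisfy-avoid PA λ { _ (vPA _ Sp′) → true≢false (trans (sym Sp′) Sp) }
    ... | true = join-compat e γ δ γ* γ (keyed-isPerm e-keyed) (keyed-isPerm arcₗ-keyed) (keyed-isPerm arc-keyed) R-eγ
        (keyed-isJoin ok e-keyed arc-keyed arc*ₗ-keyed tt tt tt) (keyed-isJoin ok arcₗ-keyed arc-keyed arcₗ-keyed tt tt tt)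
      where
      ok = zonesSatisfy-avoid PN λ { _ (vPN _ Sp′) → true≢false (trans (sym Sp) Sp′) }
      R-eγ : R e γ
      R-eγ = meet-compat x y γ e γ (keyed-isPerm x-keyed) (keyed-isPerm y-keyed) (keyed-isPerm arcₗ-keyed) R-xy
        (keyed-isMeet ok x-keyed arcₗ-keyed e-keyed tt tt tt) (keyed-isMeet ok y-keyed arcₗ-keyed arcₗ-keyed tt tt tt)

  extend-right : ∀ p q S → 1 ≤ p → p < q → suc q ≤ n →
    R (arc* n p q S) (arc n p q S) → R (arc* n p (suc q) S) (arc n p (suc q) S)
  extend-right p q S 1≤p p<q q+1≤n R-δ = R-γ
    where
    open Arcs n p q S 1≤p p<q
    q≤n : q ≤ n
    q≤n = ≤-trans (n≤1+n q) q+1≤n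
    x-keyed : ZoneKeyed (sortByZoneKey xZonesᵣ) xZonesᵣ
    x-keyed = sortByZoneKey-keyed xZonesᵣ tt
    y-keyed : ZoneKeyed (sortByZoneKey yZonesᵣ) yZonesᵣ
    y-keyed = sortByZoneKey-keyed yZonesᵣ tt
    e-keyed : ZoneKeyed (sortByZoneKey eZonesᵣ) eZonesᵣ
    e-keyed = sortByZoneKey-keyed eZonesᵣ tt
    x y e δ δ* γ γ* : List ℕ
    x = sortByZoneKey xZonesᵣ
    y = sortByZoneKey yZonesᵣ
    e = sortByZoneKey eZonesᵣ
    δ = arc n p q S
    δ* = arc* n p q S
    γ = arc n p (suc q) S
    γ* = arc* n p (suc q) S
    inv-x : Inv x q (suc q)
    inv-x = keyed-inv⁺ x-keyed (≤-trans 1≤p (<⇒≤ p<q)) q<q+1 q+1≤n descends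
      where
      descends : xZonesᵣ (zone (suc q)) < xZonesᵣ (zone q)
      descends rewrite zone-q | zone-q+1 with S q
      ... | true = s≤s (s≤s (s≤s z≤n))
      ... | false = s≤s (s≤s (s≤s z≤n))
    inv-p-q+1 : ∀ z a c → IsPerm n z → δ ≤w z → x ≤w z → 1 ≤ a → a < c → c ≤ n →
      T (isP (zone a) ∧ isQ1 (zone c)) → Inv z a c
    inv-p-q+1 z a c pz δ≤z x≤z _ _ _ PQ1
      with refl ← isP-at {a} (proj₁ (to (T-∧ {isP (zone a)}) PQ1)) | refl ← isQ1-at {c} (proj₂ (to (T-∧ {isP (zone a)}) PQ1)) =
      inv-trans pz (δ≤z _ _ (inv-arc-pq q≤n)) (x≤z _ _ inv-x)
    R-xy : R x y
    R-xy = join-compat δ* δ x x y (keyed-isPerm arc*-keyed) (keyed-isPerm arc-keyed) (keyed-isPerm x-keyed) R-δ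
      (keyed-isJoin zonesSatisfy-every arc*-keyed x-keyed x-keyed tt tt tt)
      (keyed-isJoinWith (λ s t → isP s ∧ isQ1 t) zonesSatisfy-every arc-keyed x-keyed y-keyed inv-p-q+1 tt tt tt)
    R-γ : R γ* γ
    R-γ with S q in Sq
    ... | true = meet-compat x y γ γ* γ (keyed-isPerm x-keyed) (keyed-isPerm y-keyed) (keyed-isPerm arcᵣ-keyed) R-xy
        (keyed-isMeet ok x-keyed arcᵣ-keyed arc*ᵣ-keyed tt tt tt) (keyed-isMeet ok y-keyed arcᵣ-keyed arcᵣ-keyed tt tt tt)
      where ok = zonesSatisfy-avoid QN λ { _ (vQN _ Sq′) → true≢false (trans (sym Sq) Sq′) }
    ... | false = join-compat e γ δ γ* γ (keyed-isPerm e-keyed) (keyed-isPerm arcᵣ-keyed) (keyed-isPerm arc-keyed) R-eγ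
        (keyed-isJoin ok e-keyed arc-keyed arc*ᵣ-keyed tt tt tt) (keyed-isJoin ok arcᵣ-keyed arc-keyed arcᵣ-keyed tt tt tt)
      where
      ok = zonesSatisfy-avoid QA λ { _ (vQA _ Sq′) → true≢false (trans (sym Sq′) Sq) }
      R-eγ : R e γ
      R-eγ = meet-compat x y γ e γ (keyed-isPerm x-keyed) (keyed-isPerm y-keyed) (keyed-isPerm arcᵣ-keyed) R-xy
        (keyed-isMeet ok x-keyed arcᵣ-keyed e-keyed tt tt tt) (keyed-isMeet ok y-keyed arcᵣ-keyed arcᵣ-keyed tt tt tt)

-- The generators of Θ(G⃗) identify arc (i, i + 2) with its lower cover, i + 1 lying on the side opposite its orientation.
module GeneratorArcs (n i : ℕ) (S : ℕ → Bool) (1≤i : 1 ≤ i) (i+2≤n : suc (suc i) ≤ n) where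
  private
    i<i+1 : i < suc i
    i<i+1 = n<1+n i
    i+1<i+2 : suc i < suc (suc i)
    i+1<i+2 = n<1+n (suc i)
    i<i+2 : i < suc (suc i)
    i<i+2 = <-trans i<i+1 i+1<i+2
    i+1≤n : suc i ≤ n
    i+1≤n = ≤-trans (n≤1+n (suc i)) i+2≤n
    1≤i+1 : 1 ≤ suc i
    1≤i+1 = s≤s z≤n
  open Arcs n i (suc (suc i)) S 1≤i i<i+2
  open Generators n i 1≤i i+2≤n

  private
    middle : ∀ {b} → i < b → b < suc (suc i) → b ≡ suc i
    middle i<b b<i+2 = ≤-antisym (≤-pred b<i+2) i<b

    zone-i+1 : zone (suc i) ≡ (if S (suc i) then IA else IN)
    zone-i+1 with zone (suc i) | view (suc i)
    ... | .IA | vIA _ _ S₁ rewrite S₁ = refl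
    ... | .IN | vIN _ _ S₁ rewrite S₁ = refl
    ... | .Lo | vLo i+1<i-1 = ⊥-elim (<-asym i+1<i-1 (<-trans p-1<p i<i+1))
    ... | .P0 | vP0 i+1≡i-1 = ⊥-elim (<⇒≢ (<-trans p-1<p i<i+1) (sym i+1≡i-1))
    ... | .PA | vPA i+1≡i _ = ⊥-elim (<⇒≢ i<i+1 (sym i+1≡i))
    ... | .PN | vPN i+1≡i _ = ⊥-elim (<⇒≢ i<i+1 (sym i+1≡i))
    ... | .QA | vQA i+1≡i+2 _ = ⊥-elim (<⇒≢ i+1<i+2 i+1≡i+2)
    ... | .QN | vQN i+1≡i+2 _ = ⊥-elim (<⇒≢ i+1<i+2 i+1≡i+2)
    ... | .Q1 | vQ1 i+1≡i+3 = ⊥-elim (<⇒≢ (<-trans i+1<i+2 (n<1+n _)) i+1≡i+3)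
    ... | .Hi | vHi i+3<i+1 = ⊥-elim (<-asym i+3<i+1 (<-trans i+1<i+2 (n<1+n _)))

    avoid-IA : S (suc i) ≡ false → ZonesSatisfy (λ t → not (t ==ᶻ IA))
    avoid-IA S₁ = zonesSatisfy-avoid IA λ { _ (vIA i<b b<i+2 Sb) →
      true≢false (trans (sym Sb) (trans (cong S (middle i<b b<i+2)) S₁)) }

    avoid-IN : S (suc i) ≡ true → ZonesSatisfy (λ t → not (t ==ᶻ IN))
    avoid-IN S₁ = zonesSatisfy-avoid IN λ { _ (vIN i<b b<i+2 Sb) →
      true≢false (trans (sym S₁) (trans (cong S (sym (middle i<b b<i+2))) Sb)) }

    isIN-middle : ∀ {b} → T (isIN (zone b)) → b ≡ suc i
    isIN-middle t = middle (proj₁ (isIN-at t)) (proj₂ (isIN-at t))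

    isIA-middle : ∀ {b} → T (isIA (zone b)) → b ≡ suc i
    isIA-middle t = middle (proj₁ (isIA-at t)) (proj₂ (isIA-at t))

    isP-or-IA-at : ∀ {b} → T (isP (zone b) ∨ isIA (zone b)) → b ≡ i ⊎ b ≡ suc i
    isP-or-IA-at {b} P∨IA with to (T-∨ {isP (zone b)}) P∨IA
    ... | inj₁ t = inj₁ (isP-at t)
    ... | inj₂ t = inj₂ (isIA-middle t)

    isIN-or-Q-at : ∀ {b} → T (isIN (zone b) ∨ isQ (zone b)) → b ≡ suc i ⊎ b ≡ suc (suc i)
    isIN-or-Q-at {b} IN∨Q with to (T-∨ {isIN (zone b)}) IN∨Q
    ... | inj₁ t = inj₁ (isIN-middle t)
    ... | inj₂ t = inj₂ (isQ-at t)

  sᵢ≡arc* : S (suc i) ≡ false → sr n i ≡ arc* n i (suc (suc i)) S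
  sᵢ≡arc* S₁ = ≤w-antisym sᵢ-isPerm (keyed-isPerm arc*-keyed) sᵢ≤ ≤sᵢ
    where
    sᵢ≤ : sr n i ≤w arc* n i (suc (suc i)) S
    sᵢ≤ a c inv with refl , refl ← inv-sᵢ⁻ inv =
      keyed-inv⁺ arc*-keyed 1≤i i<i+1 i+1≤n (subst (_< arc*Zones (zone i)) (sym key) (subst (0 <_) (sym arc*-key-p) (s≤s z≤n)))
      where
      key : arc*Zones (zone (suc i)) ≡ 0
      key rewrite zone-i+1 | S₁ = refl
    ≤sᵢ : arc* n i (suc (suc i)) S ≤w sr n i
    ≤sᵢ a c inv with PIN ← inv-zones (λ s t → isP s ∧ isIN t) (avoid-IA S₁) arc*-keyed tt inv
      with refl ← isP-at {a} (proj₁ (to (T-∧ {isP (zone a)}) PIN)) | refl ← isIN-middle {c} (proj₂ (to (T-∧ {isP (zone a)}) PIN)) =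
      inv-sᵢ⁺

  sᵢsᵢ₊₁≡arc : S (suc i) ≡ false → sr2 n i (suc i) ≡ arc n i (suc (suc i)) S
  sᵢsᵢ₊₁≡arc S₁ = ≤w-antisym sᵢsᵢ₊₁-isPerm (keyed-isPerm arc-keyed) ≤arc arc≤
    where
    ≤arc : sr2 n i (suc i) ≤w arc n i (suc (suc i)) S
    ≤arc a c inv with refl , c≡ ← inv-sᵢsᵢ₊₁⁻ inv with c≡
    ... | inj₂ refl = inv-arc-pq i+2≤n
    ... | inj₁ refl = keyed-inv⁺ arc-keyed 1≤i i<i+1 i+1≤n (subst₂ _<_ (sym key) (sym arc-key-p) (s≤s z≤n))
      where
      key : indicator (arcZones (zone (suc i))) ≡ 0
      key rewrite zone-i+1 | S₁ = refl
    arc≤ : arc n i (suc (suc i)) S ≤w sr2 n i (suc i)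
    arc≤ a c inv with PINQ ← inv-zones (λ s t → isP s ∧ (isIN t ∨ isQ t)) (avoid-IA S₁) arc-keyed tt inv
      with refl ← isP-at {a} (proj₁ (to (T-∧ {isP (zone a)}) PINQ)) =
      inv-sᵢsᵢ₊₁⁺ (isIN-or-Q-at {c} (proj₂ (to (T-∧ {isP (zone a)}) PINQ)))

  sᵢ₊₁≡arc* : S (suc i) ≡ true → sr n (suc i) ≡ arc* n i (suc (suc i)) S
  sᵢ₊₁≡arc* S₁ = ≤w-antisym sᵢ₊₁-isPerm (keyed-isPerm arc*-keyed) sᵢ₊₁≤ ≤sᵢ₊₁
    where
    sᵢ₊₁≤ : sr n (suc i) ≤w arc* n i (suc (suc i)) S
    sᵢ₊₁≤ a c inv with refl , refl ← inv-sᵢ₊₁⁻ inv =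
      keyed-inv⁺ arc*-keyed 1≤i+1 i+1<i+2 i+2≤n (subst₂ _<_ (sym arc*-key-q) (sym key) (s≤s (s≤s (s≤s z≤n))))
      where
      key : arc*Zones (zone (suc i)) ≡ 3
      key rewrite zone-i+1 | S₁ = refl
    ≤sᵢ₊₁ : arc* n i (suc (suc i)) S ≤w sr n (suc i)
    ≤sᵢ₊₁ a c inv with IAQ ← inv-zones (λ s t → isIA s ∧ isQ t) (avoid-IN S₁) arc*-keyed tt inv
      with refl ← isIA-middle {a} (proj₁ (to (T-∧ {isIA (zone a)}) IAQ)) | refl ← isQ-at {c} (proj₂ (to (T-∧ {isIA (zone a)}) IAQ)) =
      inv-sᵢ₊₁⁺

  sᵢ₊₁sᵢ≡arc : S (suc i) ≡ true → sr2 n (suc i) i ≡ arc n i (suc (suc i)) S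
  sᵢ₊₁sᵢ≡arc S₁ = ≤w-antisym sᵢ₊₁sᵢ-isPerm (keyed-isPerm arc-keyed) ≤arc arc≤
    where
    ≤arc : sr2 n (suc i) i ≤w arc n i (suc (suc i)) S
    ≤arc a c inv with a≡ , refl ← inv-sᵢ₊₁sᵢ⁻ inv with a≡
    ... | inj₁ refl = inv-arc-pq i+2≤n
    ... | inj₂ refl = keyed-inv⁺ arc-keyed 1≤i+1 i+1<i+2 i+2≤n (subst₂ _<_ (sym arc-key-q) (sym key) (s≤s z≤n))
      where
      key : indicator (arcZones (zone (suc i))) ≡ 1
      key rewrite zone-i+1 | S₁ = refl
    arc≤ : arc n i (suc (suc i)) S ≤w sr2 n (suc i) i
    arc≤ a c inv with PIAQ ← inv-zones (λ s t → (isP s ∨ isIA s) ∧ isQ t) (avoid-IN S₁) arc-keyed tt inv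
      with refl ← isQ-at {c} (proj₂ (to (T-∧ {isP (zone a) ∨ isIA (zone a)}) PIAQ)) =
      inv-sᵢ₊₁sᵢ⁺ (isP-or-IA-at {a} (proj₁ (to (T-∧ {isP (zone a) ∨ isIA (zone a)}) PIAQ)))

WrongSide : Orientation → (ℕ → Bool) → ℕ → Set
WrongSide o S b = (o b ≡ true × S b ≡ false) ⊎ (o b ≡ false × S b ≡ true)

module Contraction (n : ℕ) (o : Orientation) (R : Rel) (C : IsLatticeCongruence n R)
                   (Gen⊆R : ∀ u v → Gen n o u v → R u v) where
  open Forcing n R C

  generator-arc : ∀ i S → 1 ≤ i → suc (suc i) ≤ n → WrongSide o S (suc i) →
    R (arc* n i (suc (suc i)) S) (arc n i (suc (suc i)) S)
  generator-arc i S 1≤i i+2≤n (inj₁ (up , S₁)) =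
    subst₂ R (sᵢ≡arc* S₁) (sᵢsᵢ₊₁≡arc S₁) (Gen⊆R _ _ (gen-up (suc i) (s≤s 1≤i) (∸-monoˡ-≤ 1 i+2≤n) up))
    where open GeneratorArcs n i S 1≤i i+2≤n
  generator-arc i S 1≤i i+2≤n (inj₂ (down , S₁)) =
    subst₂ R (sᵢ₊₁≡arc* S₁) (sᵢ₊₁sᵢ≡arc S₁) (Gen⊆R _ _ (gen-down (suc i) (s≤s 1≤i) (∸-monoˡ-≤ 1 i+2≤n) down))
    where open GeneratorArcs n i S 1≤i i+2≤n

  extend-left-by : ∀ {q S} k p → 1 ≤ p → suc (p + k) < q → q ≤ n →
    R (arc* n (p + k) q S) (arc n (p + k) q S) → R (arc* n p q S) (arc n p q S)
  extend-left-by {q} {S} zero p _ _ _ R-arc = subst (λ p′ → R (arc* n p′ q S) (arc n p′ q S)) (+-identityʳ p) R-arc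
  extend-left-by {q} {S} (suc k) p 1≤p p+k+2<q q≤n R-arc =
    extend-left (suc p) q S (s≤s 1≤p) (≤-trans (s≤s (m<m+n p (s≤s z≤n))) (<⇒≤ p+k+2<q)) q≤n
      (extend-left-by k (suc p) (s≤s z≤n) (subst (λ j → suc j < q) (+-suc p k) p+k+2<q) q≤n
        (subst (λ p′ → R (arc* n p′ q S) (arc n p′ q S)) (+-suc p k) R-arc))

  extend-right-by : ∀ {p q S} k → 1 ≤ p → p < q → q + k ≤ n →
    R (arc* n p q S) (arc n p q S) → R (arc* n p (q + k) S) (arc n p (q + k) S)
  extend-right-by {p} {q} {S} zero _ _ _ R-arc = subst (λ q′ → R (arc* n p q′ S) (arc n p q′ S)) (sym (+-identityʳ q)) R-arc
  extend-right-by {p} {q} {S} (suc k) 1≤p p<q q+k+1≤n R-arc =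
    subst (λ q′ → R (arc* n p q′ S) (arc n p q′ S)) (sym (+-suc q k))
      (extend-right p (q + k) S 1≤p (≤-trans p<q (m≤m+n q k)) (subst (_≤ n) (+-suc q k) q+k+1≤n)
        (extend-right-by k 1≤p p<q (≤-trans (+-monoʳ-≤ q (n≤1+n k)) q+k+1≤n) R-arc))

  -- Grow the generating arc (b - 1, b + 1) to (m, M), one endpoint step at a time.
  wrong-side-contracted : ∀ m M S b → 1 ≤ m → m < b → b < M → M ≤ n → WrongSide o S b →
    R (arc* n m M S) (arc n m M S)
  wrong-side-contracted m M S (suc i) 1≤m m<b b<M M≤n wrong =
    subst (λ q → R (arc* n m q S) (arc n m q S)) (m+[n∸m]≡n b<M)
      (extend-right-by (M ∸ suc (suc i)) 1≤m m<i+2 (subst (_≤ n) (sym (m+[n∸m]≡n b<M)) M≤n)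
        (extend-left-by (i ∸ m) m 1≤m (subst (λ j → suc j < suc (suc i)) (sym (m+[n∸m]≡n m≤i)) ≤-refl) i+2≤n
          (subst (λ p → R (arc* n p (suc (suc i)) S) (arc n p (suc (suc i)) S)) (sym (m+[n∸m]≡n m≤i))
            (generator-arc i S (≤-trans 1≤m m≤i) i+2≤n wrong))))
    where
    m≤i : m ≤ i
    m≤i = ≤-pred m<b
    m<i+2 : m < suc (suc i)
    m<i+2 = s≤s (≤-trans m≤i (n≤1+n i))
    i+2≤n : suc (suc i) ≤ n
    i+2≤n = ≤-trans b<M M≤n

-- Inversions of joins

filter-outside-↭ : ∀ {p q} (l : List ℕ) → p < q → (∀ {d} → d ∈ l → q < d ⊎ d < p) →
  filter (q <?_) l ++ filter (_<? p) l ↭ l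
filter-outside-↭ [] _ _ = ↭-refl
filter-outside-↭ {p} {q} (d ∷ l) p<q outside with q <ᵇ d in q<ᵇd | d <ᵇ p in d<ᵇp
... | true | true =
  ⊥-elim (<-asym (<ᵇ⇒< q d (Equivalence.from Bool.T-≡ q<ᵇd)) (<-trans (<ᵇ⇒< d p (Equivalence.from Bool.T-≡ d<ᵇp)) p<q))
... | true | false = ↭-prep d (filter-outside-↭ l p<q (outside ∘ there))
... | false | true =
  ↭-trans (↭ₚ.shift d (filter (q <?_) l) (filter (_<? p) l)) (↭-prep d (filter-outside-↭ l p<q (outside ∘ there)))
... | false | false with outside (here refl)
...   | inj₁ q<d = ⊥-elim (true≢false (trans (sym (Equivalence.to Bool.T-≡ (<⇒<ᵇ q<d))) q<ᵇd))
...   | inj₂ d<p = ⊥-elim (true≢false (trans (sym (Equivalence.to Bool.T-≡ (<⇒<ᵇ d<p))) d<ᵇp))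

before-replace-segment : ∀ (pre X X′ post : List ℕ) {c a} → (∀ {y} → y ∈ X → y ∈ X′) → (Before X c a → Before X′ c a) →
  Before (pre ++ X ++ post) c a → Before (pre ++ X′ ++ post) c a
before-replace-segment pre X X′ post X⊆X′ X⇒X′ h with before-++⁻ pre h
... | inj₁ h₁ = before-++⁺ˡ h₁
... | inj₂ (inj₁ (c∈ , a∈)) with ∈-++⁻ X a∈
...   | inj₁ a∈X = before-++⁺ {pre} c∈ (∈-++⁺ˡ (X⊆X′ a∈X))
...   | inj₂ a∈post = before-++⁺ {pre} c∈ (∈-++⁺ʳ X′ a∈post)
before-replace-segment pre X X′ post X⊆X′ X⇒X′ h | inj₂ (inj₂ h₂) with before-++⁻ X h₂
... | inj₁ h₃ = before-++⁺ʳ pre (before-++⁺ˡ (X⇒X′ h₃))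
... | inj₂ (inj₁ (c∈ , a∈)) = before-++⁺ʳ pre (before-++⁺ {X′} (X⊆X′ c∈) a∈)
... | inj₂ (inj₂ h₄) = before-++⁺ʳ pre (before-++⁺ʳ X′ h₄)

-- The segment q … p rearranged as (mid ∩ (q, ∞)) p q (mid ∩ [0, p)): it keeps every inversion except (p, q).
uncross : ℕ → ℕ → List ℕ → List ℕ
uncross p q mid = filter (q <?_) mid ++ p ∷ q ∷ filter (_<? p) mid

module _ {p q : ℕ} (mid : List ℕ) (p<q : p < q) (outside : ∀ {d} → d ∈ mid → q < d ⊎ d < p) where

  uncross-↭ : uncross p q mid ↭ q ∷ mid ++ [ p ]
  uncross-↭ = ↭-trans (↭ₚ.shifts (filter (q <?_) mid) (p ∷ q ∷ []))
    (↭-trans (↭.swap p q ↭-refl)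
      (↭-prep q (↭-trans (↭-prep p (filter-outside-↭ mid p<q outside))
        (↭-sym (subst (λ l → mid ++ [ p ] ↭ p ∷ l) (++-identityʳ mid) (↭ₚ.shift p mid []))))))

  uncross-before : ∀ {c a} → a < c → ¬ (a ≡ p × c ≡ q) → Before (q ∷ mid ++ [ p ]) c a → Before (uncross p q mid) c a
  uncross-before {c} {a} a<c ≢pq h with before-∷⁻ h
  ... | inj₁ (refl , a∈) with ∈-++⁻ mid a∈
  ...   | inj₂ (here refl) = ⊥-elim (≢pq (refl , refl))
  ...   | inj₁ a∈mid with outside a∈mid
  ...     | inj₁ q<a = ⊥-elim (<-asym a<c q<a)
  ...     | inj₂ a<p = before-++⁺ʳ (filter (q <?_) mid) (before-tail (before-head (∈-filter⁺ (_<? p) a∈mid a<p)))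
  uncross-before {c} {a} a<c ≢pq h | inj₂ h′ with before-++⁻ mid h′
  ... | inj₂ (inj₂ h″) with before-∷⁻ h″
  ...   | inj₁ (_ , ())
  ...   | inj₂ h‴ = ⊥-elim (before-[] h‴)
  uncross-before {c} {a} a<c ≢pq h | inj₂ h′ | inj₂ (inj₁ (c∈ , here refl)) with outside c∈
  ... | inj₁ q<c = before-++⁺ (∈-filter⁺ (q <?_) c∈ q<c) (here refl)
  ... | inj₂ c<p = ⊥-elim (<-asym a<c c<p)
  uncross-before {c} {a} a<c ≢pq h | inj₂ h′ | inj₁ h-mid with outside (before⇒∈ˡ h-mid) | outside (before⇒∈ʳ h-mid)
  ... | inj₁ q<c | inj₁ q<a = before-++⁺ˡ (before-filter⁺ (q <?_) h-mid q<c q<a)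
  ... | inj₁ q<c | inj₂ a<p =
    before-++⁺ (∈-filter⁺ (q <?_) (before⇒∈ˡ h-mid) q<c) (there (there (∈-filter⁺ (_<? p) (before⇒∈ʳ h-mid) a<p)))
  ... | inj₂ c<p | inj₂ a<p =
    before-++⁺ʳ (filter (q <?_) mid) (before-tail (before-tail (before-filter⁺ (_<? p) h-mid c<p a<p)))
  ... | inj₂ c<p | inj₁ q<a = ⊥-elim (<-asym a<c (<-trans c<p (<-trans p<q q<a)))

remove-inversion : ∀ {n} pre mid post {p q} → IsPerm n (pre ++ q ∷ mid ++ p ∷ post) → p < q →
  (∀ {d} → d ∈ mid → q < d ⊎ d < p) →
  ∃ λ u → IsPerm n u × Before u p q ×
    (∀ {a c} → Inv (pre ++ q ∷ mid ++ p ∷ post) a c → ¬ (a ≡ p × c ≡ q) → Inv u a c)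
remove-inversion {n} pre mid post {p} {q} pw p<q outside = pre ++ uncross p q mid ++ post , pu , p≺q , keep
  where
  w≡ : pre ++ q ∷ mid ++ p ∷ post ≡ pre ++ (q ∷ mid ++ [ p ]) ++ post
  w≡ = cong (λ l → pre ++ q ∷ l) (sym (++-assoc mid [ p ] post))
  pu : IsPerm n (pre ++ uncross p q mid ++ post)
  pu = ↭-trans (↭ₚ.++⁺ˡ pre (↭ₚ.++⁺ʳ post (uncross-↭ mid p<q outside))) (subst (_↭ range n) w≡ pw)
  p≺q : Before (pre ++ uncross p q mid ++ post) p q
  p≺q = before-++⁺ʳ pre (before-++⁺ˡ (before-++⁺ʳ (filter (q <?_) mid) (before-head (here refl))))
  keep : ∀ {a c} → Inv (pre ++ q ∷ mid ++ p ∷ post) a c → ¬ (a ≡ p × c ≡ q) → Inv (pre ++ uncross p q mid ++ post) a c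
  keep (a<c , h) ≢pq = a<c , before-replace-segment pre (q ∷ mid ++ [ p ]) (uncross p q mid) post
    (↭ₚ.∈-resp-↭ (↭-sym (uncross-↭ mid p<q outside))) (uncross-before mid p<q outside a<c ≢pq) (subst (λ l → Before l _ _) w≡ h)

join-inversion-splits : ∀ {n x z J} → IsPerm n J → IsJoin n x z J → ∀ {p q} → Inv J p q →
  Inv x p q ⊎ Inv z p q ⊎ ∃ λ d → p < d × d < q × Inv J p d × Inv J d q
join-inversion-splits {n} {x} {z} {J} pJ (_ , x≤J , z≤J , least) {p} {q} (p<q , pre , mid , post , J≡)
  with inv? x p q | inv? z p q | any? (λ d → (p <? d) ×-dec (d <? q)) mid
... | yes ix | _ | _ = inj₁ ix
... | no _ | yes iz | _ = inj₂ (inj₁ iz)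
... | no _ | no _ | yes between with d , d∈ , p<d , d<q ← find between =
  inj₂ (inj₂ (d , p<d , d<q , (p<d , d≺p) , (d<q , q≺d)))
  where
  d≺p : Before J d p
  d≺p = subst (λ l → Before l d p) (sym J≡) (before-++⁺ʳ pre (before-tail (before-++⁺ d∈ (here refl))))
  q≺d : Before J q d
  q≺d = subst (λ l → Before l q d) (sym J≡) (before-++⁺ʳ pre (before-head (∈-++⁺ˡ d∈)))
... | no ¬ix | no ¬iz | no none with remove-inversion pre mid post (subst (IsPerm n) J≡ pJ) p<q outside
  where
  outside : ∀ {d} → d ∈ mid → q < d ⊎ d < p
  outside {d} d∈ with <-cmp d p | <-cmp d q
  ... | tri< d<p _ _ | _ = inj₂ d<p
  ... | tri≈ _ refl _ | _ = ⊥-elim (before-irrefl (perm-unique pJ)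
        (subst (λ l → Before l d d) (sym J≡) (before-++⁺ʳ pre (before-tail (before-++⁺ d∈ (here refl))))))
  ... | tri> _ _ _ | tri≈ _ refl _ = ⊥-elim (before-irrefl (perm-unique pJ)
        (subst (λ l → Before l d d) (sym J≡) (before-++⁺ʳ pre (before-head (∈-++⁺ˡ d∈)))))
  ... | tri> _ _ _ | tri> _ _ q<d = inj₁ q<d
  ... | tri> _ _ p<d | tri< d<q _ _ = ⊥-elim (none (lose d∈ (p<d , d<q)))
... | u , pu , p≺q , keep = ⊥-elim (before-asym (perm-unique pu) p≺q (proj₂ (least u pu x≤u z≤u p q (p<q , q≺p))))
  where
  q≺p : Before J q p
  q≺p = pre , mid , post , J≡
  x≤u : x ≤w u
  x≤u a c i = keep (subst (λ l → Inv l a c) J≡ (x≤J a c i)) λ { (refl , refl) → ¬ix i }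
  z≤u : z ≤w u
  z≤u a c i = keep (subst (λ l → Inv l a c) J≡ (z≤J a c i)) λ { (refl , refl) → ¬iz i }

-- The congruence separating Cambrian arcs

module CambrianCongruence (n : ℕ) (o : Orientation) where

  -- For the Cambrian arc (p, q) with A = cambrianSubset o p q: InA p q = A ∩ [p, q), OutA p q = (p, q] \ A.
  InA OutA : ℕ → ℕ → ℕ → Set
  InA p q a = a ≡ p ⊎ (p < a × a < q × o a ≡ true)
  OutA p q c = c ≡ q ⊎ (p < c × c < q × o c ≡ false)

  InA? : ∀ p q a → Dec (InA p q a)
  InA? p q a = (a ≟ p) ⊎-dec ((p <? a) ×-dec ((a <? q) ×-dec (o a Bool.≟ true)))

  OutA? : ∀ p q c → Dec (OutA p q c)
  OutA? p q c = (c ≟ q) ⊎-dec ((p <? c) ×-dec ((c <? q) ×-dec (o c Bool.≟ false)))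

  AboveArc : ℕ → ℕ → List ℕ → Set
  AboveArc p q w = ∀ a c → a < c → InA p q a → OutA p q c → Inv w a c

  aboveArc-mono : ∀ {p q w w′} → AboveArc p q w → w ≤w w′ → AboveArc p q w′
  aboveArc-mono above w≤w′ a c a<c a∈ c∈ = w≤w′ a c (above a c a<c a∈ c∈)

  InA-≥ : ∀ {p q a} → InA p q a → p ≤ a
  InA-≥ (inj₁ refl) = ≤-refl
  InA-≥ (inj₂ (p<a , _ , _)) = <⇒≤ p<a

  OutA-≤ : ∀ {p q c} → OutA p q c → c ≤ q
  OutA-≤ (inj₁ refl) = ≤-refl
  OutA-≤ (inj₂ (_ , c<q , _)) = <⇒≤ c<q

  InA-narrowʳ : ∀ {p q r a} → InA p q a → a < r → InA p r a
  InA-narrowʳ (inj₁ a≡p) _ = inj₁ a≡p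
  InA-narrowʳ (inj₂ (p<a , _ , up)) a<r = inj₂ (p<a , a<r , up)

  InA-narrowˡ : ∀ {p q r a} → InA p q a → p < r → r < a → InA r q a
  InA-narrowˡ (inj₁ refl) p<r r<a = ⊥-elim (<-asym p<r r<a)
  InA-narrowˡ (inj₂ (_ , a<q , up)) _ r<a = inj₂ (r<a , a<q , up)

  InA-widenʳ : ∀ {p q r a} → InA p r a → r < q → InA p q a
  InA-widenʳ (inj₁ a≡p) _ = inj₁ a≡p
  InA-widenʳ (inj₂ (p<a , a<r , up)) r<q = inj₂ (p<a , <-trans a<r r<q , up)

  InA-widenˡ : ∀ {p q r a} → InA r q a → p < r → r < q → o r ≡ true → InA p q a
  InA-widenˡ (inj₁ refl) p<r r<q up = inj₂ (p<r , r<q , up)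
  InA-widenˡ (inj₂ (r<a , a<q , up)) p<r _ _ = inj₂ (<-trans p<r r<a , a<q , up)

  OutA-widenˡ : ∀ {p q r c} → OutA r q c → p < r → OutA p q c
  OutA-widenˡ (inj₁ c≡q) _ = inj₁ c≡q
  OutA-widenˡ (inj₂ (r<c , c<q , down)) p<r = inj₂ (<-trans p<r r<c , c<q , down)

  OutA-widenʳ : ∀ {p q r c} → OutA p r c → p < r → r < q → o r ≡ false → OutA p q c
  OutA-widenʳ (inj₁ refl) p<r r<q down = inj₂ (p<r , r<q , down)
  OutA-widenʳ (inj₂ (p<c , c<r , down)) _ r<q _ = inj₂ (p<c , <-trans c<r r<q , down)

  OutA-narrowˡ : ∀ {p q r c} → OutA p q c → r < c → OutA r q c
  OutA-narrowˡ (inj₁ c≡q) _ = inj₁ c≡q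
  OutA-narrowˡ (inj₂ (_ , c<q , down)) r<c = inj₂ (r<c , c<q , down)

  OutA-narrowʳ : ∀ {p q r c} → OutA p q c → c < r → r < q → OutA p r c
  OutA-narrowʳ (inj₁ refl) c<r r<q = ⊥-elim (<-asym c<r r<q)
  OutA-narrowʳ (inj₂ (p<c , _ , down)) c<r _ = inj₂ (p<c , c<r , down)

  down-∉InA : ∀ {p q r} → o r ≡ false → p < r → ¬ InA p q r
  down-∉InA _ p<r (inj₁ refl) = <-irrefl refl p<r
  down-∉InA down _ (inj₂ (_ , _ , up)) = true≢false (trans (sym up) down)

  InA⇒∈A : ∀ {p q a} → InA p q a → cambrianSubset o p q a ≡ true
  InA⇒∈A {p} {q} (inj₁ refl) = cambrianSubset-left o p q
  InA⇒∈A (inj₂ (p<a , a<q , up)) = trans (cambrianSubset-inside o p<a a<q) up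

  OutA⇒∉A : ∀ {p q c} → p < q → OutA p q c → cambrianSubset o p q c ≡ false
  OutA⇒∉A p<q (inj₁ refl) = cambrianSubset-right o p<q
  OutA⇒∉A _ (inj₂ (p<c , c<q , down)) = trans (cambrianSubset-inside o p<c c<q) down

  arc≤⇒aboveArc : ∀ {p q w} → 1 ≤ p → p < q → q ≤ n → arc n p q o ≤w w → AboveArc p q w
  arc≤⇒aboveArc {p} {q} 1≤p p<q q≤n arc≤w a c a<c a∈ c∈ = arc≤w a c
    (inv-permOfSubset⁺ n (cambrianSubset o p q) (≤-trans 1≤p (InA-≥ a∈)) a<c (≤-trans (OutA-≤ c∈) q≤n)
      (InA⇒∈A a∈) (OutA⇒∉A p<q c∈))

  aboveArc⇒arc≤ : ∀ {p q w} → p < q → AboveArc p q w → arc n p q o ≤w w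
  aboveArc⇒arc≤ {p} {q} p<q above a c i with (_ , a<c , _) , a∈A , c∉A ← inv-permOfSubset⁻ n (cambrianSubset o p q) i =
    above a c a<c a∈ c∈
    where
    ∉A : ∀ b → cambrianSubset o p q b ≡ true → cambrianSubset o p q b ≡ false → ⊥
    ∉A _ b∈ b∉ = true≢false (trans (sym b∈) b∉)
    a∈ : InA p q a
    a∈ with <-cmp a p
    ... | tri< a<p _ _ = ⊥-elim (∉A a a∈A (cambrianSubset-below o a<p p<q))
    ... | tri≈ _ a≡p _ = inj₁ a≡p
    ... | tri> _ _ p<a with <-cmp a q
    ...   | tri< a<q _ _ = inj₂ (p<a , a<q , trans (sym (cambrianSubset-inside o p<a a<q)) a∈A)
    ...   | tri≈ _ refl _ = ⊥-elim (∉A a a∈A (cambrianSubset-right o p<q))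
    ...   | tri> _ _ q<a = ⊥-elim (∉A c (cambrianSubset-above o (<-trans q<a a<c) p<q) c∉A)
    c∈ : OutA p q c
    c∈ with <-cmp c q
    ... | tri< c<q _ _ = inj₂ (p<c , c<q , trans (sym (cambrianSubset-inside o p<c c<q)) c∉A)
      where p<c = ≤-<-trans (InA-≥ a∈) a<c
    ... | tri≈ _ c≡q _ = inj₁ c≡q
    ... | tri> _ _ q<c = ⊥-elim (∉A c (cambrianSubset-above o q<c p<q) c∉A)

  aboveArc-concat : ∀ {p r q w} → IsPerm n w → p < r → r < q → AboveArc p r w → AboveArc r q w → AboveArc p q w
  aboveArc-concat {p} {r} {q} pw p<r r<q above₁ above₂ a c a<c a∈ c∈ with o r in or | <-cmp a r | <-cmp c r
  ... | _ | tri< a<r _ _ | tri< c<r _ _ = above₁ a c a<c (InA-narrowʳ a∈ a<r) (OutA-narrowʳ c∈ c<r r<q)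
  ... | _ | tri< a<r _ _ | tri≈ _ refl _ = above₁ a r a<c (InA-narrowʳ a∈ a<r) (inj₁ refl)
  ... | _ | tri< a<r _ _ | tri> _ _ r<c =
    inv-trans pw (above₁ a r a<r (InA-narrowʳ a∈ a<r) (inj₁ refl)) (above₂ r c r<c (inj₁ refl) (OutA-narrowˡ c∈ r<c))
  ... | true | tri≈ _ refl _ | tri> _ _ r<c = above₂ r c r<c (inj₁ refl) (OutA-narrowˡ c∈ r<c)
  ... | false | tri≈ _ refl _ | _ = ⊥-elim (down-∉InA or p<r a∈)
  ... | _ | tri≈ _ refl _ | tri< c<r _ _ = ⊥-elim (<-asym a<c c<r)
  ... | _ | tri≈ _ refl _ | tri≈ _ refl _ = ⊥-elim (<-irrefl refl a<c)
  ... | _ | tri> _ _ r<a | _ = above₂ a c a<c (InA-narrowˡ a∈ p<r r<a) (OutA-narrowˡ c∈ (<-trans r<a a<c))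

  module JoinAboveArc {x z J : List ℕ} (px : IsPerm n x) (pz : IsPerm n z) (pJ : IsPerm n J) (join : IsJoin n x z J)
                      {p q : ℕ} (1≤p : 1 ≤ p) (p<q : p < q) (q≤n : q ≤ n) (above-J : AboveArc p q J) where

    SplitsUp SplitsDown : ℕ → Set
    SplitsUp r = p < r × o r ≡ true × (∀ {a} → a < r → InA p q a → Inv J a r)
    SplitsDown r = p < r × o r ≡ false × (∀ {c} → c < suc q → r < c → OutA p q c → Inv J r c)

    splitsUp? : ∀ r → Dec (SplitsUp r)
    splitsUp? r = (p <? r) ×-dec ((o r Bool.≟ true) ×-dec allUpTo? (λ a → InA? p q a →-dec inv? J a r) r)

    splitsDown? : ∀ r → Dec (SplitsDown r)
    splitsDown? r = (p <? r) ×-dec ((o r Bool.≟ false) ×-dec allUpTo? (λ c → (r <? c) →-dec (OutA? p q c →-dec inv? J r c)) (suc q))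

    split-up : ∀ {r} → r < q → SplitsUp r → AboveArc p r J × AboveArc r q J
    split-up {r} r<q (p<r , up , r-inv) = left , right
      where
      left : AboveArc p r J
      left a c a<c a∈ (inj₁ refl) = r-inv a<c (InA-widenʳ a∈ r<q)
      left a c a<c a∈ (inj₂ (p<c , c<r , down)) = above-J a c a<c (InA-widenʳ a∈ r<q) (inj₂ (p<c , <-trans c<r r<q , down))
      right : AboveArc r q J
      right a c a<c a∈ c∈ = above-J a c a<c (InA-widenˡ a∈ p<r r<q up) (OutA-widenˡ c∈ p<r)

    split-down : ∀ {r} → r < q → SplitsDown r → AboveArc p r J × AboveArc r q J
    split-down {r} r<q (p<r , down , r-inv) = left , right
      where
      left : AboveArc p r J
      left a c a<c a∈ c∈ = above-J a c a<c (InA-widenʳ a∈ r<q) (OutA-widenʳ c∈ p<r r<q down)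
      right : AboveArc r q J
      right a c a<c (inj₁ refl) c∈ = r-inv (s≤s (OutA-≤ c∈)) a<c (OutA-widenˡ c∈ p<r)
      right a c a<c (inj₂ (r<a , a<q , up)) c∈ = above-J a c a<c (inj₂ (<-trans p<r r<a , a<q , up)) (OutA-widenˡ c∈ p<r)

    module NoSplit (no-up : ∀ {r} → r < q → ¬ SplitsUp r) (no-down : ∀ {r} → r < q → ¬ SplitsDown r) where

      ¬inv-p-up : ∀ e → p < e → e < q → o e ≡ true → ¬ Inv J p e
      ¬inv-p-up = <-rec (λ e → p < e → e < q → o e ≡ true → ¬ Inv J p e) step
        where
        step : ∀ e → (∀ {a} → a < e → p < a → a < q → o a ≡ true → ¬ Inv J p a) →
          p < e → e < q → o e ≡ true → ¬ Inv J p e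
        step e rec p<e e<q up inv-pe with anyUpTo? (λ a → InA? p q a ×-dec ¬? (inv? J a e)) e
        ... | no none = no-up e<q (p<e , up , λ {a} a<e a∈ → decidable-stable (inv? J a e) λ ¬i → none (a , a<e , a∈ , ¬i))
        ... | yes (_ , _ , inj₁ refl , ¬inv) = ¬inv inv-pe
        ... | yes (a , a<e , inj₂ (p<a , a<q , up-a) , ¬inv) =
          rec a<e p<a a<q up-a (p<a , before-trans (perm-unique pJ) a≺e (proj₂ inv-pe))
          where a≺e = ¬inv⇒before pJ (≤-trans 1≤p (<⇒≤ p<a)) a<e (≤-trans (<⇒≤ e<q) q≤n) ¬inv

      ¬inv-down-q : ∀ e → p < e → e < q → o e ≡ false → ¬ Inv J e q
      ¬inv-down-q e = <-rec (λ d → ∀ e → q ∸ e ≡ d → p < e → e < q → o e ≡ false → ¬ Inv J e q) step (q ∸ e) e refl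
        where
        step : ∀ d → (∀ {d′} → d′ < d → ∀ e → q ∸ e ≡ d′ → p < e → e < q → o e ≡ false → ¬ Inv J e q) →
          ∀ e → q ∸ e ≡ d → p < e → e < q → o e ≡ false → ¬ Inv J e q
        step d rec e refl p<e e<q down inv-eq with anyUpTo? (λ c → (e <? c) ×-dec (OutA? p q c ×-dec ¬? (inv? J e c))) (suc q)
        ... | no none = no-down e<q (p<e , down , λ {c} c<q+1 e<c c∈ →
              decidable-stable (inv? J e c) λ ¬i → none (c , c<q+1 , e<c , c∈ , ¬i))
        ... | yes (_ , _ , _ , inj₁ refl , ¬inv) = ¬inv inv-eq
        ... | yes (c , _ , e<c , inj₂ (p<c , c<q , down-c) , ¬inv) =
          rec (∸-monoʳ-< e<c (<⇒≤ c<q)) c refl p<c c<q down-c (c<q , before-trans (perm-unique pJ) (proj₂ inv-eq) e≺c)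
          where e≺c = ¬inv⇒before pJ (≤-trans 1≤p (<⇒≤ p<e)) e<c (≤-trans (<⇒≤ c<q) q≤n) ¬inv

      inv-pq⇒aboveArc : ∀ {y} → IsPerm n y → y ≤w J → Inv y p q → AboveArc p q y
      inv-pq⇒aboveArc {y} py y≤J (_ , q≺p) a c a<c a∈ c∈ = a<c , c≺a
        where
        uy = perm-unique py
        p≼ : ∀ {b} → InA p q b → b ≡ p ⊎ Before y p b
        p≼ (inj₁ b≡p) = inj₁ b≡p
        p≼ (inj₂ (p<b , b<q , up)) =
          inj₂ (¬inv⇒before py 1≤p p<b (≤-trans (<⇒≤ b<q) q≤n) (¬inv-p-up _ p<b b<q up ∘ y≤J p _))
        ≼q : ∀ {b} → OutA p q b → b ≡ q ⊎ Before y b q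
        ≼q (inj₁ b≡q) = inj₁ b≡q
        ≼q (inj₂ (p<b , b<q , down)) =
          inj₂ (¬inv⇒before py (≤-trans 1≤p (<⇒≤ p<b)) b<q q≤n (¬inv-down-q _ p<b b<q down ∘ y≤J _ q))
        c≺p : Before y c p
        c≺p with ≼q c∈
        ... | inj₁ refl = q≺p
        ... | inj₂ c≺q = before-trans uy c≺q q≺p
        c≺a : Before y c a
        c≺a with p≼ a∈
        ... | inj₁ refl = c≺p
        ... | inj₂ p≺a = before-trans uy c≺p p≺a

      x-or-z-aboveArc : AboveArc p q x ⊎ AboveArc p q z
      x-or-z-aboveArc with join-inversion-splits pJ join (above-J p q p<q (inj₁ refl) (inj₁ refl))
      ... | inj₁ ix = inj₁ (inv-pq⇒aboveArc px (proj₁ (proj₂ join)) ix)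
      ... | inj₂ (inj₁ iz) = inj₂ (inv-pq⇒aboveArc pz (proj₁ (proj₂ (proj₂ join))) iz)
      ... | inj₂ (inj₂ (d , p<d , d<q , inv-pd , inv-dq)) with o d in od
      ...   | true = ⊥-elim (¬inv-p-up d p<d d<q od inv-pd)
      ...   | false = ⊥-elim (¬inv-down-q d p<d d<q od inv-dq)

    aboveArc-join : AboveArc p q x ⊎ AboveArc p q z ⊎ ∃ λ r → p < r × r < q × AboveArc p r J × AboveArc r q J
    aboveArc-join with anyUpTo? splitsUp? q
    ... | yes (r , r<q , splits) = inj₂ (inj₂ (r , proj₁ splits , r<q , split-up r<q splits))
    ... | no no-up with anyUpTo? splitsDown? q
    ...   | yes (r , r<q , splits) = inj₂ (inj₂ (r , proj₁ splits , r<q , split-down r<q splits))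
    ...   | no no-down with NoSplit.x-or-z-aboveArc (λ r<q s → no-up (_ , r<q , s)) (λ r<q s → no-down (_ , r<q , s))
    ...     | inj₁ above-x = inj₁ above-x
    ...     | inj₂ above-z = inj₂ (inj₁ above-z)

  SameArcs : Rel
  SameArcs x y = ∀ p q → 1 ≤ p → p < q → q ≤ n →
    (arc n p q o ≤w x → arc n p q o ≤w y) × (arc n p q o ≤w y → arc n p q o ≤w x)

  sameArcs-sym : ∀ {x y} → SameArcs x y → SameArcs y x
  sameArcs-sym same p q 1≤p p<q q≤n = proj₂ (same p q 1≤p p<q q≤n) , proj₁ (same p q 1≤p p<q q≤n)

  -- Induction on the length k of the arc: a join either inherits the arc from a joinand or splits it in two.
  aboveArc-join-compat : ∀ {x y z j₁ j₂} → IsPerm n x → IsPerm n y → IsPerm n z → SameArcs x y →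
    IsJoin n x z j₁ → IsJoin n y z j₂ →
    ∀ k p q → 1 ≤ p → p < q → q ≤ n → q ≤ p + k → AboveArc p q j₁ → AboveArc p q j₂
  aboveArc-join-compat _ _ _ _ _ _ zero p q _ p<q _ q≤p+0 _ = ⊥-elim (<-irrefl refl (<-≤-trans p<q (subst (q ≤_) (+-identityʳ p) q≤p+0)))
  aboveArc-join-compat {x} {y} {z} {j₁} {j₂} px py pz same join₁ join₂ (suc k) p q 1≤p p<q q≤n q≤p+k+1 above
    with JoinAboveArc.aboveArc-join px pz (proj₁ join₁) join₁ 1≤p p<q q≤n above
  ... | inj₁ above-x =
    aboveArc-mono (arc≤⇒aboveArc 1≤p p<q q≤n (proj₁ (same p q 1≤p p<q q≤n) (aboveArc⇒arc≤ p<q above-x))) (proj₁ (proj₂ join₂))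
  ... | inj₂ (inj₁ above-z) = aboveArc-mono above-z (proj₁ (proj₂ (proj₂ join₂)))
  ... | inj₂ (inj₂ (r , p<r , r<q , above-pr , above-rq)) =
    aboveArc-concat (proj₁ join₂) p<r r<q
      (aboveArc-join-compat px py pz same join₁ join₂ k p r 1≤p p<r (≤-trans (<⇒≤ r<q) q≤n)
        (≤-pred (≤-trans r<q q≤p+k+1′)) above-pr)
      (aboveArc-join-compat px py pz same join₁ join₂ k r q (≤-trans 1≤p (<⇒≤ p<r)) r<q q≤n
        (≤-trans q≤p+k+1′ (+-monoˡ-≤ k p<r)) above-rq)
    where
    q≤p+k+1′ : q ≤ suc (p + k)
    q≤p+k+1′ = subst (q ≤_) (+-suc p k) q≤p+k+1

  sameArcs-isLatticeCongruence : IsLatticeCongruence n SameArcs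
  sameArcs-isLatticeCongruence = record
    { refl′ = λ _ _ _ _ _ _ _ → (λ le → le) , (λ le → le)
    ; sym′ = λ _ _ → sameArcs-sym
    ; trans′ = λ _ _ _ same₁ same₂ p q 1≤p p<q q≤n →
        (proj₁ (same₂ p q 1≤p p<q q≤n) ∘ proj₁ (same₁ p q 1≤p p<q q≤n)) ,
        (proj₂ (same₁ p q 1≤p p<q q≤n) ∘ proj₂ (same₂ p q 1≤p p<q q≤n))
    ; join-compat = λ x y z j₁ j₂ px py pz same join₁ join₂ p q 1≤p p<q q≤n →
        (λ le → aboveArc⇒arc≤ p<q (aboveArc-join-compat px py pz same join₁ join₂ q p q 1≤p p<q q≤n (m≤n+m q p)
                  (arc≤⇒aboveArc 1≤p p<q q≤n le))) ,
        (λ le → aboveArc⇒arc≤ p<q (aboveArc-join-compat py px pz (sameArcs-sym same) join₂ join₁ q p q 1≤p p<q q≤n (m≤n+m q p)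
                  (arc≤⇒aboveArc 1≤p p<q q≤n le)))
    ; meet-compat = λ x y z j₁ j₂ px py pz same meet₁ meet₂ p q 1≤p p<q q≤n →
        meet-step same meet₁ meet₂ p q 1≤p p<q q≤n , meet-step (sameArcs-sym same) meet₂ meet₁ p q 1≤p p<q q≤n
    }
    where
    meet-step : ∀ {x y z j₁ j₂} → SameArcs x y → IsMeet n x z j₁ → IsMeet n y z j₂ →
      ∀ p q → 1 ≤ p → p < q → q ≤ n → arc n p q o ≤w j₁ → arc n p q o ≤w j₂
    meet-step same (_ , j₁≤x , j₁≤z , _) (_ , _ , _ , greatest) p q 1≤p p<q q≤n arc≤j₁ =
      greatest (arc n p q o) (permOfSubset-isPerm n (cambrianSubset o p q))
        (proj₁ (same p q 1≤p p<q q≤n) (≤w-trans arc≤j₁ j₁≤x)) (≤w-trans arc≤j₁ j₁≤z)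

  arc≤⇒inv-pq : ∀ {p q w} → 1 ≤ p → p < q → q ≤ n → arc n p q o ≤w w → Inv w p q
  arc≤⇒inv-pq {p} {q} 1≤p p<q q≤n arc≤w = arc≤⇒aboveArc 1≤p p<q q≤n arc≤w p q p<q (inj₁ refl) (inj₁ refl)

  InA-adjacent : ∀ {p a} → InA p (suc p) a → a ≡ p
  InA-adjacent (inj₁ a≡p) = a≡p
  InA-adjacent (inj₂ (p<a , a<p+1 , _)) = ⊥-elim (<-irrefl refl (<-≤-trans p<a (≤-pred a<p+1)))

  OutA-adjacent : ∀ {p c} → OutA p (suc p) c → c ≡ suc p
  OutA-adjacent (inj₁ c≡p+1) = c≡p+1
  OutA-adjacent (inj₂ (p<c , c<p+1 , _)) = ⊥-elim (<-irrefl refl (<-≤-trans p<c (≤-pred c<p+1)))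

  inv⇒adjacent-arc≤ : ∀ {i w} → Inv w i (suc i) → arc n i (suc i) o ≤w w
  inv⇒adjacent-arc≤ {i} {w} inv = aboveArc⇒arc≤ (n<1+n i) λ a c _ a∈ c∈ →
    subst₂ (Inv w) (sym (InA-adjacent a∈)) (sym (OutA-adjacent c∈)) inv

  Gen⊆SameArcs : ∀ u v → Gen n o u v → SameArcs u v
  Gen⊆SameArcs _ _ (gen-up (suc i) (s≤s 1≤i) i+1≤n-1 up) p q 1≤p p<q q≤n =
    (λ arc≤sᵢ → from-sᵢ (inv-pq arc≤sᵢ)) ,
    (λ arc≤sᵢsᵢ₊₁ → from-sᵢsᵢ₊₁ arc≤sᵢsᵢ₊₁ (inv-pq arc≤sᵢsᵢ₊₁))
    where
    open Generators n i 1≤i (pred-cancel-< i+1≤n-1)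
    inv-pq : ∀ {w} → arc n p q o ≤w w → Inv w p q
    inv-pq = arc≤⇒inv-pq 1≤p p<q q≤n
    from-sᵢ : Inv (sr n i) p q → arc n p q o ≤w sr2 n i (suc i)
    from-sᵢ inv with refl , refl ← inv-sᵢ⁻ inv = inv⇒adjacent-arc≤ (inv-sᵢsᵢ₊₁⁺ (inj₁ refl))
    from-sᵢsᵢ₊₁ : arc n p q o ≤w sr2 n i (suc i) → Inv (sr2 n i (suc i)) p q → arc n p q o ≤w sr n i
    from-sᵢsᵢ₊₁ arc≤ inv with inv-sᵢsᵢ₊₁⁻ inv
    ... | refl , inj₁ refl = inv⇒adjacent-arc≤ inv-sᵢ⁺
    ... | refl , inj₂ refl = ⊥-elim (<-irrefl (sym (proj₁ (inv-sᵢsᵢ₊₁⁻ inv-middle))) (n<1+n i))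
      where inv-middle = arc≤⇒aboveArc 1≤p p<q q≤n arc≤ (suc i) q (n<1+n _) (inj₂ (n<1+n i , n<1+n _ , up)) (inj₁ refl)
  Gen⊆SameArcs _ _ (gen-down (suc i) (s≤s 1≤i) i+1≤n-1 down) p q 1≤p p<q q≤n =
    (λ arc≤sᵢ₊₁ → from-sᵢ₊₁ (inv-pq arc≤sᵢ₊₁)) ,
    (λ arc≤sᵢ₊₁sᵢ → from-sᵢ₊₁sᵢ arc≤sᵢ₊₁sᵢ (inv-pq arc≤sᵢ₊₁sᵢ))
    where
    open Generators n i 1≤i (pred-cancel-< i+1≤n-1)
    inv-pq : ∀ {w} → arc n p q o ≤w w → Inv w p q
    inv-pq = arc≤⇒inv-pq 1≤p p<q q≤n
    from-sᵢ₊₁ : Inv (sr n (suc i)) p q → arc n p q o ≤w sr2 n (suc i) i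
    from-sᵢ₊₁ inv with refl , refl ← inv-sᵢ₊₁⁻ inv = inv⇒adjacent-arc≤ (inv-sᵢ₊₁sᵢ⁺ (inj₂ refl))
    from-sᵢ₊₁sᵢ : arc n p q o ≤w sr2 n (suc i) i → Inv (sr2 n (suc i) i) p q → arc n p q o ≤w sr n (suc i)
    from-sᵢ₊₁sᵢ arc≤ inv with inv-sᵢ₊₁sᵢ⁻ inv
    ... | inj₂ refl , refl = inv⇒adjacent-arc≤ inv-sᵢ₊₁⁺
    ... | inj₁ refl , refl = ⊥-elim (<-irrefl (proj₂ (inv-sᵢ₊₁sᵢ⁻ inv-middle)) (n<1+n (suc i)))
      where inv-middle = arc≤⇒aboveArc 1≤p p<q q≤n arc≤ p (suc i) (n<1+n i) (inj₁ refl) (inj₂ (n<1+n i , n<1+n _ , down))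

-- Join-irreducibles with a given left reflection

++-cancel-equal-length : ∀ (xs ys : List ℕ) {u v} → length xs ≡ length ys → xs ++ u ≡ ys ++ v → u ≡ v
++-cancel-equal-length [] [] _ eq = eq
++-cancel-equal-length (x ∷ xs) (y ∷ ys) len eq = ++-cancel-equal-length xs ys (suc-injective len) (proj₂ (∷-injective eq))

module LeftReflectionShape (n m M : ℕ) (1≤m : 1 ≤ m) (m<M : m < M) (M≤n : M ≤ n) (xs ys : List ℕ)
    (pγ : IsPerm n (xs ++ m ∷ ys)) (ji : JoinIrreducible n (xs ++ m ∷ ys)) (lr : LeftReflection n (xs ++ m ∷ ys) m M) where

  private
    γ : List ℕ
    γ = xs ++ m ∷ ys
    uγ = perm-unique pγ
    t : ℕ → ℕ
    t = transp m M

  tγ≤γ : map t γ ≤w γ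
  tγ≤γ = subst (_≤w γ) (lr _ (proj₁ (proj₂ ji))) (proj₁ (proj₂ (proj₂ (proj₁ (proj₂ ji)))))

  descent-swapped : ∀ us {u v} vs → γ ≡ us ++ u ∷ v ∷ vs → v < u → v ≡ t u
  descent-swapped us {u} {v} vs γ≡ v<u =
    proj₁ (∷-injective (++-cancel-equal-length us (map t us) (sym (length-map t us)) swapped≡tγ))
    where
    swapped≡tγ : us ++ v ∷ u ∷ vs ≡ map t us ++ t u ∷ t v ∷ map t vs
    swapped≡tγ = trans (lr _ (subst (λ l → Covers n l (us ++ v ∷ u ∷ vs)) (sym γ≡)
                        (swap-descent-covered us vs (subst (IsPerm n) γ≡ pγ) v<u)))
                      (trans (cong (map t) γ≡) (map-++ t us (u ∷ v ∷ vs)))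

  descent : ∀ us {u v} vs → γ ≡ us ++ u ∷ v ∷ vs → v < u → u ≡ M × v ≡ m
  descent us {u} {v} vs γ≡ v<u with u ≟ m | u ≟ M | descent-swapped us vs γ≡ v<u
  ... | yes refl | _ | v≡tu = ⊥-elim (<-asym v<u (subst (u <_) (trans (sym (transp-left u M)) (sym v≡tu)) m<M))
  ... | no _ | yes refl | v≡tu = refl , trans v≡tu (transp-right (<⇒≢ m<M))
  ... | no u≢m | no u≢M | v≡tu = ⊥-elim (<-irrefl (trans v≡tu (transp-other u≢m u≢M)) v<u)

  m∉xs : m ∉ xs
  m∉xs m∈ = before-irrefl uγ (before-++⁺ m∈ (here refl))

  m∉ys : m ∉ ys
  m∉ys m∈ = before-irrefl uγ (before-++⁺ʳ xs (before-head m∈))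

  ascent-unless-m : ∀ us {u v} vs → γ ≡ us ++ u ∷ v ∷ vs → v ≢ m → u < v
  ascent-unless-m us {u} {v} vs γ≡ v≢m with <-cmp u v
  ... | tri< u<v _ _ = u<v
  ... | tri≈ _ refl _ = ⊥-elim (before-irrefl uγ (subst (λ l → Before l u u) (sym γ≡) (before-++⁺ʳ us (before-head (here refl)))))
  ... | tri> _ _ v<u = ⊥-elim (v≢m (proj₂ (descent us vs γ≡ v<u)))

  xs-increasing : Increasing xs
  xs-increasing = increasing-adjacent xs λ us u v vs xs≡ →
    ascent-unless-m us (vs ++ m ∷ ys) (trans (cong (_++ m ∷ ys) xs≡) (++-assoc us (u ∷ v ∷ vs) (m ∷ ys)))
      λ { refl → m∉xs (subst (v ∈_) (sym xs≡) (∈-++⁺ʳ us (there (here refl)))) }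

  m∷ys-increasing : Increasing (m ∷ ys)
  m∷ys-increasing = increasing-adjacent (m ∷ ys) λ us u v vs m∷ys≡ →
    ascent-unless-m (xs ++ us) vs (trans (cong (xs ++_) m∷ys≡) (sym (++-assoc xs us (u ∷ v ∷ vs))))
      λ { refl → m∉ys (second-in-ys us m∷ys≡) }
    where
    second-in-ys : ∀ us {u v vs} → m ∷ ys ≡ us ++ u ∷ v ∷ vs → v ∈ ys
    second-in-ys [] m∷ys≡ = subst (_ ∈_) (sym (proj₂ (∷-injective m∷ys≡))) (here refl)
    second-in-ys (_ ∷ us) m∷ys≡ = subst (_ ∈_) (sym (proj₂ (∷-injective m∷ys≡))) (∈-++⁺ʳ us (there (here refl)))

  inv⇒sides : ∀ {a c} → Inv γ a c → a ∈ m ∷ ys × c ∈ xs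
  inv⇒sides (a<c , h) with before-++⁻ xs h
  ... | inj₁ h-xs = ⊥-elim (<-asym a<c (increasing-before⇒< xs-increasing h-xs))
  ... | inj₂ (inj₁ (c∈ , a∈)) = a∈ , c∈
  ... | inj₂ (inj₂ h-ys) = ⊥-elim (<-asym a<c (increasing-before⇒< m∷ys-increasing h-ys))

  A : ℕ → Bool
  A b = does (b ∈? m ∷ ys)

  A-true : ∀ {b} → b ∈ m ∷ ys → A b ≡ true
  A-true {b} = dec-true (b ∈? m ∷ ys)

  A-false : ∀ {b} → b ∉ m ∷ ys → A b ≡ false
  A-false {b} = dec-false (b ∈? m ∷ ys)

  xs∩m∷ys=∅ : ∀ {b} → b ∈ xs → b ∉ m ∷ ys
  xs∩m∷ys=∅ b∈xs b∈ = before-irrefl uγ (before-++⁺ b∈xs b∈)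

  γ≡permOfSubset : γ ≡ permOfSubset n A
  γ≡permOfSubset = ≤w-antisym pγ (permOfSubset-isPerm n A) γ≤ ≤γ
    where
    γ≤ : γ ≤w permOfSubset n A
    γ≤ a c i with a∈ , c∈ ← inv⇒sides i =
      inv-permOfSubset⁺ n A (proj₁ (inv-bounds pγ i)) (proj₁ i) (proj₂ (inv-bounds pγ i)) (A-true a∈) (A-false (xs∩m∷ys=∅ c∈))
    ≤γ : permOfSubset n A ≤w γ
    ≤γ a c i with (1≤a , a<c , c≤n) , Aa , Ac ← inv-permOfSubset⁻ n A i
      with ∈-++⁻ xs (perm-∈⁺ pγ (≤-trans 1≤a (<⇒≤ a<c)) c≤n)
    ... | inj₂ c∈ = ⊥-elim (true≢false (trans (sym (A-true c∈)) Ac))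
    ... | inj₁ c∈ with a ∈? m ∷ ys
    ...   | yes a∈ = a<c , before-++⁺ c∈ a∈
    ...   | no a∉ = ⊥-elim (true≢false (trans (sym Aa) (A-false a∉)))

  inv-mM : Inv γ m M
  inv-mM with inv? γ m M
  ... | yes i = i
  ... | no ¬i = ⊥-elim (¬i (tγ≤γ m M (m<M , subst₂ (Before (map t γ)) (transp-left m M) (transp-right (<⇒≢ m<M))
                                              (before-map⁺ t (¬inv⇒before pγ 1≤m m<M M≤n ¬i)))))

  M∈xs : M ∈ xs
  M∈xs = proj₂ (inv⇒sides inv-mM)

  A-below : ∀ {b} → b < m → A b ≡ false
  A-below b<m = A-false λ
    { (here refl) → <-irrefl refl b<m
    ; (there b∈ys) → <-asym b<m (All.lookup (AllPairs.head m∷ys-increasing) b∈ys) }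

  A-above : ∀ {b} → M < b → b ≤ n → A b ≡ true
  A-above {b} M<b b≤n with ∈-++⁻ xs (perm-∈⁺ pγ (≤-trans 1≤m (<⇒≤ (<-trans m<M M<b))) b≤n)
  ... | inj₂ b∈ = A-true b∈
  ... | inj₁ b∈xs = ⊥-elim (before-asym uγ M≺b (proj₂ (tγ≤γ M b (M<b , b≺M-in-tγ))))
    where
    M≺b : Before γ M b
    M≺b = before-++⁺ˡ (increasing-<⇒before xs-increasing M∈xs b∈xs M<b)
    b≺M-in-tγ : Before (map t γ) b M
    b≺M-in-tγ = subst₂ (Before (map t γ)) (transp-other (≢-sym (<⇒≢ (<-trans m<M M<b))) (≢-sym (<⇒≢ M<b))) (transp-left m M)
                  (before-map⁺ t (before-++⁺ b∈xs (here refl)))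

  γ≡arc : γ ≡ arc n m M A
  γ≡arc = trans γ≡permOfSubset (permOfSubset-cong n A≡)
    where
    A≡ : ∀ k → 1 ≤ k → k ≤ n → A k ≡ cambrianSubset A m M k
    A≡ k _ k≤n with <-cmp k m
    ... | tri< k<m _ _ = trans (A-below k<m) (sym (cambrianSubset-below A k<m m<M))
    ... | tri≈ _ refl _ = trans (A-true (here refl)) (sym (cambrianSubset-left A k M))
    ... | tri> _ _ m<k with <-cmp k M
    ...   | tri< k<M _ _ = sym (cambrianSubset-inside A m<k k<M)
    ...   | tri≈ _ refl _ = trans (A-false (xs∩m∷ys=∅ M∈xs)) (sym (cambrianSubset-right A m<M))
    ...   | tri> _ _ M<k = trans (A-above M<k k≤n) (sym (cambrianSubset-above A M<k m<M))

leftReflection⇒arc : ∀ {n m M γ} → 1 ≤ m → m < M → M ≤ n → IsPerm n γ → JoinIrreducible n γ → LeftReflection n γ m M →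
  Σ (ℕ → Bool) λ S → γ ≡ arc n m M S
leftReflection⇒arc {n} {m} {M} 1≤m m<M M≤n pγ ji lr
  with xs , ys , refl ← ∈-∃++ (perm-∈⁺ pγ 1≤m (≤-trans (<⇒≤ m<M) M≤n)) =
  _ , LeftReflectionShape.γ≡arc n m M 1≤m m<M M≤n xs ys pγ ji lr

wrong-side⇒contracted : ∀ {n o m M S b} → 1 ≤ m → m < b → b < M → M ≤ n → WrongSide o S b → Contracted n o (arc n m M S)
wrong-side⇒contracted {n} {o} {m} {M} {S} {b} 1≤m m<b b<M M≤n wrong =
  arc* n m M S , ArcCover.arc-covers-arc* n m M S 1≤m (<-trans m<b b<M) M≤n ,
  λ R C Gen⊆R → IsLatticeCongruence.sym′ C _ _ (Contraction.wrong-side-contracted n o R C Gen⊆R m M S b 1≤m m<b b<M M≤n wrong)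

uncontracted-arc-cambrian : ∀ {n o m M S} → 1 ≤ m → m < M → M ≤ n → ¬ Contracted n o (arc n m M S) →
  arc n m M S ≡ arc n m M o
uncontracted-arc-cambrian {n} {o} {m} {M} {S} 1≤m m<M M≤n ¬contracted =
  permOfSubset-cong n λ k _ _ → cambrianSubset-cong S≗o k
  where
  S≗o : ∀ b → m < b → b < M → S b ≡ o b
  S≗o b m<b b<M with S b in Sb | o b in ob
  ... | true | true = refl
  ... | false | false = refl
  ... | false | true = ⊥-elim (¬contracted (wrong-side⇒contracted 1≤m m<b b<M M≤n (inj₁ (ob , Sb))))
  ... | true | false = ⊥-elim (¬contracted (wrong-side⇒contracted 1≤m m<b b<M M≤n (inj₂ (ob , Sb))))

cambrian-arc-uncontracted : ∀ {n o m M} → 1 ≤ m → m < M → M ≤ n → ¬ Contracted n o (arc n m M o)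
cambrian-arc-uncontracted {n} {o} {m} {M} 1≤m m<M M≤n (γ* , cover , θ) =
  ¬inv-arc*-pq (subst (λ l → Inv l m M) (lower-cover-unique γ* cover) (arc≤⇒inv-pq 1≤m m<M M≤n arc≤γ*))
  where
  open ArcCover n m M o 1≤m m<M M≤n
  open CambrianCongruence n o
  arc≤γ* : arc n m M o ≤w γ*
  arc≤γ* = proj₁ (θ SameArcs sameArcs-isLatticeCongruence Gen⊆SameArcs m M 1≤m m<M M≤n) ≤w-refl

proposition6p7 : (n : ℕ) (o : Orientation) (m M : ℕ) → 1 ≤ m → m < M → M ≤ n →
    (IsPerm n (permOfSubset n (cambrianSubset o m M)) ×
     JoinIrreducible n (permOfSubset n (cambrianSubset o m M)) ×
     ¬ Contracted n o (permOfSubset n (cambrianSubset o m M)) ×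
     LeftReflection n (permOfSubset n (cambrianSubset o m M)) m M) ×
    ((γ : List ℕ) → IsPerm n γ → JoinIrreducible n γ → ¬ Contracted n o γ →
      LeftReflection n γ m M → γ ≡ permOfSubset n (cambrianSubset o m M))
proposition6p7 n o m M 1≤m m<M M≤n =
  (permOfSubset-isPerm n (cambrianSubset o m M) , arc-joinIrreducible , cambrian-arc-uncontracted 1≤m m<M M≤n , arc-leftReflection) ,
  unique
  where
  open ArcCover n m M o 1≤m m<M M≤n
  unique : (γ : List ℕ) → IsPerm n γ → JoinIrreducible n γ → ¬ Contracted n o γ →
    LeftReflection n γ m M → γ ≡ permOfSubset n (cambrianSubset o m M)
  unique γ pγ ji ¬contracted lr with S , refl ← leftReflection⇒arc 1≤m m<M M≤n pγ ji lr =
    uncontracted-arc-cambrian 1≤m m<M M≤n ¬contracted
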